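{- Let $G$ be a vertex-transitive nut graph with $o_e(G) = o_a(G) = k$. Let $\mathcal{E}$ be an edge orbit of $G$ (an orbit of $\mathrm{Aut}\,G$ on $E(G)$), let $t$ be a positive integer, and let $G_1$ be the graph obtained from $G$ by subdividing each edge of $\mathcal{E}$ exactly $4t$ times (i.e., replacing each edge $uv \in \mathcal{E}$ by a $(u,v)$-path of length $4t+1$ whose $4t$ internal vertices are new vertices of degree two). Then $G_1$ is a nut graph with $o_v(G_1) = 2t + 1$, $o_e(G_1) = 2t + k$ and $o_a(G_1) = 4t + k$.
   Context: All graphs are finite, simple and undirected. A nut graph is a graph with at least two vertices whose adjacency matrix has a one-dimensional null space spanned by a vector with no zero entries. For a graph $G$, $o_v(G)$, $o_e(G)$ and $o_a(G)$ denote the number of orbits of the automorphism group $\mathrm{Aut}\,G$ on the vertex set, on the edge set, and on the arc set (ordered pairs $(u,v)$ of adjacent vertices), respectively. -}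

module Defs where

open import Data.Nat using (ℕ; zero; suc; _+_; _*_; _∸_; _<_; _≤_; _≡ᵇ_)
import Data.Fin as Fin
open import Data.Fin using (Fin; toℕ; splitAt; remQuot)
open import Data.Fin.Permutation using (Permutation′; _⟨$⟩ʳ_)
open import Data.Bool using (Bool; true; false; _∧_; _∨_; not; T; if_then_else_)
open import Data.Product using (Σ; ∃; _×_; _,_; proj₁; proj₂)
open import Data.Sum using (_⊎_; inj₁; inj₂)
open import Data.Rational using (ℚ; 0ℚ) renaming (_+_ to _+ℚ_; _*_ to _*ℚ_)
open import Relation.Binary.PropositionalEquality using (_≡_; _≢_)
open import Function using (Surjective; _⇔_)

record Graph : Set where
  field
    n   : ℕ
    adj : Fin n → Fin n → Bool
open Graph public

IsSimple : Graph → Set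
IsSimple G = (∀ u v → adj G u v ≡ adj G v u) × (∀ v → adj G v v ≡ false)

IsAut : (G : Graph) → Permutation′ (n G) → Set
IsAut G σ = ∀ u v → adj G (σ ⟨$⟩ʳ u) (σ ⟨$⟩ʳ v) ≡ adj G u v

Aut : Graph → Set
Aut G = Σ (Permutation′ (n G)) (IsAut G)

ap : {G : Graph} → Aut G → Fin (n G) → Fin (n G)
ap (σ , _) u = σ ⟨$⟩ʳ u

Arc : Graph → Set
Arc G = Σ (Fin (n G) × Fin (n G)) (λ p → T (adj G (proj₁ p) (proj₂ p)))

VRel : (G : Graph) → Fin (n G) → Fin (n G) → Set
VRel G u v = Σ (Aut G) (λ σ → ap σ u ≡ v)

ARelP : (G : Graph) → Fin (n G) × Fin (n G) → Fin (n G) × Fin (n G) → Set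
ARelP G (u , v) (x , y) = Σ (Aut G) (λ σ → (ap σ u ≡ x) × (ap σ v ≡ y))

ERelP : (G : Graph) → Fin (n G) × Fin (n G) → Fin (n G) × Fin (n G) → Set
ERelP G (u , v) (x , y) =
  Σ (Aut G) (λ σ → ((ap σ u ≡ x) × (ap σ v ≡ y)) ⊎ ((ap σ u ≡ y) × (ap σ v ≡ x)))

ARel : (G : Graph) → Arc G → Arc G → Set
ARel G a b = ARelP G (proj₁ a) (proj₁ b)

-- an edge is represented by either of its two arcs; two arcs represent
-- edges in the same edge orbit iff they are ERel-related
ERel : (G : Graph) → Arc G → Arc G → Set
ERel G a b = ERelP G (proj₁ a) (proj₁ b)

NumClasses : (A : Set) → (A → A → Set) → ℕ → Set
NumClasses A R m =
  Σ (A → Fin m) (λ f → Surjective _≡_ _≡_ f × (∀ a b → (f a ≡ f b) ⇔ R a b))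

Ov : Graph → ℕ → Set
Ov G m = NumClasses (Fin (n G)) (VRel G) m

Oe : Graph → ℕ → Set
Oe G m = NumClasses (Arc G) (ERel G) m

Oa : Graph → ℕ → Set
Oa G m = NumClasses (Arc G) (ARel G) m

VertexTransitive : Graph → Set
VertexTransitive G = ∀ u v → VRel G u v

sumFin : (k : ℕ) → (Fin k → ℚ) → ℚ
sumFin zero    f = 0ℚ
sumFin (suc k) f = f Fin.zero +ℚ sumFin k (λ i → f (Fin.suc i))

Aapp : (G : Graph) → (Fin (n G) → ℚ) → Fin (n G) → ℚ
Aapp G x v = sumFin (n G) (λ w → if adj G v w then x w else 0ℚ)

InKernel : (G : Graph) → (Fin (n G) → ℚ) → Set
InKernel G x = ∀ v → Aapp G x v ≡ 0ℚ

IsNut : Graph → Set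
IsNut G =
  (2 ≤ n G) ×
  Σ (Fin (n G) → ℚ) (λ x →
      (∀ v → x v ≢ 0ℚ) × InKernel G x ×
      (∀ y → InKernel G y → Σ ℚ (λ c → ∀ v → y v ≡ c *ℚ x v)))

record EdgeOrbit (G : Graph) : Set where
  field
    m       : ℕ
    e       : Fin m → Fin (n G) × Fin (n G)
    e-inj   : ∀ i j → e i ≡ e j → i ≡ j
    e-edge  : ∀ i → T (adj G (proj₁ (e i)) (proj₂ (e i)))
    e-ord   : ∀ i → toℕ (proj₁ (e i)) < toℕ (proj₂ (e i))
    nonempty : Fin m
    e-orbit : ∀ i j → ERelP G (e i) (e j)
    e-closed : ∀ i u v → T (adj G u v) → toℕ u < toℕ v →
               ERelP G (e i) (u , v) → Σ (Fin m) (λ j → e j ≡ (u , v))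
open EdgeOrbit public

-- Vertex set: Fin (n + m * s); the first n are the old vertices, the
-- vertex (i , j) (i : Fin m, j : Fin s) is the j-th internal vertex of
-- the path replacing the edge e i = (u , v), the path being
-- u — (i,0) — (i,1) — … — (i,s-1) — v.

_≟ᶠ_ : {k : ℕ} → Fin k → Fin k → Bool
a ≟ᶠ b = toℕ a ≡ᵇ toℕ b

anyFin : (k : ℕ) → (Fin k → Bool) → Bool
anyFin zero    p = false
anyFin (suc k) p = p Fin.zero ∨ anyFin k (λ i → p (Fin.suc i))

module _ (G : Graph) (E : EdgeOrbit G) (s : ℕ) where

  inE : Fin (n G) → Fin (n G) → Bool
  inE u v = anyFin (m E) (λ i →
    ((proj₁ (e E i) ≟ᶠ u) ∧ (proj₂ (e E i) ≟ᶠ v)) ∨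
    ((proj₁ (e E i) ≟ᶠ v) ∧ (proj₂ (e E i) ≟ᶠ u)))

  endAdj : Fin (n G) → Fin (m E) → Fin s → Bool
  endAdj u i j =
    ((toℕ j ≡ᵇ 0) ∧ (proj₁ (e E i) ≟ᶠ u)) ∨
    ((toℕ j ≡ᵇ (s ∸ 1)) ∧ (proj₂ (e E i) ≟ᶠ u))

  adjDec : Fin (n G) ⊎ (Fin (m E) × Fin s) → Fin (n G) ⊎ (Fin (m E) × Fin s) → Bool
  adjDec (inj₁ u) (inj₁ v) = adj G u v ∧ not (inE u v)
  adjDec (inj₁ u) (inj₂ (i , j)) = endAdj u i j
  adjDec (inj₂ (i , j)) (inj₁ u) = endAdj u i j
  adjDec (inj₂ (i , j)) (inj₂ (i′ , j′)) =
    (i ≟ᶠ i′) ∧ ((suc (toℕ j) ≡ᵇ toℕ j′) ∨ (suc (toℕ j′) ≡ᵇ toℕ j))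

  decode : Fin (n G + m E * s) → Fin (n G) ⊎ (Fin (m E) × Fin s)
  decode w with splitAt (n G) w
  ... | inj₁ u = inj₁ u
  ... | inj₂ r = inj₂ (remQuot s r)

  subdivide : Graph
  subdivide = record
    { n   = n G + m E * s
    ; adj = λ a b → adjDec (decode a) (decode b)
    }

-- Nut property: at an internal vertex p_j of a subdivided path the kernel equation reads
-- y(p_{j-1}) + y(p_{j+1}) = 0, so a kernel vector of G₁ is determined on each path by its
-- values at the two ends and has period 4 along it. A path has 4t + 1 edges, so the
-- neighbours of u and v on it carry the values at v and u, and the kernel equations of
-- G₁ at original vertices become those of G. Hence ker A(G₁) ≅ ker A(G), and the nut
-- vector of G extends to one of G₁ without zero entries.
--
-- Orbits: in a vertex-transitive nut graph every vertex has degree at least 3 (degrees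
-- 0 and 1 contradict full support, and a 2-regular graph carries a second kernel vector).
-- So automorphisms of G₁ preserve the original vertices and are exactly the lifts of
-- automorphisms of G. Since o_e(G) = o_a(G), each edge of G is reversed by some
-- automorphism, so Aut G permutes the subdivided paths with both orientations. The orbits
-- of G₁ are then read off from positions along a path up to reversal: 2t internal vertex
-- orbits, 4t + 1 path-arc orbits and 2t + 1 path-edge orbits, plus one orbit of original
-- vertices and the k − 1 arc (edge) orbits of G outside the subdivided one.

module Submission where

open import Defs
open import Data.Nat as ℕ using (ℕ; zero; suc; s≤s; z≤n; _≡ᵇ_; _⊓_)
import Data.Nat.Properties as NP
open import Data.Fin as F using (Fin; toℕ; _↑ˡ_; _↑ʳ_; combine; splitAt; remQuot)
import Data.Fin.Properties as FP
open import Data.Fin.Permutation as Perm using (Permutation′; _⟨$⟩ʳ_; _⟨$⟩ˡ_; inverseʳ; inverseˡ)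
open import Data.Bool using (Bool; true; false; _∧_; _∨_; not; T; if_then_else_; _xor_)
import Data.Bool.Properties as BP
open import Data.Empty using (⊥; ⊥-elim)
open import Data.Unit using (tt)
open import Data.Product using (Σ; ∃; _×_; _,_; proj₁; proj₂)
open import Data.Sum using (_⊎_; inj₁; inj₂)
open import Data.Sum.Properties using (inj₁-injective; inj₂-injective)
open import Function.Bundles using (Equivalence; mk⇔)
open import Relation.Binary.PropositionalEquality hiding (J)
open import Relation.Nullary using (¬_; Dec; yes; no)
open import Relation.Nullary.Decidable using (_×-dec_; ¬?)

module Prelude where

  T→≡ : ∀ {b} → T b → b ≡ true
  T→≡ = Equivalence.to BP.T-≡

  ≡→T : ∀ {b} → b ≡ true → T b
  ≡→T = Equivalence.from BP.T-≡

  ≡ᵇ-true : ∀ {a b} → (a ≡ᵇ b) ≡ true → a ≡ b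
  ≡ᵇ-true {a} {b} e = NP.≡ᵇ⇒≡ a b (≡→T e)

  ≡ᵇ-refl : ∀ a → (a ≡ᵇ a) ≡ true
  ≡ᵇ-refl a = T→≡ (NP.≡⇒≡ᵇ a a refl)

  ≡ᵇ-false : ∀ {a b} → a ≢ b → (a ≡ᵇ b) ≡ false
  ≡ᵇ-false {a} {b} ne with a ≡ᵇ b in eq
  ... | true = ⊥-elim (ne (≡ᵇ-true eq))
  ... | false = refl

  ≡ᵇ-≡ : ∀ {a b} → a ≡ b → (a ≡ᵇ b) ≡ true
  ≡ᵇ-≡ {a} refl = ≡ᵇ-refl a

  ≟ᶠ-true : ∀ {k} {a b : Fin k} → (a ≟ᶠ b) ≡ true → a ≡ b
  ≟ᶠ-true e = FP.toℕ-injective (≡ᵇ-true e)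

  ≟ᶠ-refl : ∀ {k} (a : Fin k) → (a ≟ᶠ a) ≡ true
  ≟ᶠ-refl a = ≡ᵇ-refl (toℕ a)

  ≟ᶠ-≡ : ∀ {k} {a b : Fin k} → a ≡ b → (a ≟ᶠ b) ≡ true
  ≟ᶠ-≡ {a = a} refl = ≟ᶠ-refl a

  ≟ᶠ-false : ∀ {k} {a b : Fin k} → a ≢ b → (a ≟ᶠ b) ≡ false
  ≟ᶠ-false ne = ≡ᵇ-false (λ e → ne (FP.toℕ-injective e))

  ≟ᶠ-dec : ∀ {k} (a b : Fin k) → ((a ≟ᶠ b) ≡ true × a ≡ b) ⊎ ((a ≟ᶠ b) ≡ false × a ≢ b)
  ≟ᶠ-dec a b with a FP.≟ b
  ... | yes e = inj₁ (≟ᶠ-≡ e , e)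
  ... | no ne = inj₂ (≟ᶠ-false ne , ne)

  ∧-true : ∀ {a b} → (a ∧ b) ≡ true → (a ≡ true) × (b ≡ true)
  ∧-true {true} {true} _ = refl , refl

  ∨-true : ∀ {a b} → (a ∨ b) ≡ true → (a ≡ true) ⊎ (b ≡ true)
  ∨-true {true} _ = inj₁ refl
  ∨-true {false} {true} _ = inj₂ refl

  true≢false : true ≢ false
  true≢false ()

  anyFin-true : ∀ k (p : Fin k → Bool) → anyFin k p ≡ true → Σ (Fin k) (λ i → p i ≡ true)
  anyFin-true (suc k) p e with p F.zero in eq
  ... | true = F.zero , eq
  ... | false with anyFin-true k (λ i → p (F.suc i)) e
  ... | i , q = F.suc i , q

  anyFin-intro : ∀ k (p : Fin k → Bool) (i : Fin k) → p i ≡ true → anyFin k p ≡ true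
  anyFin-intro (suc k) p F.zero e rewrite e = refl
  anyFin-intro (suc k) p (F.suc i) e with p F.zero
  ... | true = refl
  ... | false = anyFin-intro k (λ j → p (F.suc j)) i e

  not-true→false : ∀ {b} → b ≢ true → b ≡ false
  not-true→false {true} h = ⊥-elim (h refl)
  not-true→false {false} h = refl

  T∧₁ : ∀ {a b} → T (a ∧ b) → T a
  T∧₁ {true} _ = tt

  T∧₂ : ∀ {a b} → T (a ∧ b) → T b
  T∧₂ {true} p = p

  T-not : ∀ {b} → T (not b) → b ≡ false
  T-not {false} _ = refl

  periodic-4 : ∀ {B : Set} (f : ℕ → B) → (∀ k → f (suc (suc (suc (suc k)))) ≡ f k) → ∀ r c → f (c ℕ.+ 4 ℕ.* r) ≡ f c
  periodic-4 f h zero c rewrite NP.+-identityʳ c = refl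
  periodic-4 f h (suc r) c rewrite NP.*-suc 4 r | NP.+-suc c (suc (suc (suc (4 ℕ.* r)))) | NP.+-suc c (suc (suc (4 ℕ.* r)))
     | NP.+-suc c (suc (4 ℕ.* r)) | NP.+-suc c (4 ℕ.* r) = trans (h (c ℕ.+ 4 ℕ.* r)) (periodic-4 f h r c)

  induction₂ : ∀ (P : ℕ → Set) → P 0 → P 1 → (∀ a → P a → P (suc a) → P (suc (suc a))) → ∀ a → P a × P (suc a)
  induction₂ P p0 p1 step zero = p0 , p1
  induction₂ P p0 p1 step (suc a) = let (pa , pa1) = induction₂ P p0 p1 step a in pa1 , step a pa pa1

  rightInverse⇒injective : ∀ {k} (g : Fin k → Fin k) (h : Fin k → Fin k) → (∀ c → g (h c) ≡ c) → ∀ a b → g a ≡ g b → a ≡ b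
  rightInverse⇒injective {zero} g h gh () b e
  rightInverse⇒injective {suc k} g h gh a b e with a FP.≟ b
  ... | yes q = q
  ... | no a≢b = ⊥-elim (NP.1+n≰n (FP.injective⇒≤ {f = h'} h'-inj))
    where
    d : Fin (suc k)
    d with h (g a) FP.≟ a
    ... | yes _ = b
    ... | no _ = a
    d-miss : ∀ c → h c ≢ d
    d-miss c hc with h (g a) FP.≟ a
    ... | yes q = a≢b (trans (sym q) (trans (cong h e) (trans (cong h (sym (trans (sym (gh c)) (cong g hc)))) hc)))
    ... | no q = q (trans (cong h (sym (trans (sym (gh c)) (cong g hc)))) hc)
    h' : Fin (suc k) → Fin k
    h' c = F.punchOut (λ q → d-miss c (sym q))
    h-inj : ∀ c c' → h c ≡ h c' → c ≡ c'
    h-inj c c' q = trans (sym (gh c)) (trans (cong g q) (gh c'))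
    h'-inj : ∀ {c c'} → h' c ≡ h' c' → c ≡ c'
    h'-inj {c} {c'} q = h-inj c c' (FP.punchOut-injective {i = d} (λ q → d-miss c (sym q)) (λ q → d-miss c' (sym q)) q)

  numClasses-from : ∀ (X : Set) (R : X → X → Set) (M : ℕ) (cls : X → ℕ) → (∀ a → cls a ℕ.< M) →
         (∀ c → c ℕ.< M → Σ X (λ a → cls a ≡ c)) → (∀ a b → cls a ≡ cls b → R a b) → (∀ a b → R a b → cls a ≡ cls b) →
         NumClasses X R M
  numClasses-from X R M cls bnd sur to from = f , surj , λ a b → mk⇔ (λ q → to a b (trans (sym (FP.toℕ-fromℕ< (bnd a))) (trans (cong toℕ q) (FP.toℕ-fromℕ< (bnd b)))))
                                                            (λ r → FP.toℕ-injective (trans (FP.toℕ-fromℕ< (bnd a)) (trans (from a b r) (sym (FP.toℕ-fromℕ< (bnd b))))))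
    where
    f : X → Fin M
    f a = F.fromℕ< (bnd a)
    surj : ∀ y → ∃ λ x → ∀ {z} → z ≡ x → f z ≡ y
    surj y = proj₁ (sur (toℕ y) (FP.toℕ<n y)) , λ { refl → FP.toℕ-injective (trans (FP.toℕ-fromℕ< (bnd _)) (proj₂ (sur (toℕ y) (FP.toℕ<n y)))) }

module Rationals where

  open import Data.Rational using (ℚ; 0ℚ; 1ℚ; _+_; _*_; -_; 1/_; ≢-nonZero)
  open import Data.Rational.Properties
  open import Data.Rational.Solver
  open +-*-Solver

  sum-cong : ∀ k {f g : Fin k → ℚ} → (∀ i → f i ≡ g i) → sumFin k f ≡ sumFin k g
  sum-cong zero h = refl
  sum-cong (suc k) h = cong₂ _+_ (h F.zero) (sum-cong k (λ i → h (F.suc i)))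

  sum-0 : ∀ k → sumFin k (λ _ → 0ℚ) ≡ 0ℚ
  sum-0 zero = refl
  sum-0 (suc k) = trans (cong (0ℚ +_) (sum-0 k)) refl

  sum-+ : ∀ k (f g : Fin k → ℚ) → sumFin k (λ i → f i + g i) ≡ sumFin k f + sumFin k g
  sum-+ zero f g = refl
  sum-+ (suc k) f g = trans (cong ((f F.zero + g F.zero) +_) (sum-+ k _ _))
    (solve 4 (λ a b c d → (a :+ b) :+ (c :+ d) := (a :+ c) :+ (b :+ d)) refl (f F.zero) (g F.zero) (sumFin k _) (sumFin k _))

  sum-single : ∀ k (g : Fin k → ℚ) (a : Fin k) → (∀ i → i ≢ a → g i ≡ 0ℚ) → sumFin k g ≡ g a
  sum-single (suc k) g F.zero h = trans (cong (g F.zero +_) (trans (sum-cong k (λ i → h (F.suc i) (λ ()))) (sum-0 k))) (+-identityʳ _)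
  sum-single (suc k) g (F.suc a) h = trans (cong (_+ sumFin k (λ i → g (F.suc i))) (h F.zero (λ ())))
    (trans (+-identityˡ _) (sum-single k (λ i → g (F.suc i)) a (λ i ne → h (F.suc i) (λ eq → ne (FP.suc-injective eq)))))

  sum-zero : ∀ k (g : Fin k → ℚ) → (∀ i → g i ≡ 0ℚ) → sumFin k g ≡ 0ℚ
  sum-zero k g h = trans (sum-cong k h) (sum-0 k)

  sum-split : ∀ a b (f : Fin (a ℕ.+ b) → ℚ) → sumFin (a ℕ.+ b) f ≡ sumFin a (λ i → f (i ↑ˡ b)) + sumFin b (λ j → f (a ↑ʳ j))
  sum-split zero b f = sym (+-identityˡ _)
  sum-split (suc a) b f = trans (cong (f F.zero +_) (sum-split a b (λ i → f (F.suc i)))) (sym (+-assoc (f F.zero) _ _))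

  sum-combine : ∀ m s (f : Fin (m ℕ.* s) → ℚ) → sumFin (m ℕ.* s) f ≡ sumFin m (λ i → sumFin s (λ j → f (combine i j)))
  sum-combine zero s f = refl
  sum-combine (suc m) s f = trans (sum-split s (m ℕ.* s) f) (cong (sumFin s (λ j → f (j ↑ˡ (m ℕ.* s))) +_) (sum-combine m s _))

  sum-swap : ∀ a b (f : Fin a → Fin b → ℚ) → sumFin a (λ i → sumFin b (λ j → f i j)) ≡ sumFin b (λ j → sumFin a (λ i → f i j))
  sum-swap zero b f = sym (sum-0 b)
  sum-swap (suc a) b f = trans (cong (sumFin b (f F.zero) +_) (sum-swap a b _)) (sym (sum-+ b _ _))

  sum-two : ∀ k (g : Fin k → ℚ) (a b : Fin k) → a ≢ b → (∀ i → i ≢ a → i ≢ b → g i ≡ 0ℚ) → sumFin k g ≡ g a + g b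
  sum-two k g a b ab h = trans (sum-cong k split) (trans (sum-+ k g1 g2) (cong₂ _+_ s1 s2))
    where
    g1 g2 : Fin k → ℚ
    g1 i with i FP.≟ a
    ... | yes _ = g i
    ... | no _ = 0ℚ
    g2 i with i FP.≟ a
    ... | yes _ = 0ℚ
    ... | no _ = g i
    split : ∀ i → g i ≡ g1 i + g2 i
    split i with i FP.≟ a
    ... | yes _ = sym (+-identityʳ _)
    ... | no _ = sym (+-identityˡ _)
    s1 : sumFin k g1 ≡ g a
    s1 = trans (sum-single k g1 a z1) (e1)
      where
      z1 : ∀ i → i ≢ a → g1 i ≡ 0ℚ
      z1 i ne with i FP.≟ a
      ... | yes e = ⊥-elim (ne e)
      ... | no _ = refl
      e1 : g1 a ≡ g a
      e1 with a FP.≟ a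
      ... | yes _ = refl
      ... | no ne = ⊥-elim (ne refl)
    s2 : sumFin k g2 ≡ g b
    s2 = trans (sum-single k g2 b z2) e2
      where
      z2 : ∀ i → i ≢ b → g2 i ≡ 0ℚ
      z2 i ne with i FP.≟ a
      ... | yes _ = refl
      ... | no ne' = h i ne' ne
      e2 : g2 b ≡ g b
      e2 with b FP.≟ a
      ... | yes e = ⊥-elim (ab (sym e))
      ... | no _ = refl

  sumN : ℕ → (ℕ → ℚ) → ℚ
  sumN zero f = 0ℚ
  sumN (suc N) f = sumN N f + f N

  sumN-cong : ∀ N {f g : ℕ → ℚ} → (∀ k → f k ≡ g k) → sumN N f ≡ sumN N g
  sumN-cong zero h = refl
  sumN-cong (suc N) h = cong₂ _+_ (sumN-cong N h) (h N)

  sumN-0 : ∀ N → sumN N (λ _ → 0ℚ) ≡ 0ℚ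
  sumN-0 zero = refl
  sumN-0 (suc N) = trans (+-identityʳ _) (sumN-0 N)

  sumN-* : ∀ N c (f : ℕ → ℚ) → sumN N (λ i → c * f i) ≡ c * sumN N f
  sumN-* zero c f = sym (*-zeroʳ c)
  sumN-* (suc N) c f = trans (cong (_+ (c * f N)) (sumN-* N c f)) (sym (*-distribˡ-+ c _ _))

  sum-sumN : ∀ k N (f : Fin k → ℕ → ℚ) → sumFin k (λ i → sumN N (f i)) ≡ sumN N (λ j → sumFin k (λ i → f i j))
  sum-sumN k zero f = sum-0 k
  sum-sumN k (suc N) f = trans (sum-+ k _ _) (cong (_+ sumFin k (λ i → f i N)) (sum-sumN k N f))

  telescope : ∀ N (b : ℕ → ℚ) → sumN N (λ k → b k + - b (suc (suc k))) ≡ (b 0 + b 1) + - (b N + b (suc N))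
  telescope zero b = solve 2 (λ a c → con 0ℚ := (a :+ c) :+ (:- (a :+ c))) refl (b 0) (b 1)
  telescope (suc N) b = trans (cong (_+ (b N + - b (suc (suc N)))) (telescope N b))
    (solve 5 (λ p q r s t → ((p :+ q) :+ (:- (r :+ s))) :+ (r :+ (:- t)) := (p :+ q) :+ (:- (s :+ t))) refl (b 0) (b 1) (b N) (b (suc N)) (b (suc (suc N))))

  *≡0⇒≡0 : ∀ c a → c * a ≡ 0ℚ → a ≢ 0ℚ → c ≡ 0ℚ
  *≡0⇒≡0 c a e a≢0 = begin
      c                  ≡⟨ sym (*-identityʳ c) ⟩
      c * 1ℚ             ≡⟨ cong (c *_) (sym (*-inverseʳ a {{≢-nonZero a≢0}})) ⟩
      c * (a * (1/ a) {{≢-nonZero a≢0}})  ≡⟨ sym (*-assoc c a _) ⟩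
      (c * a) * (1/ a) {{≢-nonZero a≢0}}  ≡⟨ cong (λ z → z * (1/ a) {{≢-nonZero a≢0}}) e ⟩
      0ℚ * (1/ a) {{≢-nonZero a≢0}}       ≡⟨ *-zeroˡ ((1/ a) {{≢-nonZero a≢0}}) ⟩
      0ℚ ∎
    where open ≡-Reasoning

  ≡-⇒≡0 : ∀ a → a ≡ - a → a ≡ 0ℚ
  ≡-⇒≡0 a e = *≡0⇒≡0 a (1ℚ + 1ℚ) a*2≡0 (λ ())
    where
    a*2≡0 : a * (1ℚ + 1ℚ) ≡ 0ℚ
    a*2≡0 = trans (solve 1 (λ z → z :* (con 1ℚ :+ con 1ℚ) := z :+ z) refl a) (trans (cong (a +_) e) (+-inverseʳ a))

  neg≢0 : ∀ a → a ≢ 0ℚ → - a ≢ 0ℚ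
  neg≢0 a a≢0 -a≡0 = a≢0 (trans (solve 1 (λ z → z := :- (:- z)) refl a) (cong -_ -a≡0))

  +≡0⇒≡- : ∀ {a b} → a + b ≡ 0ℚ → b ≡ - a
  +≡0⇒≡- {a} {b} q = trans (solve 2 (λ p r → r := (:- p) :+ (p :+ r)) refl a b) (trans (cong (- a +_) q) (+-identityʳ (- a)))

module NutVector (G : Graph) (nut : IsNut G) where

  open import Data.Rational using (ℚ; 0ℚ; _*_)

  x : Fin (n G) → ℚ
  x = proj₁ (proj₂ nut)

  x≢0 : ∀ v → x v ≢ 0ℚ
  x≢0 = proj₁ (proj₂ (proj₂ nut))

  x-kernel : InKernel G x
  x-kernel = proj₁ (proj₂ (proj₂ (proj₂ nut)))

  x-spans : ∀ y → InKernel G y → Σ ℚ (λ c → ∀ v → y v ≡ c * x v)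
  x-spans = proj₂ (proj₂ (proj₂ (proj₂ nut)))

module MinDegree (G : Graph) (simp : IsSimple G) (nut : IsNut G) (vt : VertexTransitive G) where

  open Prelude
  open Rationals
  open NutVector G nut
  open import Data.Rational using (ℚ; 0ℚ; 1ℚ; _+_; _*_; -_; 1/_; ≢-nonZero; _≤_; _<_)
  open import Data.Rational.Properties hiding (_≟_)
  import Data.Rational.Solver

  V : Set
  V = Fin (n G)

  A : V → V → Bool
  A = adj G

  A-sym : ∀ u v → A u v ≡ A v u
  A-sym = proj₁ simp

  A-loop : ∀ v → A v v ≡ false
  A-loop = proj₂ simp

  two-distinct : ∀ k → 2 ℕ.≤ k → Σ (Fin k) (λ v0 → Σ (Fin k) (λ v1 → v0 ≢ v1))
  two-distinct (suc (suc k)) _ = F.zero , F.suc F.zero , (λ ())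
  two-distinct (suc zero) (s≤s ())

  two-vertices : Σ V (λ v0 → Σ V (λ v1 → v0 ≢ v1))
  two-vertices = two-distinct (n G) (proj₁ nut)

  another-vertex : (v : V) → Σ V (λ w → w ≢ v)
  another-vertex v with two-vertices
  ... | v0 , v1 , ne with v0 FP.≟ v
  ...   | yes refl = v1 , (λ e → ne (sym e))
  ...   | no ne' = v0 , ne'

  ThreeNeighbours : V → Set
  ThreeNeighbours v = Σ V λ a → Σ V λ b → Σ V λ c →
    (A v a ≡ true) × (A v b ≡ true) × (A v c ≡ true) × (a ≢ b) × (a ≢ c) × (b ≢ c)

  no-isolated-vertex : (v : V) → (∀ w → A v w ≡ false) → ⊥
  no-isolated-vertex v iso = 1≢0 (trans (sym ev) (trans (hc v) (trans (cong (_* x v) c≡0) (*-zeroˡ (x v)))))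
    where
    δv : V → ℚ
    δv u = if u ≟ᶠ v then 1ℚ else 0ℚ
    ev : δv v ≡ 1ℚ
    ev rewrite ≟ᶠ-refl v = refl
    e0 : ∀ u → u ≢ v → δv u ≡ 0ℚ
    e0 u ne rewrite ≟ᶠ-false ne = refl
    eker : InKernel G δv
    eker w = trans (sum-single (n G) _ v (λ u ne → lem u ne)) (lem2)
      where
      lem : ∀ u → u ≢ v → (if A w u then δv u else 0ℚ) ≡ 0ℚ
      lem u ne with A w u
      ... | true = e0 u ne
      ... | false = refl
      lem2 : (if A w v then δv v else 0ℚ) ≡ 0ℚ
      lem2 rewrite A-sym w v | iso w = refl
    c = proj₁ (x-spans δv eker)
    hc = proj₂ (x-spans δv eker)
    w = proj₁ (another-vertex v)
    c≡0 : c ≡ 0ℚ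
    c≡0 = *≡0⇒≡0 c (x w) (trans (sym (hc w)) (e0 w (proj₂ (another-vertex v)))) (x≢0 w)

  no-pendant-vertex : (v a : V) → A v a ≡ true → (∀ w → A v w ≡ true → w ≡ a) → ⊥
  no-pendant-vertex v a ha nbr-only = x≢0 a (trans (sym lem2) (trans (sym (sum-single (n G) _ a lem)) (x-kernel v)))
    where
    lem : ∀ u → u ≢ a → (if A v u then x u else 0ℚ) ≡ 0ℚ
    lem u ne with A v u in eq
    ... | true = ⊥-elim (ne (nbr-only u eq))
    ... | false = refl
    lem2 : (if A v a then x a else 0ℚ) ≡ x a
    lem2 rewrite ha = refl

  even : ℕ → Bool
  even zero = true
  even (suc zero) = false
  even (suc (suc k)) = even k

  data View4 : ℕ → Set where
    v0 : ∀ r → View4 (4 ℕ.* r)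
    v1 : ∀ r → View4 (suc (4 ℕ.* r))
    v2 : ∀ r → View4 (suc (suc (4 ℕ.* r)))
    v3 : ∀ r → View4 (suc (suc (suc (4 ℕ.* r))))

  view4 : ∀ k → View4 k
  view4 zero = v0 0
  view4 (suc k) with view4 k
  ... | v0 r = v1 r
  ... | v1 r = v2 r
  ... | v2 r = v3 r
  ... | v3 r = subst View4 (NP.*-suc 4 r) (v0 (suc r))

  even-4r : ∀ r → even (4 ℕ.* r) ≡ true
  even-4r zero = refl
  even-4r (suc r) rewrite NP.*-suc 4 r = even-4r r

  even-suc : ∀ m → even (suc m) ≡ not (even m)
  even-suc zero = refl
  even-suc (suc zero) = refl
  even-suc (suc (suc m)) = even-suc m

  even-4r+1 : ∀ r → even (suc (4 ℕ.* r)) ≡ false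
  even-4r+1 r = trans (even-suc (4 ℕ.* r)) (cong not (even-4r r))

  -- Along a non-backtracking walk w₀ w₁ … the kernel equation at w (k + 1) gives
  -- x (w (k + 2)) = − x (w k). For a period P of the walk, y = Σ_{k<4P} cos(kπ/2) e_{w (k+1)}
  -- is in the kernel (the sum telescopes) and vanishes at w₀ (returns to w₀ take an even
  -- number of steps), so y = 0 by the nut property; but ⟨y , x⟩ = 2P · x w₁ ≠ 0.
  module TwoRegular (v₀ : V) (nbr₁ nbr₂ : V → V) (nbr₁≢nbr₂ : ∀ w → nbr₁ w ≢ nbr₂ w)
    (adj-nbr₁ : ∀ w → A w (nbr₁ w) ≡ true) (adj-nbr₂ : ∀ w → A w (nbr₂ w) ≡ true)
    (nbr-only : ∀ w u → A w u ≡ true → u ≡ nbr₁ w ⊎ u ≡ nbr₂ w) where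

    open Data.Rational.Solver.+-*-Solver

    other : V → V → V
    other c p with nbr₁ c FP.≟ p
    ... | yes _ = nbr₂ c
    ... | no _ = nbr₁ c

    other-adj : ∀ c p → A c (other c p) ≡ true
    other-adj c p with nbr₁ c FP.≟ p
    ... | yes _ = adj-nbr₂ c
    ... | no _ = adj-nbr₁ c

    other-≢ : ∀ c p → A c p ≡ true → other c p ≢ p
    other-≢ c p a with nbr₁ c FP.≟ p
    ... | yes e = λ e' → nbr₁≢nbr₂ c (trans e (sym e'))
    ... | no ne = ne

    other-only : ∀ c p u → A c p ≡ true → A c u ≡ true → u ≡ p ⊎ u ≡ other c p
    other-only c p u a au with nbr₁ c FP.≟ p | nbr-only c u au | nbr-only c p a
    ... | yes e | inj₁ e1 | _ = inj₁ (trans e1 e)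
    ... | yes e | inj₂ e2 | _ = inj₂ e2
    ... | no ne | inj₁ e1 | _ = inj₂ e1
    ... | no ne | inj₂ e2 | inj₁ e3 = ⊥-elim (ne (sym e3))
    ... | no ne | inj₂ e2 | inj₂ e3 = inj₁ (trans e2 (sym e3))

    other-inv : ∀ c p → A c p ≡ true → other c (other c p) ≡ p
    other-inv c p a with other-only c (other c p) p (other-adj c p) a
    ... | inj₁ e = ⊥-elim (other-≢ c p a (sym e))
    ... | inj₂ e = sym e

    State : Set
    State = V × V

    step : State → State
    step s = proj₂ s , other (proj₂ s) (proj₁ s)

    unstep : State → State
    unstep s = other (proj₁ s) (proj₂ s) , proj₁ s

    walkState : ℕ → State
    walkState zero = nbr₁ v₀ , v₀
    walkState (suc k) = step (walkState k)

    walk : ℕ → V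
    walk k = proj₂ (walkState k)

    walkState-adj : ∀ k → A (proj₂ (walkState k)) (proj₁ (walkState k)) ≡ true
    walkState-adj zero = adj-nbr₁ v₀
    walkState-adj (suc k) = trans (A-sym _ _) (other-adj (proj₂ (walkState k)) (proj₁ (walkState k)))

    unstep-step : ∀ k → unstep (walkState (suc k)) ≡ walkState k
    unstep-step k = cong (_, walk k) (other-inv (walk k) (proj₁ (walkState k)) (walkState-adj k))

    walk-adjˡ : ∀ k → A (walk (suc k)) (walk k) ≡ true
    walk-adjˡ k = walkState-adj (suc k)

    walk-adjʳ : ∀ k → A (walk k) (walk (suc k)) ≡ true
    walk-adjʳ k = trans (A-sym _ _) (walk-adjˡ k)

    walk-nbrs : ∀ k u → A (walk (suc k)) u ≡ true → u ≡ walk k ⊎ u ≡ walk (suc (suc k))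
    walk-nbrs k u a = other-only (walk (suc k)) (walk k) u (walk-adjˡ k) a

    walk-nonbacktracking : ∀ k → walk k ≢ walk (suc (suc k))
    walk-nonbacktracking k e = other-≢ (walk (suc k)) (walk k) (walk-adjˡ k) (sym e)

    xW : ℕ → ℚ
    xW k = x (walk k)

    xW-alternates : ∀ k → xW (suc (suc k)) ≡ - xW k
    xW-alternates k = sym (trans (sym (+-identityˡ (- xW k))) (trans (cong (_+ - xW k) (sym s0)) (
           trans (solve 2 (λ a b → (a :+ b) :+ (:- a) := b) refl (xW k) (xW (suc (suc k)))) refl)))
      where
      s0 : xW k + xW (suc (suc k)) ≡ 0ℚ
      s0 = trans (sym (trans (sum-two (n G) _ (walk k) (walk (suc (suc k))) (walk-nonbacktracking k) z)
                  (cong₂ _+_ (c1 (walk k) (walk-adjˡ k)) (c1 (walk (suc (suc k))) (walk-adjʳ (suc k)))))) (x-kernel (walk (suc k)))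
        where
        z : ∀ u → u ≢ walk k → u ≢ walk (suc (suc k)) → (if A (walk (suc k)) u then x u else 0ℚ) ≡ 0ℚ
        z u n1 n2 with A (walk (suc k)) u in eq
        ... | false = refl
        ... | true with walk-nbrs k u eq
        ...   | inj₁ e = ⊥-elim (n1 e)
        ...   | inj₂ e = ⊥-elim (n2 e)
        c1 : ∀ u → A (walk (suc k)) u ≡ true → (if A (walk (suc k)) u then x u else 0ℚ) ≡ x u
        c1 u e rewrite e = refl

    xW-period4 : ∀ k → xW (suc (suc (suc (suc k)))) ≡ xW k
    xW-period4 k = trans (xW-alternates (suc (suc k))) (trans (cong -_ (xW-alternates k)) (solve 1 (λ a → :- (:- a) := a) refl (xW k)))

    revisit-even : ∀ D d → d ℕ.≤ D → ∀ i → walk i ≡ walk (i ℕ.+ d) → even d ≡ true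
    revisit-even D zero _ i e = refl
    revisit-even D (suc zero) _ i e = ⊥-elim (true≢false (trans (sym (walk-adjʳ i)) (trans (cong (λ z → A z (walk (suc i))) (trans e (cong walk (NP.+-comm i 1)))) (A-loop _))))
    revisit-even (suc D) (suc (suc d)) (s≤s le) i e with walk-nbrs (i ℕ.+ suc d) (walk (suc i)) a
      where
      a : A (walk (suc (i ℕ.+ suc d))) (walk (suc i)) ≡ true
      a = subst (λ z → A (walk z) (walk (suc i)) ≡ true) (NP.+-suc i (suc d)) (subst (λ z → A z (walk (suc i)) ≡ true) e (walk-adjʳ i))
    ... | inj₁ e1 = revisit-even D d (NP.≤-trans (NP.n≤1+n d) le) (suc i) (trans e1 (cong walk (NP.+-suc i d)))
    ... | inj₂ e2 = shape (view4 (suc (suc d))) e3 e4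
      where
      e3 : xW i ≡ xW (i ℕ.+ suc (suc d))
      e3 = cong x e
      e4 : xW (suc i) ≡ xW (suc i ℕ.+ suc (suc d))
      e4 = cong x (trans e2 (cong walk (cong suc (sym (NP.+-suc i (suc d))))))
      sh : ∀ i' c r → xW (i' ℕ.+ (c ℕ.+ 4 ℕ.* r)) ≡ xW (i' ℕ.+ c)
      sh i' c r = trans (cong xW (sym (NP.+-assoc i' c (4 ℕ.* r)))) (periodic-4 xW xW-period4 r (i' ℕ.+ c))
      shape : ∀ {d'} → View4 d' → xW i ≡ xW (i ℕ.+ d') → xW (suc i) ≡ xW (suc i ℕ.+ d') → even d' ≡ true
      shape (v0 r) _ _ = even-4r r
      shape (v2 r) _ _ = even-4r r
      shape (v1 r) a b = ⊥-elim (x≢0 (walk i) (≡-⇒≡0 (xW i) (trans a (trans (sh i 1 r) (trans (cong xW (NP.+-comm i 1)) (trans b (trans (sh (suc i) 1 r) (trans (cong xW (NP.+-comm (suc i) 1)) (xW-alternates i)))))))))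
      shape (v3 r) a b = ⊥-elim (x≢0 (walk i) (≡-⇒≡0 (xW i) (trans a (trans (sh i 3 r) (trans (cong xW (NP.+-comm i 3)) (trans (xW-alternates (suc i)) (cong -_ (trans b (trans (sh (suc i) 3 r) (trans (cong xW (NP.+-comm (suc i) 3)) (xW-period4 i)))))))))))

    walkState-cancel : ∀ i d → walkState (i ℕ.+ d) ≡ walkState i → walkState d ≡ walkState 0
    walkState-cancel zero d e = e
    walkState-cancel (suc i) d e = walkState-cancel i d (trans (sym (unstep-step (i ℕ.+ d))) (trans (cong unstep e) (unstep-step i)))

    encodeState : ℕ → Fin (n G ℕ.* n G)
    encodeState k = F.combine (proj₁ (walkState k)) (proj₂ (walkState k))

    walk-period : Σ ℕ (λ d → walkState (suc d) ≡ walkState 0)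
    walk-period with FP.pigeonhole (NP.n<1+n (n G ℕ.* n G)) (λ k → encodeState (toℕ k))
    ... | i , j , i<j , eq with NP.m≤n⇒∃[o]m+o≡n i<j
    ... | o , eo = o , walkState-cancel (toℕ i) (suc o) (trans (cong walkState e2) (sym e1))
      where
      e1 : (proj₁ (walkState (toℕ i)) , proj₂ (walkState (toℕ i))) ≡ (proj₁ (walkState (toℕ j)) , proj₂ (walkState (toℕ j)))
      e1 = trans (sym (FP.remQuot-combine (proj₁ (walkState (toℕ i))) (proj₂ (walkState (toℕ i)))))
            (trans (cong (F.remQuot (n G)) eq) (FP.remQuot-combine _ _))
      e2 : toℕ i ℕ.+ suc o ≡ toℕ j
      e2 = trans (NP.+-suc (toℕ i) o) eo

    period : ℕ
    period = suc (proj₁ walk-period)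

    walk-periodic : ∀ k → walkState (k ℕ.+ period) ≡ walkState k
    walk-periodic zero = proj₂ walk-period
    walk-periodic (suc k) = cong step (walk-periodic k)

    walk-periodic* : ∀ r k → walkState (k ℕ.+ r ℕ.* period) ≡ walkState k
    walk-periodic* zero k = cong walkState (NP.+-identityʳ k)
    walk-periodic* (suc r) k = trans (cong walkState (sym (NP.+-assoc k period (r ℕ.* period)))) (trans (walk-periodic* r (k ℕ.+ period)) (walk-periodic k))

    N : ℕ
    N = 4 ℕ.* period

    walk-period-N : ∀ k → walk (k ℕ.+ N) ≡ walk k
    walk-period-N k = cong proj₂ (walk-periodic* 4 k)

    cosQuarter : ℕ → ℚ
    cosQuarter zero = 1ℚ
    cosQuarter (suc zero) = 0ℚ
    cosQuarter (suc (suc zero)) = - 1ℚ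
    cosQuarter (suc (suc (suc zero))) = 0ℚ
    cosQuarter (suc (suc (suc (suc k)))) = cosQuarter k

    cosQuarter-alternates : ∀ k → cosQuarter (suc (suc k)) ≡ - cosQuarter k
    cosQuarter-alternates zero = refl
    cosQuarter-alternates (suc zero) = refl
    cosQuarter-alternates (suc (suc zero)) = solve 0 (con 1ℚ := :- (:- con 1ℚ)) refl
    cosQuarter-alternates (suc (suc (suc zero))) = refl
    cosQuarter-alternates (suc (suc (suc (suc k)))) = cosQuarter-alternates k

    cosQuarter-period : ∀ k → cosQuarter (k ℕ.+ N) ≡ cosQuarter k
    cosQuarter-period k = periodic-4 cosQuarter (λ _ → refl) period k

    cosQuarter-odd : ∀ k → even (suc k) ≡ true → cosQuarter k ≡ 0ℚ
    cosQuarter-odd k ev = go (view4 k) ev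
      where
      go : ∀ {k} → View4 k → even (suc k) ≡ true → cosQuarter k ≡ 0ℚ
      go (v0 r) e = ⊥-elim (true≢false (trans (sym e) (even-4r+1 r)))
      go (v1 r) e = periodic-4 cosQuarter (λ _ → refl) r 1
      go (v2 r) e = ⊥-elim (true≢false (trans (sym e) (even-4r+1 r)))
      go (v3 r) e = periodic-4 cosQuarter (λ _ → refl) r 3

    δ : V → V → ℚ
    δ a u = if u ≟ᶠ a then 1ℚ else 0ℚ

    δ-same : ∀ a → δ a a ≡ 1ℚ
    δ-same a rewrite ≟ᶠ-refl a = refl

    δ-diff : ∀ a u → u ≢ a → δ a u ≡ 0ℚ
    δ-diff a u ne rewrite ≟ᶠ-false ne = refl

    y : V → ℚ
    y u = sumN N (λ k → cosQuarter k * δ (walk (suc k)) u)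

    if-sumN : ∀ (b : Bool) M (weight : ℕ → ℚ) → (if b then sumN M weight else 0ℚ) ≡ sumN M (λ k → if b then weight k else 0ℚ)
    if-sumN true M weight = refl
    if-sumN false M weight = sym (sumN-0 M)

    term : V → ℕ → ℚ
    term w k = cosQuarter k * δ (walk k) w

    Ay-summand : ∀ w k → sumFin (n G) (λ u → if A w u then cosQuarter k * δ (walk (suc k)) u else 0ℚ) ≡ (if A w (walk (suc k)) then cosQuarter k else 0ℚ)
    Ay-summand w k = trans (sum-single (n G) _ (walk (suc k)) z) e3
      where
      z : ∀ u → u ≢ walk (suc k) → (if A w u then cosQuarter k * δ (walk (suc k)) u else 0ℚ) ≡ 0ℚ
      z u ne with A w u
      ... | true = trans (cong (cosQuarter k *_) (δ-diff _ u ne)) (*-zeroʳ (cosQuarter k))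
      ... | false = refl
      e3 : (if A w (walk (suc k)) then cosQuarter k * δ (walk (suc k)) (walk (suc k)) else 0ℚ) ≡ (if A w (walk (suc k)) then cosQuarter k else 0ℚ)
      e3 with A w (walk (suc k))
      ... | true = trans (cong (cosQuarter k *_) (δ-same (walk (suc k)))) (*-identityʳ (cosQuarter k))
      ... | false = refl

    ≢-walk-prev : ∀ w k → A w (walk (suc k)) ≡ false → w ≢ walk k
    ≢-walk-prev w k eq refl = true≢false (trans (sym (walk-adjʳ k)) eq)
    ≢-walk-next : ∀ w k → A w (walk (suc k)) ≡ false → w ≢ walk (suc (suc k))
    ≢-walk-next w k eq refl = true≢false (trans (sym (walk-adjˡ (suc k))) eq)

    Ay-summand-telescopes : ∀ w k → (if A w (walk (suc k)) then cosQuarter k else 0ℚ) ≡ term w k + - term w (suc (suc k))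
    Ay-summand-telescopes w k rewrite cosQuarter-alternates k with A w (walk (suc k)) in eq
    ... | true with walk-nbrs k w (trans (A-sym _ _) eq)
    ...   | inj₁ refl rewrite δ-same (walk k) | δ-diff (walk (suc (suc k))) (walk k) (walk-nonbacktracking k) =
              solve 1 (λ p → p := (p :* con 1ℚ) :+ (:- ((:- p) :* con 0ℚ))) refl (cosQuarter k)
    ...   | inj₂ refl rewrite δ-same (walk (suc (suc k))) | δ-diff (walk k) (walk (suc (suc k))) (λ e' → walk-nonbacktracking k (sym e')) =
              solve 1 (λ p → p := (p :* con 0ℚ) :+ (:- ((:- p) :* con 1ℚ))) refl (cosQuarter k)
    Ay-summand-telescopes w k | false rewrite δ-diff (walk k) w (≢-walk-prev w k eq) | δ-diff (walk (suc (suc k))) w (≢-walk-next w k eq) =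
              solve 1 (λ p → con 0ℚ := (p :* con 0ℚ) :+ (:- ((:- p) :* con 0ℚ))) refl (cosQuarter k)

    yker : InKernel G y
    yker w = begin
        sumFin (n G) (λ u → if A w u then y u else 0ℚ)
          ≡⟨ sum-cong (n G) (λ u → if-sumN (A w u) N _) ⟩
        sumFin (n G) (λ u → sumN N (λ k → if A w u then cosQuarter k * δ (walk (suc k)) u else 0ℚ))
          ≡⟨ sum-sumN (n G) N _ ⟩
        sumN N (λ k → sumFin (n G) (λ u → if A w u then cosQuarter k * δ (walk (suc k)) u else 0ℚ))
          ≡⟨ sumN-cong N (λ k → trans (Ay-summand w k) (Ay-summand-telescopes w k)) ⟩
        sumN N (λ k → term w k + - term w (suc (suc k)))
          ≡⟨ telescope N (term w) ⟩
        (term w 0 + term w 1) + - (term w N + term w (suc N))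
          ≡⟨ cong (λ z → (term w 0 + term w 1) + - z) (cong₂ _+_ e0 e1) ⟩
        (term w 0 + term w 1) + - (term w 0 + term w 1)
          ≡⟨ +-inverseʳ (term w 0 + term w 1) ⟩
        0ℚ ∎
      where
      open ≡-Reasoning
      e0 : term w N ≡ term w 0
      e0 = cong₂ (λ a b → a * δ b w) (cosQuarter-period 0) (walk-period-N 0)
      e1 : term w (suc N) ≡ term w 1
      e1 = cong₂ (λ a b → a * δ b w) (cosQuarter-period 1) (walk-period-N 1)

    yW0 : y (walk 0) ≡ 0ℚ
    yW0 = trans (sumN-cong N t) (sumN-0 N)
      where
      t : ∀ k → cosQuarter k * δ (walk (suc k)) (walk 0) ≡ 0ℚ
      t k with walk 0 FP.≟ walk (suc k)
      ... | yes e = trans (cong (_* δ (walk (suc k)) (walk 0)) (cosQuarter-odd k (revisit-even (suc k) (suc k) NP.≤-refl 0 e))) (*-zeroˡ (δ (walk (suc k)) (walk 0)))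
      ... | no ne = trans (cong (cosQuarter k *_) (δ-diff _ _ ne)) (*-zeroʳ (cosQuarter k))

    cy = proj₁ (x-spans y yker)
    hy = proj₂ (x-spans y yker)

    cy≡0 : cy ≡ 0ℚ
    cy≡0 = *≡0⇒≡0 cy (x (walk 0)) (trans (sym (hy (walk 0))) yW0) (x≢0 (walk 0))

    y≡0 : ∀ u → y u ≡ 0ℚ
    y≡0 u = trans (hy u) (trans (cong (_* x u) cy≡0) (*-zeroˡ (x u)))

    ⟨y,x⟩≡0 : sumFin (n G) (λ u → y u * x u) ≡ 0ℚ
    ⟨y,x⟩≡0 = sum-zero (n G) _ (λ u → trans (cong (_* x u) (y≡0 u)) (*-zeroˡ (x u)))

    weight : ℕ → ℚ
    weight k = cosQuarter k * xW (suc k)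

    ⟨y,x⟩≡walk-sum : sumFin (n G) (λ u → y u * x u) ≡ sumN N weight
    ⟨y,x⟩≡walk-sum = begin
        sumFin (n G) (λ u → y u * x u)
          ≡⟨ sum-cong (n G) (λ u → trans (*-comm (y u) (x u)) (sym (sumN-* N (x u) _))) ⟩
        sumFin (n G) (λ u → sumN N (λ k → x u * (cosQuarter k * δ (walk (suc k)) u)))
          ≡⟨ sum-sumN (n G) N _ ⟩
        sumN N (λ k → sumFin (n G) (λ u → x u * (cosQuarter k * δ (walk (suc k)) u)))
          ≡⟨ sumN-cong N (λ k → trans (sum-single (n G) _ (walk (suc k)) (z k)) (ee k)) ⟩
        sumN N weight ∎
      where
      open ≡-Reasoning
      z : ∀ k u → u ≢ walk (suc k) → x u * (cosQuarter k * δ (walk (suc k)) u) ≡ 0ℚ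
      z k u ne = trans (cong (λ q → x u * (cosQuarter k * q)) (δ-diff _ u ne)) (trans (cong (x u *_) (*-zeroʳ (cosQuarter k))) (*-zeroʳ (x u)))
      ee : ∀ k → x (walk (suc k)) * (cosQuarter k * δ (walk (suc k)) (walk (suc k))) ≡ weight k
      ee k = trans (cong (λ q → x (walk (suc k)) * (cosQuarter k * q)) (δ-same (walk (suc k)))) (trans (cong (x (walk (suc k)) *_) (*-identityʳ (cosQuarter k))) (*-comm (x (walk (suc k))) (cosQuarter k)))

    γ : ℚ
    γ = xW 1 + xW 1

    walk-sum-blocks : ∀ r → sumN (4 ℕ.* r) weight ≡ sumN r (λ _ → γ)
    walk-sum-blocks zero = refl
    walk-sum-blocks (suc r) = trans (cong (λ q → sumN q weight) (NP.*-suc 4 r)) (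
      begin
        (((sumN (4 ℕ.* r) weight + weight (4 ℕ.* r)) + weight (suc (4 ℕ.* r))) + weight (suc (suc (4 ℕ.* r)))) + weight (suc (suc (suc (4 ℕ.* r))))
          ≡⟨ cong₂ _+_ (cong₂ _+_ (cong₂ _+_ (cong₂ _+_ (walk-sum-blocks r) (fp 0)) (fp 1)) (fp 2)) (fp 3) ⟩
        (((sumN r (λ _ → γ) + weight 0) + weight 1) + weight 2) + weight 3
          ≡⟨ refl ⟩
        (((sumN r (λ _ → γ) + 1ℚ * xW 1) + 0ℚ * xW 2) + (- 1ℚ) * xW 3) + 0ℚ * xW 4
          ≡⟨ cong (λ q → (((sumN r (λ _ → γ) + 1ℚ * xW 1) + 0ℚ * xW 2) + (- 1ℚ) * q) + 0ℚ * xW 4) (xW-alternates 1) ⟩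
        (((sumN r (λ _ → γ) + 1ℚ * xW 1) + 0ℚ * xW 2) + (- 1ℚ) * (- xW 1)) + 0ℚ * xW 4
          ≡⟨ solve 4 (λ s a b c → (((s :+ con 1ℚ :* a) :+ con 0ℚ :* b) :+ (:- con 1ℚ) :* (:- a)) :+ con 0ℚ :* c := s :+ (a :+ a)) refl (sumN r (λ _ → γ)) (xW 1) (xW 2) (xW 4) ⟩
        sumN r (λ _ → γ) + γ ∎)
      where
      open ≡-Reasoning
      fp : ∀ c → weight (c ℕ.+ 4 ℕ.* r) ≡ weight c
      fp c = periodic-4 weight (λ k → cong (cosQuarter k *_) (xW-period4 (suc k))) r c

    S-nonneg : ∀ r → 0ℚ ≤ sumN r (λ _ → 1ℚ)
    S-nonneg zero = ≤-refl
    S-nonneg (suc r) = subst (_≤ sumN (suc r) (λ _ → 1ℚ)) (+-identityʳ 0ℚ) (+-mono-≤ (S-nonneg r) (<⇒≤ (positive⁻¹ 1ℚ)))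

    S-pos : ∀ r → 0ℚ < sumN (suc r) (λ _ → 1ℚ)
    S-pos r = subst (_< sumN (suc r) (λ _ → 1ℚ)) (+-identityʳ 0ℚ) (+-mono-≤-< (S-nonneg r) (positive⁻¹ 1ℚ))

    absurd : ⊥
    absurd = x≢0 (walk 1) (≡-⇒≡0 (xW 1) (trans (sym (+-identityʳ (xW 1))) (trans (cong (xW 1 +_) (sym (+-inverseʳ (xW 1))))
               (trans (sym (+-assoc (xW 1) (xW 1) (- xW 1))) (trans (cong (_+ - xW 1) γ≡0) (+-identityˡ (- xW 1)))))))
      where
      S = sumN period (λ _ → 1ℚ)
      S≢0 : S ≢ 0ℚ
      S≢0 e = <-irrefl (sym e) (S-pos (proj₁ walk-period))
      γS : γ * S ≡ 0ℚ
      γS = trans (sym (trans (sumN-* period γ (λ _ → 1ℚ)) refl)) (trans (sumN-cong period (λ _ → *-identityʳ γ))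
             (trans (sym (walk-sum-blocks period)) (trans (sym ⟨y,x⟩≡walk-sum) ⟨y,x⟩≡0)))
      γ≡0 : γ ≡ 0ℚ
      γ≡0 = *≡0⇒≡0 γ S γS S≢0

  not-2-regular : (v a b : V) → a ≢ b → A v a ≡ true → A v b ≡ true → (∀ u → A v u ≡ true → u ≡ a ⊎ u ≡ b) → ⊥
  not-2-regular v a b ab ha hb onlyv = TwoRegular.absurd v nbr₁ nbr₂ nbr₁≢nbr₂ adj-nbr₁ adj-nbr₂ nbr-only
    where
    σ : V → Aut G
    σ w = proj₁ (vt v w)
    σv : ∀ w → ap (σ w) v ≡ w
    σv w = proj₂ (vt v w)
    nbr₁ nbr₂ : V → V
    nbr₁ w = ap (σ w) a
    nbr₂ w = ap (σ w) b
    inj : ∀ w {p q} → ap (σ w) p ≡ ap (σ w) q → p ≡ q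
    inj w {p} {q} e = trans (sym (inverseˡ (proj₁ (σ w)))) (trans (cong (proj₁ (σ w) ⟨$⟩ˡ_) e) (inverseˡ (proj₁ (σ w))))
    nbr₁≢nbr₂ : ∀ w → nbr₁ w ≢ nbr₂ w
    nbr₁≢nbr₂ w e = ab (inj w e)
    autw : ∀ w p → A w (ap (σ w) p) ≡ A v p
    autw w p = trans (cong (λ z → A z (ap (σ w) p)) (sym (σv w))) (proj₂ (σ w) v p)
    adj-nbr₁ : ∀ w → A w (nbr₁ w) ≡ true
    adj-nbr₁ w = trans (autw w a) ha
    adj-nbr₂ : ∀ w → A w (nbr₂ w) ≡ true
    adj-nbr₂ w = trans (autw w b) hb
    nbr-only : ∀ w u → A w u ≡ true → u ≡ nbr₁ w ⊎ u ≡ nbr₂ w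
    nbr-only w u e with onlyv (proj₁ (σ w) ⟨$⟩ˡ u) (trans (sym (autw w (proj₁ (σ w) ⟨$⟩ˡ u))) (trans (cong (A w) (inverseʳ (proj₁ (σ w)))) e))
    ... | inj₁ e1 = inj₁ (trans (sym (inverseʳ (proj₁ (σ w)))) (cong (ap (σ w)) e1))
    ... | inj₂ e2 = inj₂ (trans (sym (inverseʳ (proj₁ (σ w)))) (cong (ap (σ w)) e2))

  three-neighbours : ∀ v → ThreeNeighbours v
  three-neighbours v with FP.any? (λ a → FP.any? (λ b → FP.any? (λ c → (A v a BP.≟ true) ×-dec ((A v b BP.≟ true) ×-dec ((A v c BP.≟ true) ×-dec
                 (¬? (a FP.≟ b) ×-dec (¬? (a FP.≟ c) ×-dec ¬? (b FP.≟ c))))))))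
  ... | yes t = t
  ... | no ¬3 with FP.any? (λ a → A v a BP.≟ true)
  ...   | no ¬a = ⊥-elim (no-isolated-vertex v (λ w → not-true→false (λ e → ¬a (w , e))))
  ...   | yes (a , ha) with FP.any? (λ b → (A v b BP.≟ true) ×-dec ¬? (b FP.≟ a))
  ...     | no ¬b = ⊥-elim (no-pendant-vertex v a ha (λ w e → dec-eq w e))
    where
    dec-eq : ∀ w → A v w ≡ true → w ≡ a
    dec-eq w e with w FP.≟ a
    ... | yes q = q
    ... | no q = ⊥-elim (¬b (w , e , q))
  ...     | yes (b , hb , b≢a) = ⊥-elim (not-2-regular v a b (λ q → b≢a (sym q)) ha hb onlyv)
    where
    onlyv : ∀ u → A v u ≡ true → u ≡ a ⊎ u ≡ b
    onlyv u e with u FP.≟ a | u FP.≟ b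
    ... | yes q | _ = inj₁ q
    ... | no _ | yes q = inj₂ q
    ... | no na | no nb = ⊥-elim (¬3 (a , b , u , ha , hb , e , (λ q → b≢a (sym q)) , (λ q → na (sym q)) , (λ q → nb (sym q))))

module ArcReversal (G : Graph) (k : ℕ) (oe : Oe G k) (oa : Oa G k) where

  open Prelude

  id-aut : Aut G
  id-aut = Perm.id , (λ u v → refl)

  fe = proj₁ oe
  fa = proj₁ oa

  fe-to : ∀ a b → fe a ≡ fe b → ERel G a b
  fe-to a b = Equivalence.to (proj₂ (proj₂ oe) a b)
  fe-from : ∀ a b → ERel G a b → fe a ≡ fe b
  fe-from a b = Equivalence.from (proj₂ (proj₂ oe) a b)
  fa-to : ∀ a b → fa a ≡ fa b → ARel G a b
  fa-to a b = Equivalence.to (proj₂ (proj₂ oa) a b)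
  fa-from : ∀ a b → ARel G a b → fa a ≡ fa b
  fa-from a b = Equivalence.from (proj₂ (proj₂ oa) a b)

  arcRep : Fin k → Arc G
  arcRep c = proj₁ (proj₁ (proj₂ oa) c)
  arcRep-class : ∀ c → fa (arcRep c) ≡ c
  arcRep-class c = proj₂ (proj₁ (proj₂ oa) c) refl
  edgeRep : Fin k → Arc G
  edgeRep c = proj₁ (proj₁ (proj₂ oe) c)
  edgeRep-class : ∀ c → fe (edgeRep c) ≡ c
  edgeRep-class c = proj₂ (proj₁ (proj₂ oe) c) refl

  arcToEdgeClass : Fin k → Fin k
  arcToEdgeClass c = fe (arcRep c)

  ARel⇒ERel : ∀ a b → ARel G a b → ERel G a b
  ARel⇒ERel a b (σ , p , q) = σ , inj₁ (p , q)

  arcToEdgeClass-fa : ∀ a → arcToEdgeClass (fa a) ≡ fe a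
  arcToEdgeClass-fa a = fe-from (arcRep (fa a)) a (ARel⇒ERel (arcRep (fa a)) a (fa-to (arcRep (fa a)) a (arcRep-class (fa a))))

  arcToEdgeClass-injective : ∀ c c' → arcToEdgeClass c ≡ arcToEdgeClass c' → c ≡ c'
  arcToEdgeClass-injective = rightInverse⇒injective arcToEdgeClass (λ c → fa (edgeRep c)) (λ c → trans (arcToEdgeClass-fa (edgeRep c)) (edgeRep-class c))

  -- arcToEdgeClass is onto a set of the same size k, hence injective; and
  -- (u , w), (w , u) lie over the same edge.
  reverse-arc : ∀ u w → (t : T (adj G u w)) → (t' : T (adj G w u)) → ARelP G (u , w) (w , u)
  reverse-arc u w t t' = fa-to ((u , w) , t) ((w , u) , t') (arcToEdgeClass-injective _ _ (trans (arcToEdgeClass-fa ((u , w) , t)) (trans (fe-from ((u , w) , t) ((w , u) , t') (id-aut , inj₂ (refl , refl))) (sym (arcToEdgeClass-fa ((w , u) , t'))))))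

module Subdivision (G : Graph) (simp : IsSimple G) (E : EdgeOrbit G) (t' : ℕ) where

  open Prelude
  open Rationals
  open import Data.Rational using (ℚ; 0ℚ; 1ℚ; _+_; _*_; -_)
  open import Data.Rational.Properties hiding (_≟_)

  s : ℕ
  s = suc (suc (suc (suc (4 ℕ.* t'))))

  V : Set
  V = Fin (n G)
  I : Set
  I = Fin (m E)
  J : Set
  J = Fin s
  D : Set
  D = V ⊎ (I × J)

  G1 : Graph
  G1 = subdivide G E s

  N1 : ℕ
  N1 = n G ℕ.+ m E ℕ.* s

  dec : Fin N1 → D
  dec = decode G E s

  enc : D → Fin N1
  enc (inj₁ u) = u ↑ˡ (m E ℕ.* s)
  enc (inj₂ (i , j)) = n G ↑ʳ combine i j

  AD : D → D → Bool
  AD = adjDec G E s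

  A : V → V → Bool
  A = adj G

  e1 e2 : I → V
  e1 i = proj₁ (e E i)
  e2 i = proj₂ (e E i)

  lastJ : J
  lastJ = F.fromℕ (suc (suc (suc (4 ℕ.* t'))))

  toℕ-lastJ : toℕ lastJ ≡ suc (suc (suc (4 ℕ.* t')))
  toℕ-lastJ = FP.toℕ-fromℕ _

  decode-spec : ∀ w → dec w ≡ Data.Sum.[ inj₁ , (λ r → inj₂ (remQuot s r)) ]′ (splitAt (n G) w)
  decode-spec w with splitAt (n G) w
  ... | inj₁ u = refl
  ... | inj₂ r = refl

  dec-enc : ∀ d → dec (enc d) ≡ d
  dec-enc (inj₁ u) rewrite decode-spec (u ↑ˡ (m E ℕ.* s)) | FP.splitAt-↑ˡ (n G) u (m E ℕ.* s) = refl
  dec-enc (inj₂ (i , j)) rewrite decode-spec (n G ↑ʳ combine i j) | FP.splitAt-↑ʳ (n G) (m E ℕ.* s) (combine i j)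
    | FP.remQuot-combine i j = refl

  enc-dec : ∀ w → enc (dec w) ≡ w
  enc-dec w rewrite decode-spec w with splitAt (n G) w in eq
  ... | inj₁ u = trans (cong (F.join (n G) (m E ℕ.* s)) (sym eq)) (FP.join-splitAt (n G) (m E ℕ.* s) w)
  ... | inj₂ r = trans (cong (n G ↑ʳ_) (FP.combine-remQuot {m E} s r)) (trans (cong (F.join (n G) (m E ℕ.* s)) (sym eq)) (FP.join-splitAt (n G) (m E ℕ.* s) w))

  sumD : (D → ℚ) → ℚ
  sumD f = sumFin (n G) (λ u → f (inj₁ u)) + sumFin (m E) (λ i → sumFin s (λ j → f (inj₂ (i , j))))

  sumD-cong : ∀ {f g : D → ℚ} → (∀ d → f d ≡ g d) → sumD f ≡ sumD g
  sumD-cong h = cong₂ _+_ (sum-cong (n G) (λ u → h (inj₁ u))) (sum-cong (m E) (λ i → sum-cong s (λ j → h (inj₂ (i , j)))))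

  sum-decode : ∀ (g : Fin N1 → ℚ) → sumFin N1 g ≡ sumD (λ d → g (enc d))
  sum-decode g = trans (sum-split (n G) (m E ℕ.* s) g) (cong (sumFin (n G) (λ u → g (u ↑ˡ (m E ℕ.* s))) +_) (sum-combine (m E) s _))

  AappD : (D → ℚ) → D → ℚ
  AappD Y d = sumD (λ d' → if AD d d' then Y d' else 0ℚ)

  Aapp-enc : ∀ Y d → Aapp G1 (λ w → Y (dec w)) (enc d) ≡ AappD Y d
  Aapp-enc Y d = trans (sum-decode _) (sumD-cong (λ d' → cong₂ (λ a b → if AD a b then Y b else 0ℚ) (dec-enc d) (dec-enc d')))

  sel : Bool → ℚ → ℚ
  sel b q = if b then q else 0ℚ

  A-sym : ∀ u v → A u v ≡ A v u
  A-sym = proj₁ simp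

  e-ordℕ : ∀ i → toℕ (e1 i) ℕ.< toℕ (e2 i)
  e-ordℕ i = e-ord E i

  e12 : ∀ i → e1 i ≢ e2 i
  e12 i q = NP.<-irrefl (cong toℕ q) (e-ordℕ i)

  e-adj : ∀ i → A (e1 i) (e2 i) ≡ true
  e-adj i = T→≡ (e-edge E i)

  endAdj-0 : ∀ u i → endAdj G E s u i F.zero ≡ (e1 i ≟ᶠ u)
  endAdj-0 u i = BP.∨-identityʳ _

  endAdj-last : ∀ u i → endAdj G E s u i lastJ ≡ (e2 i ≟ᶠ u)
  endAdj-last u i = cong₂ (λ p q → (p ∧ (e1 i ≟ᶠ u)) ∨ (q ∧ (e2 i ≟ᶠ u))) (≡ᵇ-false {toℕ lastJ} {0} (λ q → 0≢L (trans (sym q) toℕ-lastJ))) (≡ᵇ-≡ toℕ-lastJ)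
    where
    0≢L : 0 ≢ suc (suc (suc (4 ℕ.* t')))
    0≢L ()

  endAdj-mid : ∀ u i j → j ≢ F.zero → j ≢ lastJ → endAdj G E s u i j ≡ false
  endAdj-mid u i j n0 nl rewrite ≡ᵇ-false {toℕ j} {0} (λ q → n0 (FP.toℕ-injective q))
    | ≡ᵇ-false {toℕ j} {suc (suc (suc (4 ℕ.* t')))} (λ q → nl (FP.toℕ-injective (trans q (sym toℕ-lastJ)))) = refl

  zero≢last : F.zero ≢ lastJ
  zero≢last q with cong toℕ q
  ... | q' = 0≢ (trans q' toℕ-lastJ)
    where
    0≢ : 0 ≢ suc (suc (suc (4 ℕ.* t')))
    0≢ ()

  sum-row-endpoint : ∀ (Y : D → ℚ) u0 i → sumFin s (λ j → sel (AD (inj₁ u0) (inj₂ (i , j))) (Y (inj₂ (i , j))))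
     ≡ sel (e1 i ≟ᶠ u0) (Y (inj₂ (i , F.zero))) + sel (e2 i ≟ᶠ u0) (Y (inj₂ (i , lastJ)))
  sum-row-endpoint Y u0 i = trans (sum-two s _ F.zero lastJ zero≢last z)
     (cong₂ _+_ (cong (λ b → sel b (Y (inj₂ (i , F.zero)))) (endAdj-0 u0 i)) (cong (λ b → sel b (Y (inj₂ (i , lastJ)))) (endAdj-last u0 i)))
    where
    z : ∀ j → j ≢ F.zero → j ≢ lastJ → sel (AD (inj₁ u0) (inj₂ (i , j))) (Y (inj₂ (i , j))) ≡ 0ℚ
    z j n0 nl = cong (λ b → sel b (Y (inj₂ (i , j)))) (endAdj-mid u0 i j n0 nl)

  isEdgeᵇ : V → I → V → Bool
  isEdgeᵇ u0 i u = ((e1 i ≟ᶠ u0) ∧ (e2 i ≟ᶠ u)) ∨ ((e1 i ≟ᶠ u) ∧ (e2 i ≟ᶠ u0))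

  isEdgeᵇ-true : ∀ u0 i u → isEdgeᵇ u0 i u ≡ true → (e1 i ≡ u0 × e2 i ≡ u) ⊎ (e1 i ≡ u × e2 i ≡ u0)
  isEdgeᵇ-true u0 i u q with ∨-true {(e1 i ≟ᶠ u0) ∧ (e2 i ≟ᶠ u)} q
  ... | inj₁ a = inj₁ (≟ᶠ-true (proj₁ (∧-true a)) , ≟ᶠ-true (proj₂ (∧-true a)))
  ... | inj₂ b = inj₂ (≟ᶠ-true (proj₁ (∧-true {e1 i ≟ᶠ u} b)) , ≟ᶠ-true (proj₂ (∧-true {e1 i ≟ᶠ u} b)))

  e-injective : ∀ {i i'} → e1 i ≡ e1 i' → e2 i ≡ e2 i' → i ≡ i'
  e-injective {i} {i'} p q = e-inj E i i' (cong₂ _,_ p q)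

  isEdgeᵇ-unique : ∀ u0 u i i' → isEdgeᵇ u0 i u ≡ true → isEdgeᵇ u0 i' u ≡ true → i ≡ i'
  isEdgeᵇ-unique u0 u i i' c c' with isEdgeᵇ-true u0 i u c | isEdgeᵇ-true u0 i' u c'
  ... | inj₁ (a , b) | inj₁ (a' , b') = e-injective (trans a (sym a')) (trans b (sym b'))
  ... | inj₂ (a , b) | inj₂ (a' , b') = e-injective (trans a (sym a')) (trans b (sym b'))
  ... | inj₁ (a , b) | inj₂ (a' , b') = ⊥-elim (NP.<-asym (subst₂ (λ p q → toℕ p ℕ.< toℕ q) a b (e-ordℕ i)) (subst₂ (λ p q → toℕ p ℕ.< toℕ q) a' b' (e-ordℕ i')))
  ... | inj₂ (a , b) | inj₁ (a' , b') = ⊥-elim (NP.<-asym (subst₂ (λ p q → toℕ p ℕ.< toℕ q) a b (e-ordℕ i)) (subst₂ (λ p q → toℕ p ℕ.< toℕ q) a' b' (e-ordℕ i')))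

  sum-anyFin : ∀ k (c : Fin k → Bool) q → (∀ i i' → c i ≡ true → c i' ≡ true → i ≡ i') → sumFin k (λ i → sel (c i) q) ≡ sel (anyFin k c) q
  sum-anyFin k c q u with anyFin k c in eq
  ... | true with anyFin-true k c eq
  ... | i0 , ci0 = trans (sum-single k _ i0 z) (cong (λ b → sel b q) ci0)
    where
    z : ∀ i → i ≢ i0 → sel (c i) q ≡ 0ℚ
    z i ne with c i in ci
    ... | true = ⊥-elim (ne (u i i0 ci ci0))
    ... | false = refl
  sum-anyFin k c q u | false = sum-zero k _ z
    where
    z : ∀ i → sel (c i) q ≡ 0ℚ
    z i with c i in ci
    ... | true = ⊥-elim (true≢false (trans (sym (anyFin-intro k c i ci)) eq))
    ... | false = refl

  edge-endpoint-sum : ∀ (Yv : V → ℚ) u0 i → sel (e1 i ≟ᶠ u0) (Yv (e2 i)) + sel (e2 i ≟ᶠ u0) (Yv (e1 i)) ≡ sumFin (n G) (λ u → sel (isEdgeᵇ u0 i u) (Yv u))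
  edge-endpoint-sum Yv u0 i with ≟ᶠ-dec (e1 i) u0 | ≟ᶠ-dec (e2 i) u0
  ... | inj₁ (b1 , refl) | inj₁ (b2 , q2) = ⊥-elim (e12 i (sym q2))
  ... | inj₁ (b1 , refl) | inj₂ (b2 , q2) = trans (cong₂ (λ p q → sel p (Yv (e2 i)) + sel q (Yv (e1 i))) b1 b2) (trans (+-identityʳ _) (sym (trans (sum-single (n G) _ (e2 i) z) v)))
    where
    z : ∀ u → u ≢ e2 i → sel (isEdgeᵇ (e1 i) i u) (Yv u) ≡ 0ℚ
    z u ne rewrite ≟ᶠ-refl (e1 i) | ≟ᶠ-false (λ q → ne (sym q)) | ≟ᶠ-false (λ (q : e2 i ≡ e1 i) → e12 i (sym q)) | BP.∧-zeroʳ (e1 i ≟ᶠ u) = refl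
    v : sel (isEdgeᵇ (e1 i) i (e2 i)) (Yv (e2 i)) ≡ Yv (e2 i)
    v rewrite ≟ᶠ-refl (e1 i) | ≟ᶠ-refl (e2 i) = refl
  ... | inj₂ (b1 , q1) | inj₁ (b2 , refl) = trans (cong₂ (λ p q → sel p (Yv (e2 i)) + sel q (Yv (e1 i))) b1 b2) (trans (+-identityˡ _) (sym (trans (sum-single (n G) _ (e1 i) z) v)))
    where
    z : ∀ u → u ≢ e1 i → sel (isEdgeᵇ (e2 i) i u) (Yv u) ≡ 0ℚ
    z u ne rewrite ≟ᶠ-refl (e2 i) | ≟ᶠ-false (λ q → ne (sym q)) | ≟ᶠ-false (e12 i) = refl
    v : sel (isEdgeᵇ (e2 i) i (e1 i)) (Yv (e1 i)) ≡ Yv (e1 i)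
    v rewrite ≟ᶠ-refl (e1 i) | ≟ᶠ-refl (e2 i) | ≟ᶠ-false (e12 i) = refl
  ... | inj₂ (b1 , q1) | inj₂ (b2 , q2) = trans (cong₂ (λ p q → sel p (Yv (e2 i)) + sel q (Yv (e1 i))) b1 b2) (trans (+-identityʳ 0ℚ) (sym (sum-zero (n G) _ z)))
    where
    z : ∀ u → sel (isEdgeᵇ u0 i u) (Yv u) ≡ 0ℚ
    z u rewrite b1 | b2 | BP.∧-zeroʳ (e1 i ≟ᶠ u) = refl

  inE-adj : ∀ u0 u → inE G E s u0 u ≡ true → A u0 u ≡ true
  inE-adj u0 u q with anyFin-true (m E) (λ i → isEdgeᵇ u0 i u) q
  ... | i , c with isEdgeᵇ-true u0 i u c
  ... | inj₁ (refl , refl) = e-adj i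
  ... | inj₂ (refl , refl) = trans (A-sym _ _) (e-adj i)

  AappD-original : ∀ (Y : D → ℚ) → (∀ i → Y (inj₂ (i , F.zero)) ≡ Y (inj₁ (e2 i))) → (∀ i → Y (inj₂ (i , lastJ)) ≡ Y (inj₁ (e1 i)))
     → ∀ u0 → AappD Y (inj₁ u0) ≡ Aapp G (λ u → Y (inj₁ u)) u0
  AappD-original Y h0 hl u0 = begin
      sumFin (n G) (λ u → sel (A u0 u ∧ not (inE G E s u0 u)) (Yv u)) + sumFin (m E) (λ i → sumFin s (λ j → sel (AD (inj₁ u0) (inj₂ (i , j))) (Y (inj₂ (i , j)))))
        ≡⟨ cong (X +_) (sum-cong (m E) (λ i → trans (sum-row-endpoint Y u0 i) (cong₂ (λ a b → sel (e1 i ≟ᶠ u0) a + sel (e2 i ≟ᶠ u0) b) (h0 i) (hl i)))) ⟩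
      X + sumFin (m E) (λ i → sel (e1 i ≟ᶠ u0) (Yv (e2 i)) + sel (e2 i ≟ᶠ u0) (Yv (e1 i)))
        ≡⟨ cong (X +_) (sum-cong (m E) (edge-endpoint-sum Yv u0)) ⟩
      X + sumFin (m E) (λ i → sumFin (n G) (λ u → sel (isEdgeᵇ u0 i u) (Yv u)))
        ≡⟨ cong (X +_) (sum-swap (m E) (n G) _) ⟩
      X + sumFin (n G) (λ u → sumFin (m E) (λ i → sel (isEdgeᵇ u0 i u) (Yv u)))
        ≡⟨ cong (X +_) (sum-cong (n G) (λ u → sum-anyFin (m E) (λ i → isEdgeᵇ u0 i u) (Yv u) (isEdgeᵇ-unique u0 u))) ⟩
      X + sumFin (n G) (λ u → sel (inE G E s u0 u) (Yv u))
        ≡⟨ sym (sum-+ (n G) _ _) ⟩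
      sumFin (n G) (λ u → sel (A u0 u ∧ not (inE G E s u0 u)) (Yv u) + sel (inE G E s u0 u) (Yv u))
        ≡⟨ sum-cong (n G) pw ⟩
      Aapp G Yv u0 ∎
    where
    open ≡-Reasoning
    Yv : V → ℚ
    Yv u = Y (inj₁ u)
    X = sumFin (n G) (λ u → sel (A u0 u ∧ not (inE G E s u0 u)) (Yv u))
    pw : ∀ u → sel (A u0 u ∧ not (inE G E s u0 u)) (Yv u) + sel (inE G E s u0 u) (Yv u) ≡ sel (A u0 u) (Yv u)
    pw u with inE G E s u0 u in q
    ... | true rewrite inE-adj u0 u q = +-identityˡ _
    ... | false rewrite BP.∧-identityʳ (A u0 u) = +-identityʳ _

  atℕ : (J → ℚ) → ℕ → ℚ
  atℕ F a with a ℕ.<? s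
  ... | yes p = F (F.fromℕ< p)
  ... | no _ = 0ℚ

  atℕ-pred : (J → ℚ) → ℕ → ℚ
  atℕ-pred F zero = 0ℚ
  atℕ-pred F (suc a) = atℕ F a

  ≡ᵇ-sym : ∀ a b → (a ℕ.≡ᵇ b) ≡ (b ℕ.≡ᵇ a)
  ≡ᵇ-sym zero zero = refl
  ≡ᵇ-sym zero (suc b) = refl
  ≡ᵇ-sym (suc a) zero = refl
  ≡ᵇ-sym (suc a) (suc b) = ≡ᵇ-sym a b

  sum-select : ∀ (F : J → ℚ) a → sumFin s (λ j → sel (a ℕ.≡ᵇ toℕ j) (F j)) ≡ atℕ F a
  sum-select F a with a ℕ.<? s
  ... | yes p = trans (sum-single s _ (F.fromℕ< p) z) v
    where
    z : ∀ j → j ≢ F.fromℕ< p → sel (a ℕ.≡ᵇ toℕ j) (F j) ≡ 0ℚ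
    z j ne rewrite ≡ᵇ-false {a} {toℕ j} (λ q → ne (FP.toℕ-injective (trans (sym q) (sym (FP.toℕ-fromℕ< p))))) = refl
    v : sel (a ℕ.≡ᵇ toℕ (F.fromℕ< p)) (F (F.fromℕ< p)) ≡ F (F.fromℕ< p)
    v rewrite FP.toℕ-fromℕ< p | ≡ᵇ-refl a = refl
  ... | no np = sum-zero s _ z
    where
    z : ∀ j → sel (a ℕ.≡ᵇ toℕ j) (F j) ≡ 0ℚ
    z j rewrite ≡ᵇ-false {a} {toℕ j} (λ q → np (subst (ℕ._< s) (sym q) (FP.toℕ<n j))) = refl

  sum-select-pred : ∀ (F : J → ℚ) a → sumFin s (λ j → sel (suc (toℕ j) ℕ.≡ᵇ a) (F j)) ≡ atℕ-pred F a
  sum-select-pred F zero = sum-zero s _ (λ j → refl)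
  sum-select-pred F (suc a) = trans (sum-cong s (λ j → cong (λ b → sel b (F j)) (≡ᵇ-sym (toℕ j) a))) (sum-select F a)

  sel-∨ : ∀ p q c → ¬ (p ≡ true × q ≡ true) → sel (p ∨ q) c ≡ sel p c + sel q c
  sel-∨ true true c h = ⊥-elim (h (refl , refl))
  sel-∨ true false c h = sym (+-identityʳ c)
  sel-∨ false true c h = sym (+-identityˡ c)
  sel-∨ false false c h = sym (+-identityˡ 0ℚ)

  L : ℕ
  L = suc (suc (suc (4 ℕ.* t')))

  pathValue : (D → ℚ) → I → ℕ → ℚ
  pathValue Y i zero = Y (inj₁ (e1 i))
  pathValue Y i (suc a) = if a ℕ.≡ᵇ s then Y (inj₁ (e2 i)) else atℕ (λ j → Y (inj₂ (i , j))) a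

  sum-endpoints : ∀ (Yv : V → ℚ) i (b0 bL : Bool) → ¬ (b0 ≡ true × bL ≡ true) →
     sumFin (n G) (λ u → sel ((b0 ∧ (e1 i ≟ᶠ u)) ∨ (bL ∧ (e2 i ≟ᶠ u))) (Yv u)) ≡ sel b0 (Yv (e1 i)) + sel bL (Yv (e2 i))
  sum-endpoints Yv i true true h = ⊥-elim (h (refl , refl))
  sum-endpoints Yv i true false h = trans (sum-single (n G) _ (e1 i) z) (trans v (sym (+-identityʳ _)))
    where
    z : ∀ u → u ≢ e1 i → sel ((e1 i ≟ᶠ u) ∨ false) (Yv u) ≡ 0ℚ
    z u ne rewrite ≟ᶠ-false (λ q → ne (sym q)) = refl
    v : sel ((e1 i ≟ᶠ e1 i) ∨ false) (Yv (e1 i)) ≡ Yv (e1 i)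
    v rewrite ≟ᶠ-refl (e1 i) = refl
  sum-endpoints Yv i false true h = trans (sum-single (n G) _ (e2 i) z) (trans v (sym (+-identityˡ _)))
    where
    z : ∀ u → u ≢ e2 i → sel (e2 i ≟ᶠ u) (Yv u) ≡ 0ℚ
    z u ne rewrite ≟ᶠ-false (λ q → ne (sym q)) = refl
    v : sel (e2 i ≟ᶠ e2 i) (Yv (e2 i)) ≡ Yv (e2 i)
    v rewrite ≟ᶠ-refl (e2 i) = refl
  sum-endpoints Yv i false false h = trans (sum-zero (n G) _ (λ u → refl)) (sym (+-identityˡ 0ℚ))

  sum-internal : ∀ (Y : D → ℚ) i0 j0 →
     sumFin (m E) (λ i → sumFin s (λ j → sel (AD (inj₂ (i0 , j0)) (inj₂ (i , j))) (Y (inj₂ (i , j)))))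
     ≡ atℕ (λ j → Y (inj₂ (i0 , j))) (suc (toℕ j0)) + atℕ-pred (λ j → Y (inj₂ (i0 , j))) (toℕ j0)
  sum-internal Y i0 j0 = trans (sum-single (m E) _ i0 z) (trans (sum-cong s pw) (trans (sum-+ s (λ j → sel (suc (toℕ j0) ℕ.≡ᵇ toℕ j) (Fi j)) (λ j → sel (suc (toℕ j) ℕ.≡ᵇ toℕ j0) (Fi j))) (cong₂ _+_ (sum-select Fi (suc (toℕ j0))) (sum-select-pred Fi (toℕ j0)))))
    where
    Fi : J → ℚ
    Fi j = Y (inj₂ (i0 , j))
    cnd : J → Bool
    cnd j = (suc (toℕ j0) ℕ.≡ᵇ toℕ j) ∨ (suc (toℕ j) ℕ.≡ᵇ toℕ j0)
    z : ∀ i → i ≢ i0 → sumFin s (λ j → sel (AD (inj₂ (i0 , j0)) (inj₂ (i , j))) (Y (inj₂ (i , j)))) ≡ 0ℚ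
    z i ne = sum-zero s _ (λ j → cong (λ b → sel (b ∧ cnd j) (Y (inj₂ (i , j)))) (≟ᶠ-false (λ q → ne (sym q))))
    pw : ∀ j → sel (AD (inj₂ (i0 , j0)) (inj₂ (i0 , j))) (Y (inj₂ (i0 , j))) ≡
            sel (suc (toℕ j0) ℕ.≡ᵇ toℕ j) (Y (inj₂ (i0 , j))) + sel (suc (toℕ j) ℕ.≡ᵇ toℕ j0) (Y (inj₂ (i0 , j)))
    pw j = trans (cong (λ b → sel (b ∧ cnd j) (Y (inj₂ (i0 , j)))) (≟ᶠ-refl i0)) (sel-∨ (suc (toℕ j0) ℕ.≡ᵇ toℕ j) (suc (toℕ j) ℕ.≡ᵇ toℕ j0) (Fi j) ex)
      where
      ex : ¬ ((suc (toℕ j0) ℕ.≡ᵇ toℕ j) ≡ true × (suc (toℕ j) ℕ.≡ᵇ toℕ j0) ≡ true)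
      ex (p , q) = NP.<-asym (NP.≤-reflexive (≡ᵇ-true {suc (toℕ j0)} {toℕ j} p)) (NP.≤-reflexive (≡ᵇ-true {suc (toℕ j)} {toℕ j0} q))

  AappD-internal : ∀ (Y : D → ℚ) i0 j0 → AappD Y (inj₂ (i0 , j0)) ≡ pathValue Y i0 (toℕ j0) + pathValue Y i0 (suc (suc (toℕ j0)))
  AappD-internal Y i0 j0 = trans (cong₂ _+_ (sum-endpoints (λ u → Y (inj₁ u)) i0 (toℕ j0 ℕ.≡ᵇ 0) (toℕ j0 ℕ.≡ᵇ L) ex) (sum-internal Y i0 j0))
    (trans (solve 4 (λ a b c d → (a :+ b) :+ (c :+ d) := (a :+ d) :+ (b :+ c)) refl (sel (toℕ j0 ℕ.≡ᵇ 0) (Y (inj₁ (e1 i0)))) (sel (toℕ j0 ℕ.≡ᵇ L) (Y (inj₁ (e2 i0)))) (atℕ F (suc (toℕ j0))) (atℕ-pred F (toℕ j0))) (cong₂ _+_ (P0 (toℕ j0) (FP.toℕ<n j0)) (P2 (toℕ j0) (FP.toℕ<n j0))))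
    where
    open import Data.Rational.Solver
    open +-*-Solver
    F = λ j → Y (inj₂ (i0 , j))
    ex : ¬ ((toℕ j0 ℕ.≡ᵇ 0) ≡ true × (toℕ j0 ℕ.≡ᵇ L) ≡ true)
    ex (p , q) with trans (sym (≡ᵇ-true {toℕ j0} {0} p)) (≡ᵇ-true {toℕ j0} {L} q)
    ... | ()
    P0 : ∀ a → a ℕ.< s → sel (a ℕ.≡ᵇ 0) (Y (inj₁ (e1 i0))) + atℕ-pred F a ≡ pathValue Y i0 a
    P0 zero _ = +-identityʳ _
    P0 (suc a) lt rewrite ≡ᵇ-false {a} {s} (λ q → NP.<-irrefl q (NP.<-trans (NP.n<1+n a) lt)) = +-identityˡ _
    P2 : ∀ a → a ℕ.< s → sel (a ℕ.≡ᵇ L) (Y (inj₁ (e2 i0))) + atℕ F (suc a) ≡ pathValue Y i0 (suc (suc a))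
    P2 a lt with suc a ℕ.<? s
    ... | yes p rewrite ≡ᵇ-false {a} {L} (λ q → NP.<-irrefl (cong suc q) p) = +-identityˡ _
    ... | no np rewrite ≡ᵇ-≡ {a} {L} (NP.≤-antisym (NP.≤-pred lt) (NP.≤-pred (NP.≮⇒≥ np))) = +-identityʳ _

  -- Along the path e1 i = p₀, p₁, …, p_{s+1} = e2 i a kernel vector takes the values
  -- a, b, −a, −b, a, … (alt4 a b j at p_{j+1}). As 4 ∣ s, p₁ carries the value b at e2 i
  -- and p_s the value a at e1 i, exactly as the deleted edge did.
  alt4 : ℚ → ℚ → ℕ → ℚ
  alt4 a b zero = b
  alt4 a b (suc zero) = - a
  alt4 a b (suc (suc zero)) = - b
  alt4 a b (suc (suc (suc zero))) = a
  alt4 a b (suc (suc (suc (suc j)))) = alt4 a b j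

  pathAlt4 : ℚ → ℚ → ℕ → ℚ
  pathAlt4 a b zero = a
  pathAlt4 a b (suc j) = alt4 a b j

  alt4-kernel : ∀ a b j → alt4 a b j + alt4 a b (suc (suc j)) ≡ 0ℚ
  alt4-kernel a b zero = +-inverseʳ b
  alt4-kernel a b (suc zero) = +-inverseˡ a
  alt4-kernel a b (suc (suc zero)) = +-inverseˡ b
  alt4-kernel a b (suc (suc (suc zero))) = +-inverseʳ a
  alt4-kernel a b (suc (suc (suc (suc j)))) = alt4-kernel a b j

  pathAlt4-kernel : ∀ a b j → pathAlt4 a b j + pathAlt4 a b (suc (suc j)) ≡ 0ℚ
  pathAlt4-kernel a b zero = +-inverseʳ a
  pathAlt4-kernel a b (suc j) = alt4-kernel a b j

  alt4-L : ∀ a b → alt4 a b L ≡ a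
  alt4-L a b = periodic-4 (alt4 a b) (λ _ → refl) t' 3

  alt4-s : ∀ a b → alt4 a b s ≡ b
  alt4-s a b = periodic-4 (alt4 a b) (λ _ → refl) t' 0

  alt4-nonzero : ∀ a b j → a ≢ 0ℚ → b ≢ 0ℚ → alt4 a b j ≢ 0ℚ
  alt4-nonzero a b zero na nb = nb
  alt4-nonzero a b (suc zero) na nb = neg≢0 a na
  alt4-nonzero a b (suc (suc zero)) na nb = neg≢0 b nb
  alt4-nonzero a b (suc (suc (suc zero))) na nb = na
  alt4-nonzero a b (suc (suc (suc (suc j)))) na nb = alt4-nonzero a b j na nb

  alt4-scale : ∀ c a b j → alt4 (c * a) (c * b) j ≡ c * alt4 a b j
  alt4-scale c a b zero = refl
  alt4-scale c a b (suc zero) = neg-distribʳ-* c a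
  alt4-scale c a b (suc (suc zero)) = neg-distribʳ-* c b
  alt4-scale c a b (suc (suc (suc zero))) = refl
  alt4-scale c a b (suc (suc (suc (suc j)))) = alt4-scale c a b j

  kernel-path-determined : ∀ (R : ℕ → ℚ) → (∀ j → j ℕ.< s → R j + R (suc (suc j)) ≡ 0ℚ) → ∀ a → a ℕ.≤ suc s → R a ≡ pathAlt4 (R 0) (R 1) a
  kernel-path-determined R h zero _ = refl
  kernel-path-determined R h (suc zero) _ = refl
  kernel-path-determined R h (suc (suc a)) le = trans (+≡0⇒≡- (h a lt)) (trans (cong -_ (kernel-path-determined R h a le')) (sym (+≡0⇒≡- (pathAlt4-kernel (R 0) (R 1) a))))
    where
    lt : a ℕ.< s
    lt = NP.≤-pred le
    le' : a ℕ.≤ suc s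
    le' = NP.≤-trans (NP.n≤1+n a) (NP.≤-trans (NP.n≤1+n (suc a)) le)

  Aapp-cong : ∀ (H : Graph) {y z : Fin (n H) → ℚ} → (∀ w → y w ≡ z w) → ∀ v → Aapp H y v ≡ Aapp H z v
  Aapp-cong H h v = sum-cong (n H) (λ w → cong (if adj H v w then_else 0ℚ) (h w))

  atℕ-toℕ : ∀ (F : J → ℚ) j → atℕ F (toℕ j) ≡ F j
  atℕ-toℕ F j with toℕ j ℕ.<? s
  ... | yes p = cong F (FP.fromℕ<-toℕ j p)
  ... | no np = ⊥-elim (np (FP.toℕ<n j))

  pathValue-internal : ∀ Y i j → pathValue Y i (suc (toℕ j)) ≡ Y (inj₂ (i , j))
  pathValue-internal Y i j rewrite ≡ᵇ-false {toℕ j} {s} (λ q → NP.<-irrefl q (FP.toℕ<n j)) = atℕ-toℕ _ j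

  pathValue-end : ∀ Y i → pathValue Y i (suc s) ≡ Y (inj₁ (e2 i))
  pathValue-end Y i rewrite ≡ᵇ-refl s = refl

  module Kernel (nut : IsNut G) where

    open NutVector G nut

    xD : D → ℚ
    xD (inj₁ u) = x u
    xD (inj₂ (i , j)) = alt4 (x (e1 i)) (x (e2 i)) (toℕ j)

    xD≢0 : ∀ d → xD d ≢ 0ℚ
    xD≢0 (inj₁ u) = x≢0 u
    xD≢0 (inj₂ (i , j)) = alt4-nonzero _ _ (toℕ j) (x≢0 (e1 i)) (x≢0 (e2 i))

    pathValue-xD : ∀ i a → a ℕ.≤ suc s → pathValue xD i a ≡ pathAlt4 (x (e1 i)) (x (e2 i)) a
    pathValue-xD i zero _ = refl
    pathValue-xD i (suc a) le with a ℕ.≟ s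
    ... | yes refl = trans (pathValue-end xD i) (sym (alt4-s _ _))
    ... | no ne = trans (cong (λ j → pathValue xD i (suc j)) (sym (FP.toℕ-fromℕ< lt))) (trans (pathValue-internal xD i (F.fromℕ< lt)) (cong (alt4 (x (e1 i)) (x (e2 i))) (FP.toℕ-fromℕ< lt)))
      where
      lt : a ℕ.< s
      lt = NP.≤∧≢⇒< (NP.≤-pred le) ne

    xD-kernel : ∀ d → AappD xD d ≡ 0ℚ
    xD-kernel (inj₁ u) = trans (AappD-original xD (λ i → refl) (λ i → trans (cong (alt4 (x (e1 i)) (x (e2 i))) toℕ-lastJ) (alt4-L _ _)) u) (x-kernel u)
    xD-kernel (inj₂ (i , j)) = trans (AappD-internal xD i j) (trans (cong₂ _+_ (pathValue-xD i (toℕ j) (NP.≤-trans (NP.<⇒≤ (FP.toℕ<n j)) (NP.n≤1+n s)))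
                            (pathValue-xD i (suc (suc (toℕ j))) (s≤s (FP.toℕ<n j)))) (pathAlt4-kernel _ _ (toℕ j)))

    x₁ : Fin N1 → ℚ
    x₁ w = xD (dec w)

    x₁-kernel : InKernel G1 x₁
    x₁-kernel w = trans (cong (Aapp G1 x₁) (sym (enc-dec w))) (trans (Aapp-enc xD (dec w)) (xD-kernel (dec w)))

    x₁-spans : ∀ y → InKernel G1 y → Σ ℚ (λ c → ∀ w → y w ≡ c * x₁ w)
    x₁-spans y yk = c , y≡cx₁
      where
      Y : D → ℚ
      Y d = y (enc d)
      Y-kernel : ∀ d → AappD Y d ≡ 0ℚ
      Y-kernel d = trans (sym (Aapp-enc Y d)) (trans (Aapp-cong G1 (λ w → cong y (enc-dec w)) (enc d)) (yk (enc d)))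
      along : I → ℕ → ℚ
      along i = pathValue Y i
      along-kernel : ∀ i j → j ℕ.< s → along i j + along i (suc (suc j)) ≡ 0ℚ
      along-kernel i j lt = trans (cong (λ z → along i z + along i (suc (suc z))) (sym (FP.toℕ-fromℕ< lt))) (trans (sym (AappD-internal Y i (F.fromℕ< lt))) (Y-kernel (inj₂ (i , F.fromℕ< lt))))
      along-alt4 : ∀ i a → a ℕ.≤ suc s → along i a ≡ pathAlt4 (along i 0) (along i 1) a
      along-alt4 i = kernel-path-determined (along i) (along-kernel i)
      along-1 : ∀ i → along i 1 ≡ Y (inj₁ (e2 i))
      along-1 i = trans (sym (alt4-s (along i 0) (along i 1))) (trans (sym (along-alt4 i (suc s) NP.≤-refl)) (pathValue-end Y i))
      along-1′ : ∀ i → along i 1 ≡ Y (inj₂ (i , F.zero))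
      along-1′ i = pathValue-internal Y i F.zero
      Y-internal : ∀ i j → Y (inj₂ (i , j)) ≡ alt4 (Y (inj₁ (e1 i))) (Y (inj₁ (e2 i))) (toℕ j)
      Y-internal i j = trans (sym (pathValue-internal Y i j)) (trans (along-alt4 i (suc (toℕ j)) (s≤s (NP.<⇒≤ (FP.toℕ<n j)))) (cong (λ b → alt4 (Y (inj₁ (e1 i))) b (toℕ j)) (along-1 i)))
      Y-first : ∀ i → Y (inj₂ (i , F.zero)) ≡ Y (inj₁ (e2 i))
      Y-first i = trans (sym (along-1′ i)) (along-1 i)
      Y-last : ∀ i → Y (inj₂ (i , lastJ)) ≡ Y (inj₁ (e1 i))
      Y-last i = trans (Y-internal i lastJ) (trans (cong (alt4 _ _) toℕ-lastJ) (alt4-L _ _))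
      Y-original-kernel : InKernel G (λ u → Y (inj₁ u))
      Y-original-kernel u = trans (sym (AappD-original Y Y-first Y-last u)) (Y-kernel (inj₁ u))
      c = proj₁ (x-spans _ Y-original-kernel)
      hc = proj₂ (x-spans _ Y-original-kernel)
      Y≡cxD : ∀ d → Y d ≡ c * xD d
      Y≡cxD (inj₁ u) = hc u
      Y≡cxD (inj₂ (i , j)) = trans (Y-internal i j) (trans (cong₂ (λ a b → alt4 a b (toℕ j)) (hc (e1 i)) (hc (e2 i))) (alt4-scale c _ _ (toℕ j)))
      y≡cx₁ : ∀ w → y w ≡ c * x₁ w
      y≡cx₁ w = trans (cong y (sym (enc-dec w))) (Y≡cxD (dec w))

    N1≥2 : 2 ℕ.≤ N1
    N1≥2 = NP.≤-trans (proj₁ nut) (NP.m≤m+n (n G) _)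

    isNut₁ : IsNut G1
    isNut₁ = N1≥2 , x₁ , (λ w → xD≢0 (dec w)) , x₁-kernel , x₁-spans

module Lift (G : Graph) (simp : IsSimple G) (E : EdgeOrbit G) (t' : ℕ) where

  open Prelude
  open Subdivision G simp E t'

  orient : Bool → V × V → V × V
  orient false p = p
  orient true (a , b) = (b , a)

  orient-xor : ∀ b b' p → orient b' (orient b p) ≡ orient (b xor b') p
  orient-xor false false p = refl
  orient-xor false true p = refl
  orient-xor true false p = refl
  orient-xor true true p = refl

  map-pair : (V → V) → V × V → V × V
  map-pair f (a , b) = (f a , f b)

  map-orient : ∀ f b p → map-pair f (orient b p) ≡ orient b (map-pair f p)
  map-orient f false p = refl
  map-orient f true p = refl

  orient-unique : ∀ {i i' b b' p} → e E i ≡ orient b p → e E i' ≡ orient b' p → i ≡ i' × b ≡ b'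
  orient-unique {i} {i'} {false} {false} q q' = e-inj E i i' (trans q (sym q')) , refl
  orient-unique {i} {i'} {true} {true} q q' = e-inj E i i' (trans q (sym q')) , refl
  orient-unique {i} {i'} {false} {true} {p} q q' = ⊥-elim (NP.<-asym (subst (λ z → toℕ (proj₁ z) ℕ.< toℕ (proj₂ z)) q (e-ordℕ i)) (subst (λ z → toℕ (proj₁ z) ℕ.< toℕ (proj₂ z)) q' (e-ordℕ i')))
  orient-unique {i} {i'} {true} {false} {p} q q' = ⊥-elim (NP.<-asym (subst (λ z → toℕ (proj₁ z) ℕ.< toℕ (proj₂ z)) q (e-ordℕ i)) (subst (λ z → toℕ (proj₁ z) ℕ.< toℕ (proj₂ z)) q' (e-ordℕ i')))

  ep : I → V × V
  ep i = e1 i , e2 i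

  xor-false : ∀ b b' → (b xor b') ≡ false → b' ≡ b
  xor-false false false _ = refl
  xor-false true true _ = refl

  flipJ : Bool → J → J
  flipJ false j = j
  flipJ true j = F.opposite j

  flipJ-involutive : ∀ b j → flipJ b (flipJ b j) ≡ j
  flipJ-involutive false j = refl
  flipJ-involutive true j = FP.opposite-involutive j

  toℕ≤L : ∀ (j : J) → toℕ j ℕ.≤ L
  toℕ≤L j = NP.≤-pred (FP.toℕ<n j)

  opposite-sum : ∀ (j : J) → toℕ j ℕ.+ toℕ (F.opposite j) ≡ L
  opposite-sum j = trans (cong (toℕ j ℕ.+_) (FP.opposite-prop j)) (NP.m+[n∸m]≡n (toℕ≤L j))

  aut⁻¹ : Aut G → Aut G
  aut⁻¹ (p , h) = Perm.flip p , λ u v → trans (sym (h (Perm.flip p ⟨$⟩ʳ u) (Perm.flip p ⟨$⟩ʳ v))) (cong₂ (adj G) (inverseʳ p) (inverseʳ p))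

  aut⁻¹-inverseˡ : ∀ σ u → ap (aut⁻¹ σ) (ap σ u) ≡ u
  aut⁻¹-inverseˡ (p , h) u = inverseˡ p

  aut⁻¹-inverseʳ : ∀ σ u → ap σ (ap (aut⁻¹ σ) u) ≡ u
  aut⁻¹-inverseʳ (p , h) u = inverseʳ p

  ap-injective : ∀ σ {u v} → ap σ u ≡ ap σ v → u ≡ v
  ap-injective σ {u} {v} q = trans (sym (aut⁻¹-inverseˡ σ u)) (trans (cong (ap (aut⁻¹ σ)) q) (aut⁻¹-inverseˡ σ v))

  aut-∘ : Aut G → Aut G → Aut G
  aut-∘ (p , h) (p' , h') = (p Perm.∘ₚ p') , λ u v → trans (h' _ _) (h u v)

  ≟ᶠ-ap : ∀ σ u v → (ap σ u ≟ᶠ ap σ v) ≡ (u ≟ᶠ v)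
  ≟ᶠ-ap σ u v with ≟ᶠ-dec u v
  ... | inj₁ (b , refl) = trans (≟ᶠ-refl (ap σ u)) (sym b)
  ... | inj₂ (b , ne) = trans (≟ᶠ-false (λ q → ne (ap-injective σ q))) (sym b)

  module EdgeAction (σ : Aut G) where
    σf : V → V
    σf = ap σ

    σ-adj : ∀ u v → A (σf u) (σf v) ≡ A u v
    σ-adj = proj₂ σ

    edge-image : ∀ i → Σ I (λ i' → Σ Bool (λ b → e E i' ≡ orient b (map-pair σf (ep i))))
    edge-image i with toℕ (σf (e1 i)) ℕ.<? toℕ (σf (e2 i))
    ... | yes lt = proj₁ r , false , proj₂ r
      where
      r = e-closed E i (σf (e1 i)) (σf (e2 i)) (≡→T (trans (σ-adj _ _) (e-adj i))) lt (σ , inj₁ (refl , refl))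
    ... | no nlt = proj₁ r , true , proj₂ r
      where
      ne : σf (e2 i) ≢ σf (e1 i)
      ne q = e12 i (ap-injective σ (sym q))
      lt : toℕ (σf (e2 i)) ℕ.< toℕ (σf (e1 i))
      lt = NP.≤∧≢⇒< (NP.≮⇒≥ nlt) (λ q → ne (FP.toℕ-injective q))
      r = e-closed E i (σf (e2 i)) (σf (e1 i)) (≡→T (trans (A-sym _ _) (trans (σ-adj _ _) (e-adj i)))) lt (σ , inj₂ (refl , refl))

    π : I → I
    π i = proj₁ (edge-image i)
    reversed : I → Bool
    reversed i = proj₁ (proj₂ (edge-image i))
    π-spec : ∀ i → e E (π i) ≡ orient (reversed i) (map-pair σf (ep i))
    π-spec i = proj₂ (proj₂ (edge-image i))

    act : D → D
    act (inj₁ u) = inj₁ (σf u)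
    act (inj₂ (i , j)) = inj₂ (π i , flipJ (reversed i) j)

    π-unique : ∀ i i' b → e E i' ≡ orient b (map-pair σf (ep i)) → i' ≡ π i × b ≡ reversed i
    π-unique i i' b q = orient-unique q (π-spec i)

  open EdgeAction public

  module _ (σ ρ : Aut G) (h : ∀ u → ap ρ (ap σ u) ≡ u) (i : I) where
    private
      q : e E (π ρ (π σ i)) ≡ orient (reversed σ i xor reversed ρ (π σ i)) (ep i)
      q = begin
          e E (π ρ (π σ i))   ≡⟨ π-spec ρ (π σ i) ⟩
          orient (reversed ρ (π σ i)) (map-pair (ap ρ) (ep (π σ i)))  ≡⟨ cong (λ z → orient (reversed ρ (π σ i)) (map-pair (ap ρ) z)) (π-spec σ i) ⟩
          orient (reversed ρ (π σ i)) (map-pair (ap ρ) (orient (reversed σ i) (map-pair (ap σ) (ep i))))  ≡⟨ cong (orient (reversed ρ (π σ i))) (map-orient (ap ρ) (reversed σ i) _) ⟩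
          orient (reversed ρ (π σ i)) (orient (reversed σ i) (map-pair (ap ρ) (map-pair (ap σ) (ep i))))  ≡⟨ cong (λ z → orient (reversed ρ (π σ i)) (orient (reversed σ i) z)) (cong₂ _,_ (h (e1 i)) (h (e2 i))) ⟩
          orient (reversed ρ (π σ i)) (orient (reversed σ i) (ep i))  ≡⟨ orient-xor (reversed σ i) (reversed ρ (π σ i)) (ep i) ⟩
          orient (reversed σ i xor reversed ρ (π σ i)) (ep i) ∎
        where open ≡-Reasoning
      u : i ≡ π ρ (π σ i) × (false ≡ reversed σ i xor reversed ρ (π σ i))
      u = orient-unique {i} {π ρ (π σ i)} {false} {reversed σ i xor reversed ρ (π σ i)} {ep i} refl q
    π-cancel : π ρ (π σ i) ≡ i
    π-cancel = sym (proj₁ u)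
    reversed-cancel : reversed ρ (π σ i) ≡ reversed σ i
    reversed-cancel = xor-false (reversed σ i) (reversed ρ (π σ i)) (sym (proj₂ u))

  act-cancel : ∀ σ ρ → (∀ u → ap ρ (ap σ u) ≡ u) → ∀ d → act ρ (act σ d) ≡ d
  act-cancel σ ρ h (inj₁ u) = cong inj₁ (h u)
  act-cancel σ ρ h (inj₂ (i , j)) = cong inj₂ (cong₂ _,_ (π-cancel σ ρ h i) (trans (cong (λ b → flipJ b (flipJ (reversed σ i) j)) (reversed-cancel σ ρ h i)) (flipJ-involutive (reversed σ i) j)))

  π-injective : ∀ σ {i i'} → π σ i ≡ π σ i' → i ≡ i'
  π-injective σ {i} {i'} q = trans (sym (π-cancel σ (aut⁻¹ σ) (aut⁻¹-inverseˡ σ) i)) (trans (cong (π (aut⁻¹ σ)) q) (π-cancel σ (aut⁻¹ σ) (aut⁻¹-inverseˡ σ) i'))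

  bool-iff : ∀ {p q : Bool} → (p ≡ true → q ≡ true) → (q ≡ true → p ≡ true) → p ≡ q
  bool-iff {true} {q} f g = sym (f refl)
  bool-iff {false} {true} f g = g refl
  bool-iff {false} {false} f g = refl

  EdgeIs : I → V → V → Set
  EdgeIs i a b = (e1 i ≡ a × e2 i ≡ b) ⊎ (e1 i ≡ b × e2 i ≡ a)

  EdgeIs-map : ∀ (f : V → V) i i' b {a c} → e E i' ≡ orient b (map-pair f (ep i)) → EdgeIs i a c → EdgeIs i' (f a) (f c)
  EdgeIs-map f i i' false q (inj₁ (p1 , p2)) = inj₁ (trans (cong proj₁ q) (cong f p1) , trans (cong proj₂ q) (cong f p2))
  EdgeIs-map f i i' false q (inj₂ (p1 , p2)) = inj₂ (trans (cong proj₁ q) (cong f p1) , trans (cong proj₂ q) (cong f p2))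
  EdgeIs-map f i i' true q (inj₁ (p1 , p2)) = inj₂ (trans (cong proj₁ q) (cong f p2) , trans (cong proj₂ q) (cong f p1))
  EdgeIs-map f i i' true q (inj₂ (p1 , p2)) = inj₁ (trans (cong proj₁ q) (cong f p2) , trans (cong proj₂ q) (cong f p1))

  isEdgeᵇ-intro : ∀ a i b → EdgeIs i a b → isEdgeᵇ a i b ≡ true
  isEdgeᵇ-intro a i b (inj₁ (refl , refl)) rewrite ≟ᶠ-refl (e1 i) | ≟ᶠ-refl (e2 i) = refl
  isEdgeᵇ-intro a i b (inj₂ (refl , refl)) rewrite ≟ᶠ-refl (e1 i) | ≟ᶠ-refl (e2 i) = BP.∨-zeroʳ _

  inE-true : ∀ u v → inE G E s u v ≡ true → Σ I (λ i → EdgeIs i u v)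
  inE-true u v q with anyFin-true (m E) (λ i → isEdgeᵇ u i v) q
  ... | i , c = i , isEdgeᵇ-true u i v c

  inE-intro : ∀ u v i → EdgeIs i u v → inE G E s u v ≡ true
  inE-intro u v i se = anyFin-intro (m E) (λ i → isEdgeᵇ u i v) i (isEdgeᵇ-intro u i v se)

  inE-act-true : ∀ σ u v → inE G E s u v ≡ true → inE G E s (ap σ u) (ap σ v) ≡ true
  inE-act-true σ u v q with inE-true u v q
  ... | i , se = inE-intro _ _ (π σ i) (EdgeIs-map (ap σ) i (π σ i) (reversed σ i) (π-spec σ i) se)

  inE-act : ∀ σ u v → inE G E s (ap σ u) (ap σ v) ≡ inE G E s u v
  inE-act σ u v = bool-iff (λ q → subst₂ (λ a b → inE G E s a b ≡ true) (aut⁻¹-inverseˡ σ u) (aut⁻¹-inverseˡ σ v) (inE-act-true (aut⁻¹ σ) _ _ q)) (inE-act-true σ u v)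

  endᵇ : ℕ → Bool → Bool → Bool
  endᵇ a p q = ((a ℕ.≡ᵇ 0) ∧ p) ∨ ((a ℕ.≡ᵇ L) ∧ q)

  opposite-0 : ∀ j → (toℕ (F.opposite j) ℕ.≡ᵇ 0) ≡ (toℕ j ℕ.≡ᵇ L)
  opposite-0 j = bool-iff (λ q → ≡ᵇ-≡ (trans (sym (NP.+-identityʳ (toℕ j))) (trans (cong (toℕ j ℕ.+_) (sym (≡ᵇ-true q))) (opposite-sum j))))
                    (λ q → ≡ᵇ-≡ (NP.+-cancelˡ-≡ (toℕ j) _ _ (trans (opposite-sum j) (trans (sym (≡ᵇ-true q)) (sym (NP.+-identityʳ (toℕ j)))))))

  opposite-L : ∀ j → (toℕ (F.opposite j) ℕ.≡ᵇ L) ≡ (toℕ j ℕ.≡ᵇ 0)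
  opposite-L j = bool-iff (λ q → ≡ᵇ-≡ (NP.+-cancelʳ-≡ (toℕ (F.opposite j)) (toℕ j) 0 (trans (opposite-sum j) (sym (≡ᵇ-true q)))))
                    (λ q → ≡ᵇ-≡ (trans (sym (cong (ℕ._+ toℕ (F.opposite j)) (≡ᵇ-true q))) (opposite-sum j)))

  endᵇ-opposite : ∀ j p q → endᵇ (toℕ (F.opposite j)) p q ≡ endᵇ (toℕ j) q p
  endᵇ-opposite j p q rewrite opposite-0 j | opposite-L j = BP.∨-comm ((toℕ j ℕ.≡ᵇ L) ∧ p) ((toℕ j ℕ.≡ᵇ 0) ∧ q)

  endAdj-act : ∀ σ u i i' b j → e E i' ≡ orient b (map-pair (ap σ) (ep i)) → endAdj G E s (ap σ u) i' (flipJ b j) ≡ endAdj G E s u i j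
  endAdj-act σ u i i' false j q = cong₂ (endᵇ (toℕ j)) (trans (cong (_≟ᶠ ap σ u) (cong proj₁ q)) (≟ᶠ-ap σ _ _)) (trans (cong (_≟ᶠ ap σ u) (cong proj₂ q)) (≟ᶠ-ap σ _ _))
  endAdj-act σ u i i' true j q = trans (cong₂ (endᵇ (toℕ (F.opposite j))) (trans (cong (_≟ᶠ ap σ u) (cong proj₁ q)) (≟ᶠ-ap σ _ _)) (trans (cong (_≟ᶠ ap σ u) (cong proj₂ q)) (≟ᶠ-ap σ _ _))) (endᵇ-opposite j _ _)

  consecutiveᵇ : ℕ → ℕ → Bool
  consecutiveᵇ a b = (suc a ℕ.≡ᵇ b) ∨ (suc b ℕ.≡ᵇ a)

  opposite-consecutive : ∀ j j' → (suc (toℕ (F.opposite j)) ℕ.≡ᵇ toℕ (F.opposite j')) ≡ (suc (toℕ j') ℕ.≡ᵇ toℕ j)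
  opposite-consecutive j j' = bool-iff f g
    where
    a = toℕ j
    a' = toℕ (F.opposite j)
    b = toℕ j'
    b' = toℕ (F.opposite j')
    f : (suc a' ℕ.≡ᵇ b') ≡ true → (suc b ℕ.≡ᵇ a) ≡ true
    f q = ≡ᵇ-≡ (sym (NP.+-cancelʳ-≡ a' a (suc b) (trans (opposite-sum j) (trans (sym (opposite-sum j')) (trans (cong (b ℕ.+_) (sym (≡ᵇ-true q))) (NP.+-suc b a'))))))
    g : (suc b ℕ.≡ᵇ a) ≡ true → (suc a' ℕ.≡ᵇ b') ≡ true
    g q = ≡ᵇ-≡ (sym (NP.+-cancelˡ-≡ b b' (suc a') (trans (opposite-sum j') (trans (sym (opposite-sum j)) (trans (cong (ℕ._+ a') (sym (≡ᵇ-true q))) (sym (NP.+-suc b a')))))))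

  consecutiveᵇ-flipJ : ∀ b j j' → consecutiveᵇ (toℕ (flipJ b j)) (toℕ (flipJ b j')) ≡ consecutiveᵇ (toℕ j) (toℕ j')
  consecutiveᵇ-flipJ false j j' = refl
  consecutiveᵇ-flipJ true j j' = trans (cong₂ _∨_ (opposite-consecutive j j') (opposite-consecutive j' j)) (BP.∨-comm (suc (toℕ j') ℕ.≡ᵇ toℕ j) (suc (toℕ j) ℕ.≡ᵇ toℕ j'))

  AD-act : ∀ σ d d' → AD (act σ d) (act σ d') ≡ AD d d'
  AD-act σ (inj₁ u) (inj₁ v) = cong₂ (λ p q → p ∧ not q) (proj₂ σ u v) (inE-act σ u v)
  AD-act σ (inj₁ u) (inj₂ (i , j)) = endAdj-act σ u i (π σ i) (reversed σ i) j (π-spec σ i)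
  AD-act σ (inj₂ (i , j)) (inj₁ u) = endAdj-act σ u i (π σ i) (reversed σ i) j (π-spec σ i)
  AD-act σ (inj₂ (i , j)) (inj₂ (i' , j')) with i FP.≟ i'
  ... | yes refl = cong₂ _∧_ (trans (≟ᶠ-refl (π σ i)) (sym (≟ᶠ-refl i))) (consecutiveᵇ-flipJ (reversed σ i) j j')
  ... | no ne = trans (cong (_∧ consecutiveᵇ (toℕ (flipJ (reversed σ i) j)) (toℕ (flipJ (reversed σ i') j'))) (≟ᶠ-false (λ q → ne (π-injective σ q)))) (sym (cong (_∧ consecutiveᵇ (toℕ j) (toℕ j')) (≟ᶠ-false ne)))

  lift : Aut G → Aut G1
  lift σ = Perm.permutation f g fg gf , isAut
    where
    f g : Fin N1 → Fin N1
    f w = enc (act σ (dec w))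
    g w = enc (act (aut⁻¹ σ) (dec w))
    fg : ∀ w → f (g w) ≡ w
    fg w = trans (cong (λ z → enc (act σ z)) (dec-enc (act (aut⁻¹ σ) (dec w)))) (trans (cong enc (act-cancel (aut⁻¹ σ) σ (aut⁻¹-inverseʳ σ) (dec w))) (enc-dec w))
    gf : ∀ w → g (f w) ≡ w
    gf w = trans (cong (λ z → enc (act (aut⁻¹ σ) z)) (dec-enc (act σ (dec w)))) (trans (cong enc (act-cancel σ (aut⁻¹ σ) (aut⁻¹-inverseˡ σ) (dec w))) (enc-dec w))
    isAut : IsAut G1 (Perm.permutation f g fg gf)
    isAut u v = trans (cong₂ AD (dec-enc (act σ (dec u))) (dec-enc (act σ (dec v)))) (AD-act σ (dec u) (dec v))

module Restriction (G : Graph) (simp : IsSimple G) (nut : IsNut G) (vt : VertexTransitive G) (E : EdgeOrbit G) (t' : ℕ) where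

  open Prelude
  open Subdivision G simp E t'
  open Lift G simp E t'
  module MinDeg = MinDegree G simp nut vt

  ThreeNeighboursD : D → Set
  ThreeNeighboursD d = Σ D λ a → Σ D λ b → Σ D λ c →
    (AD d a ≡ true) × (AD d b ≡ true) × (AD d c ≡ true) × (a ≢ b) × (a ≢ c) × (b ≢ c)

  ThreeNeighboursD-map : ∀ (Fm : D → D) → (∀ d d' → AD (Fm d) (Fm d') ≡ AD d d') → (∀ d d' → Fm d ≡ Fm d' → d ≡ d') → ∀ d → ThreeNeighboursD d → ThreeNeighboursD (Fm d)
  ThreeNeighboursD-map Fm h inj d (a , b , c , ha , hb , hc , ab , ac , bc) =
    Fm a , Fm b , Fm c , trans (h d a) ha , trans (h d b) hb , trans (h d c) hc ,
    (λ q → ab (inj _ _ q)) , (λ q → ac (inj _ _ q)) , (λ q → bc (inj _ _ q))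

  pathPred : I → J → D
  pathPred i F.zero = inj₁ (e1 i)
  pathPred i (F.suc j) = inj₂ (i , F.inject₁ j)

  pathSucc : I → J → D
  pathSucc i j with toℕ j ℕ.≟ L
  ... | yes _ = inj₁ (e2 i)
  ... | no ne = inj₂ (i , F.fromℕ< (s≤s (NP.≤∧≢⇒< (toℕ≤L j) ne)))

  pathSucc-last : ∀ i j → toℕ j ≡ L → pathSucc i j ≡ inj₁ (e2 i)
  pathSucc-last i j q with toℕ j ℕ.≟ L
  ... | yes _ = refl
  ... | no ne = ⊥-elim (ne q)

  pathSucc-internal : ∀ i j j' → toℕ j' ≡ suc (toℕ j) → pathSucc i j ≡ inj₂ (i , j')
  pathSucc-internal i j j' q with toℕ j ℕ.≟ L
  ... | yes e = ⊥-elim (NP.<-irrefl refl (NP.≤-trans (s≤s (NP.≤-reflexive (sym (trans q (cong suc e))))) (FP.toℕ<n j')))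
  ... | no ne = cong (λ z → inj₂ (i , z)) (FP.toℕ-injective (trans (FP.toℕ-fromℕ< (s≤s (NP.≤∧≢⇒< (toℕ≤L j) ne))) (sym q)))

  internal-nbrs : ∀ i j d → AD (inj₂ (i , j)) d ≡ true → d ≡ pathPred i j ⊎ d ≡ pathSucc i j
  internal-nbrs i j (inj₁ u) q with ∨-true {(toℕ j ℕ.≡ᵇ 0) ∧ (e1 i ≟ᶠ u)} q
  ... | inj₁ a with ∧-true {toℕ j ℕ.≡ᵇ 0} a
  ...   | a1 , a2 with j
  ...     | F.zero = inj₁ (cong inj₁ (sym (≟ᶠ-true a2)))
  ...     | F.suc j' = ⊥-elim (true≢false (sym a1))
  internal-nbrs i j (inj₁ u) q | inj₂ b with ∧-true {toℕ j ℕ.≡ᵇ L} b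
  ... | b1 , b2 = inj₂ (trans (cong inj₁ (sym (≟ᶠ-true b2))) (sym (pathSucc-last i j (≡ᵇ-true b1))))
  internal-nbrs i j (inj₂ (i' , j')) q with ∧-true {i ≟ᶠ i'} q
  ... | q1 , q2 with ≟ᶠ-true {a = i} {b = i'} q1
  ... | refl with ∨-true {suc (toℕ j) ℕ.≡ᵇ toℕ j'} q2
  ... | inj₁ c = inj₂ (sym (pathSucc-internal i j j' (sym (≡ᵇ-true c))))
  ... | inj₂ c = inj₁ (low j (≡ᵇ-true c))
    where
    low : ∀ (j : J) → suc (toℕ j') ≡ toℕ j → inj₂ (i , j') ≡ pathPred i j
    low F.zero ()
    low (F.suc k) w = cong (λ z → inj₂ (i , z)) (FP.toℕ-injective (trans (NP.suc-injective w) (sym (FP.toℕ-inject₁ k))))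

  internal-lacks-three : ∀ i j → ¬ ThreeNeighboursD (inj₂ (i , j))
  internal-lacks-three i j (a , b , c , ha , hb , hc , ab , ac , bc) with internal-nbrs i j a ha | internal-nbrs i j b hb | internal-nbrs i j c hc
  ... | inj₁ p | inj₁ q | _ = ab (trans p (sym q))
  ... | inj₂ p | inj₂ q | _ = ab (trans p (sym q))
  ... | inj₁ p | _ | inj₁ r = ac (trans p (sym r))
  ... | inj₂ p | _ | inj₂ r = ac (trans p (sym r))
  ... | _ | inj₁ q | inj₁ r = bc (trans q (sym r))
  ... | _ | inj₂ q | inj₂ r = bc (trans q (sym r))

  internalNbr : V → I → D
  internalNbr u i = if e1 i ≟ᶠ u then inj₂ (i , F.zero) else inj₂ (i , lastJ)

  nbrD′ : ∀ u w (b : Bool) → inE G E s u w ≡ b → D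
  nbrD′ u w false q = inj₁ w
  nbrD′ u w true q = internalNbr u (proj₁ (inE-true u w q))

  nbrD : V → V → D
  nbrD u w = nbrD′ u w (inE G E s u w) refl

  original : V → D → V
  original u (inj₁ w) = w
  original u (inj₂ (i , j)) = if e1 i ≟ᶠ u then e2 i else e1 i

  internalNbr-adj : ∀ u w i → EdgeIs i u w → AD (inj₁ u) (internalNbr u i) ≡ true
  internalNbr-adj u w i se with ≟ᶠ-dec (e1 i) u
  ... | inj₁ (b , p) rewrite b = trans (endAdj-0 u i) b
  ... | inj₂ (b , np) rewrite b with se
  ...   | inj₁ (p1 , _) = ⊥-elim (np p1)
  ...   | inj₂ (_ , p2) = trans (endAdj-last u i) (≟ᶠ-≡ p2)

  original-internalNbr : ∀ u w i → EdgeIs i u w → original u (internalNbr u i) ≡ w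
  original-internalNbr u w i se with ≟ᶠ-dec (e1 i) u
  ... | inj₁ (b , p) rewrite b with se
  ...   | inj₁ (_ , p2) rewrite b = p2
  ...   | inj₂ (p1 , p2) = ⊥-elim (e12 i (trans p (sym p2)))
  original-internalNbr u w i se | inj₂ (b , np) rewrite b with se
  ...   | inj₁ (p1 , _) = ⊥-elim (np p1)
  ...   | inj₂ (p1 , _) rewrite b = p1

  nbrD′-adj : ∀ u w b q → A u w ≡ true → AD (inj₁ u) (nbrD′ u w b q) ≡ true
  nbrD′-adj u w false q a rewrite a | q = refl
  nbrD′-adj u w true q a = internalNbr-adj u w _ (proj₂ (inE-true u w q))

  original-nbrD′ : ∀ u w b q → original u (nbrD′ u w b q) ≡ w
  original-nbrD′ u w false q = refl
  original-nbrD′ u w true q = original-internalNbr u w _ (proj₂ (inE-true u w q))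

  nbrD-adj : ∀ u w → A u w ≡ true → AD (inj₁ u) (nbrD u w) ≡ true
  nbrD-adj u w = nbrD′-adj u w _ refl

  original-nbrD : ∀ u w → original u (nbrD u w) ≡ w
  original-nbrD u w = original-nbrD′ u w _ refl

  original-has-three : ∀ u → ThreeNeighboursD (inj₁ u)
  original-has-three u with MinDeg.three-neighbours u
  ... | a , b , c , ha , hb , hc , ab , ac , bc =
    nbrD u a , nbrD u b , nbrD u c , nbrD-adj u a ha , nbrD-adj u b hb , nbrD-adj u c hc ,
    (λ q → ab (trans (sym (original-nbrD u a)) (trans (cong (original u) q) (original-nbrD u b)))) ,
    (λ q → ac (trans (sym (original-nbrD u a)) (trans (cong (original u) q) (original-nbrD u c)))) ,
    (λ q → bc (trans (sym (original-nbrD u b)) (trans (cong (original u) q) (original-nbrD u c))))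

  aut₁⁻¹ : Aut G1 → Aut G1
  aut₁⁻¹ (p , h) = Perm.flip p , λ u v → trans (sym (h (Perm.flip p ⟨$⟩ʳ u) (Perm.flip p ⟨$⟩ʳ v))) (cong₂ (adj G1) (inverseʳ p) (inverseʳ p))

  opposite-unique : ∀ (c j : J) → toℕ c ℕ.+ toℕ j ≡ L → c ≡ F.opposite j
  opposite-unique c j q = FP.toℕ-injective (NP.+-cancelʳ-≡ (toℕ j) (toℕ c) (toℕ (F.opposite j)) (trans q (trans (sym (opposite-sum j)) (NP.+-comm (toℕ j) _))))

  flipJ-next : ∀ bb {j0 j1 j c : J} → toℕ j1 ≡ suc (toℕ j0) → toℕ j ≡ suc (toℕ j1) →
               consecutiveᵇ (toℕ (flipJ bb j1)) (toℕ c) ≡ true → c ≢ flipJ bb j0 → c ≡ flipJ bb j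
  flipJ-next false {j0} {j1} {j} {c} t1 t cf avoid with ∨-true {suc (toℕ j1) ℕ.≡ᵇ toℕ c} cf
  ... | inj₁ w = FP.toℕ-injective (trans (sym (≡ᵇ-true w)) (sym t))
  ... | inj₂ w = ⊥-elim (avoid (FP.toℕ-injective (NP.suc-injective (trans (≡ᵇ-true w) t1))))
  flipJ-next true {j0} {j1} {j} {c} t1 t cf avoid with ∨-true {suc (toℕ (F.opposite j1)) ℕ.≡ᵇ toℕ c} cf
  ... | inj₁ w = ⊥-elim (avoid (opposite-unique c j0 (begin
         toℕ c ℕ.+ toℕ j0                       ≡⟨ cong (ℕ._+ toℕ j0) (sym (≡ᵇ-true w)) ⟩
         suc (toℕ (F.opposite j1)) ℕ.+ toℕ j0   ≡⟨ sym (NP.+-suc (toℕ (F.opposite j1)) (toℕ j0)) ⟩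
         toℕ (F.opposite j1) ℕ.+ suc (toℕ j0)   ≡⟨ cong (toℕ (F.opposite j1) ℕ.+_) (sym t1) ⟩
         toℕ (F.opposite j1) ℕ.+ toℕ j1         ≡⟨ NP.+-comm (toℕ (F.opposite j1)) (toℕ j1) ⟩
         toℕ j1 ℕ.+ toℕ (F.opposite j1)         ≡⟨ opposite-sum j1 ⟩
         L                                      ∎)))
    where open ≡-Reasoning
  ... | inj₂ w = opposite-unique c j (begin
         toℕ c ℕ.+ toℕ j                        ≡⟨ cong (toℕ c ℕ.+_) t ⟩
         toℕ c ℕ.+ suc (toℕ j1)                 ≡⟨ NP.+-suc (toℕ c) (toℕ j1) ⟩
         suc (toℕ c) ℕ.+ toℕ j1                 ≡⟨ cong (ℕ._+ toℕ j1) (≡ᵇ-true {suc (toℕ c)} {toℕ (F.opposite j1)} w) ⟩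
         toℕ (F.opposite j1) ℕ.+ toℕ j1         ≡⟨ NP.+-comm (toℕ (F.opposite j1)) (toℕ j1) ⟩
         toℕ j1 ℕ.+ toℕ (F.opposite j1)         ≡⟨ opposite-sum j1 ⟩
         L                                      ∎)
    where open ≡-Reasoning

  -- τ preserves degrees, and original vertices have at least three neighbours while
  -- internal ones have two; so τ maps original vertices to original vertices and each
  -- path onto a path, which defines the automorphism of G that τ lifts.
  module Transport (τ : Aut G1) where
    τD : D → D
    τD d = dec (ap τ (enc d))
    τ⁻¹D : D → D
    τ⁻¹D d = dec (ap (aut₁⁻¹ τ) (enc d))

    τ⁻¹τ : ∀ d → τ⁻¹D (τD d) ≡ d
    τ⁻¹τ d = trans (cong (λ z → dec (ap (aut₁⁻¹ τ) z)) (enc-dec _)) (trans (cong dec (inverseˡ (proj₁ τ))) (dec-enc d))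
    ττ⁻¹ : ∀ d → τD (τ⁻¹D d) ≡ d
    ττ⁻¹ d = trans (cong (λ z → dec (ap τ z)) (enc-dec _)) (trans (cong dec (inverseʳ (proj₁ τ))) (dec-enc d))

    τD-adj : ∀ d d' → AD (τD d) (τD d') ≡ AD d d'
    τD-adj d d' = trans (proj₂ τ (enc d) (enc d')) (cong₂ AD (dec-enc d) (dec-enc d'))
    τ⁻¹D-adj : ∀ d d' → AD (τ⁻¹D d) (τ⁻¹D d') ≡ AD d d'
    τ⁻¹D-adj d d' = trans (sym (τD-adj (τ⁻¹D d) (τ⁻¹D d'))) (cong₂ AD (ττ⁻¹ d) (ττ⁻¹ d'))
    τD-injective : ∀ d d' → τD d ≡ τD d' → d ≡ d'
    τD-injective d d' q = trans (sym (τ⁻¹τ d)) (trans (cong τ⁻¹D q) (τ⁻¹τ d'))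
    τ⁻¹D-injective : ∀ d d' → τ⁻¹D d ≡ τ⁻¹D d' → d ≡ d'
    τ⁻¹D-injective d d' q = trans (sym (ττ⁻¹ d)) (trans (cong τD q) (ττ⁻¹ d'))

    τ-original : ∀ u → Σ V (λ v → τD (inj₁ u) ≡ inj₁ v)
    τ-original u with τD (inj₁ u) in q
    ... | inj₁ v = v , refl
    ... | inj₂ (i , j) = ⊥-elim (internal-lacks-three i j (subst ThreeNeighboursD q (ThreeNeighboursD-map τD τD-adj τD-injective (inj₁ u) (original-has-three u))))

    τ-internal : ∀ i j → Σ (I × J) (λ z → τD (inj₂ (i , j)) ≡ inj₂ z)
    τ-internal i j with τD (inj₂ (i , j)) in q
    ... | inj₂ z = z , refl
    ... | inj₁ v = ⊥-elim (internal-lacks-three i j (subst ThreeNeighboursD (trans (cong τ⁻¹D (sym q)) (τ⁻¹τ (inj₂ (i , j)))) (ThreeNeighboursD-map τ⁻¹D τ⁻¹D-adj τ⁻¹D-injective (inj₁ v) (original-has-three v))))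

    στ : V → V
    στ u = proj₁ (τ-original u)
    τD-original : ∀ u → τD (inj₁ u) ≡ inj₁ (στ u)
    τD-original u = proj₂ (τ-original u)

    module OnPath (i : I) where
      z0 = proj₁ (τ-internal i F.zero)
      i' = proj₁ z0
      j0 = proj₂ z0
      τ-first : τD (inj₂ (i , F.zero)) ≡ inj₂ (i' , j0)
      τ-first = proj₂ (τ-internal i F.zero)

      τ-first-adj : endAdj G E s (στ (e1 i)) i' j0 ≡ true
      τ-first-adj = trans (sym (cong₂ AD (τD-original (e1 i)) τ-first)) (trans (τD-adj (inj₁ (e1 i)) (inj₂ (i , F.zero))) (trans (endAdj-0 (e1 i) i) (≟ᶠ-refl (e1 i))))

      τ-first-shape : Σ Bool (λ b → (j0 ≡ flipJ b F.zero) × (proj₁ (orient b (ep i')) ≡ στ (e1 i)))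
      τ-first-shape with ∨-true {(toℕ j0 ℕ.≡ᵇ 0) ∧ (e1 i' ≟ᶠ στ (e1 i))} τ-first-adj
      ... | inj₁ a = false , FP.toℕ-injective (≡ᵇ-true (proj₁ (∧-true {toℕ j0 ℕ.≡ᵇ 0} a))) , ≟ᶠ-true (proj₂ (∧-true {toℕ j0 ℕ.≡ᵇ 0} a))
      ... | inj₂ a = true , FP.toℕ-injective (trans (≡ᵇ-true (proj₁ (∧-true {toℕ j0 ℕ.≡ᵇ L} a))) (sym (FP.opposite-prop {s} F.zero))) , ≟ᶠ-true (proj₂ (∧-true {toℕ j0 ℕ.≡ᵇ L} a))

      b = proj₁ τ-first-shape

      Follows : ℕ → Set
      Follows a = ∀ j → toℕ j ≡ a → τD (inj₂ (i , j)) ≡ inj₂ (i' , flipJ b j)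

      follows-0 : Follows 0
      follows-0 j q rewrite FP.toℕ-injective {i = j} {j = F.zero} q = trans τ-first (cong (λ z → inj₂ (i' , z)) (proj₁ (proj₂ τ-first-shape)))

      τD-path-nbr : ∀ (jp j : J) → AD (inj₂ (i , jp)) (inj₂ (i , j)) ≡ true → τD (inj₂ (i , jp)) ≡ inj₂ (i' , flipJ b jp) →
               Σ J (λ c' → (τD (inj₂ (i , j)) ≡ inj₂ (i' , c')) × (consecutiveᵇ (toℕ (flipJ b jp)) (toℕ c') ≡ true))
      τD-path-nbr jp j a h with τ-internal i j
      ... | (i'' , c') , q with ∧-true {i' ≟ᶠ i''} (trans (sym (cong₂ AD h q)) (trans (τD-adj (inj₂ (i , jp)) (inj₂ (i , j))) a))
      ... | a1 , a2 with ≟ᶠ-true {a = i'} {b = i''} a1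
      ... | refl = c' , q , a2

      AD-consecutive : ∀ (jp j : J) → suc (toℕ jp) ≡ toℕ j → AD (inj₂ (i , jp)) (inj₂ (i , j)) ≡ true
      AD-consecutive jp j q rewrite ≟ᶠ-refl i | ≡ᵇ-≡ q = refl

      follows-1 : Follows 1
      follows-1 j q with τD-path-nbr F.zero j (AD-consecutive F.zero j (sym q)) (follows-0 F.zero refl)
      ... | c' , h , cf with b
      ...   | false with ∨-true {1 ℕ.≡ᵇ toℕ c'} cf
      ...     | inj₁ w = trans h (cong (λ z → inj₂ (i' , z)) (FP.toℕ-injective (trans (sym (≡ᵇ-true w)) (sym q))))
      ...     | inj₂ ()
      follows-1 j q | c' , h , cf | true with ∨-true {suc (toℕ (F.opposite {s} F.zero)) ℕ.≡ᵇ toℕ c'} cf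
      ...     | inj₁ w = ⊥-elim (NP.<-irrefl refl (NP.≤-trans (s≤s (NP.≤-reflexive (trans (cong suc (sym (FP.opposite-prop {s} F.zero))) (≡ᵇ-true w)))) (FP.toℕ<n c')))
      ...     | inj₂ w = trans h (cong (λ z → inj₂ (i' , z)) (opposite-unique c' j (trans (NP.+-comm (toℕ c') (toℕ j)) (trans (cong (ℕ._+ toℕ c') q) (trans (≡ᵇ-true w) (FP.opposite-prop {s} F.zero))))))

      follows-step : ∀ a → Follows a → Follows (suc a) → Follows (suc (suc a))
      follows-step a fa fa1 j q =
        let (c , h , cf) = τD-path-nbr j1 j (AD-consecutive j1 j (trans (cong suc tj1) (sym q))) (fa1 j1 tj1)
        in trans h (cong (λ z → inj₂ (i' , z)) (flipJ-next b (trans tj1 (cong suc (sym tj0))) (trans q (cong suc (sym tj1))) cf (avoid c h)))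
        where
        lt1 : suc a ℕ.< s
        lt1 = NP.≤-trans (NP.n≤1+n _) (subst (ℕ._< s) q (FP.toℕ<n j))
        lt0 : a ℕ.< s
        lt0 = NP.≤-trans (NP.n≤1+n _) lt1
        j1 = F.fromℕ< lt1
        j0' = F.fromℕ< lt0
        tj1 : toℕ j1 ≡ suc a
        tj1 = FP.toℕ-fromℕ< lt1
        tj0 : toℕ j0' ≡ a
        tj0 = FP.toℕ-fromℕ< lt0
        avoid : ∀ c → τD (inj₂ (i , j)) ≡ inj₂ (i' , c) → c ≢ flipJ b j0'
        avoid c h e' = NP.<-irrefl (sym jj) (subst (a ℕ.<_) (sym q) (NP.n≤1+n (suc a)))
          where
          jj : toℕ j ≡ a
          jj = trans (cong toℕ (cong proj₂ (inj₂-injective (τD-injective (inj₂ (i , j)) (inj₂ (i , j0')) (trans h (trans (cong (λ z → inj₂ (i' , z)) e') (sym (fa j0' tj0)))))))) tj0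

      follows-pair : ∀ a → Follows a × Follows (suc a)
      follows-pair = induction₂ Follows follows-0 follows-1 follows-step

      τD-path : ∀ j → τD (inj₂ (i , j)) ≡ inj₂ (i' , flipJ b j)
      τD-path j = proj₁ (follows-pair (toℕ j)) j refl

      τ-last-adj : endAdj G E s (στ (e2 i)) i' (flipJ b lastJ) ≡ true
      τ-last-adj = trans (sym (cong₂ AD (τD-path lastJ) (τD-original (e2 i)))) (trans (τD-adj (inj₂ (i , lastJ)) (inj₁ (e2 i))) (trans (endAdj-last (e2 i) i) (≟ᶠ-refl (e2 i))))

      opposite-last : F.opposite lastJ ≡ F.zero
      opposite-last = FP.toℕ-injective (trans (FP.opposite-prop lastJ) (trans (cong (s ℕ.∸_) (cong suc toℕ-lastJ)) (NP.n∸n≡0 L)))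

      τ-edge-shape : ∀ bb → proj₁ (orient bb (ep i')) ≡ στ (e1 i) → endAdj G E s (στ (e2 i)) i' (flipJ bb lastJ) ≡ true → e E i' ≡ orient bb (map-pair στ (ep i))
      τ-edge-shape false p1 ea = cong₂ _,_ p1 (≟ᶠ-true (trans (sym (endAdj-last (στ (e2 i)) i')) ea))
      τ-edge-shape true p1 ea = cong₂ _,_ (≟ᶠ-true (trans (sym (endAdj-0 (στ (e2 i)) i')) (trans (cong (endAdj G E s (στ (e2 i)) i') (sym opposite-last)) ea))) p1

      τ-edge : e E i' ≡ orient b (map-pair στ (ep i))
      τ-edge = τ-edge-shape b (proj₂ (proj₂ τ-first-shape)) τ-last-adj

    inE-τ : ∀ u v → inE G E s u v ≡ true → inE G E s (στ u) (στ v) ≡ true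
    inE-τ u v q with inE-true u v q
    ... | i , se = inE-intro _ _ (OnPath.i' i) (EdgeIs-map στ i (OnPath.i' i) (OnPath.b i) (OnPath.τ-edge i) se)

  A-dec : ∀ u v → A u v ≡ (A u v ∧ not (inE G E s u v)) ∨ inE G E s u v
  A-dec u v with inE G E s u v in q
  ... | true rewrite inE-adj u v q = refl
  ... | false rewrite BP.∧-identityʳ (A u v) | BP.∨-identityʳ (A u v) = refl

  restrict : (τ : Aut G1) → Σ (Aut G) (λ σ → ∀ d → Transport.τD τ d ≡ act σ d)
  restrict τ = σA , spec
    where
    module Tτ = Transport τ
    module Tτ⁻¹ = Transport (aut₁⁻¹ τ)
    σ'σ : ∀ u → Tτ⁻¹.στ (Tτ.στ u) ≡ u
    σ'σ u = inj₁-injective (trans (sym (Tτ⁻¹.τD-original (Tτ.στ u))) (trans (cong Tτ⁻¹.τD (sym (Tτ.τD-original u))) (Tτ.τ⁻¹τ (inj₁ u))))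
    σσ' : ∀ u → Tτ.στ (Tτ⁻¹.στ u) ≡ u
    σσ' u = inj₁-injective (trans (sym (Tτ.τD-original (Tτ⁻¹.στ u))) (trans (cong Tτ.τD (sym (Tτ⁻¹.τD-original u))) (Tτ.ττ⁻¹ (inj₁ u))))
    inE-eq' : ∀ u v → inE G E s (Tτ.στ u) (Tτ.στ v) ≡ inE G E s u v
    inE-eq' u v = bool-iff (λ q → subst₂ (λ a b → inE G E s a b ≡ true) (σ'σ u) (σ'σ v) (Tτ⁻¹.inE-τ _ _ q)) (Tτ.inE-τ u v)
    AD-original : ∀ u v → (A (Tτ.στ u) (Tτ.στ v) ∧ not (inE G E s (Tτ.στ u) (Tτ.στ v))) ≡ (A u v ∧ not (inE G E s u v))
    AD-original u v = trans (sym (cong₂ AD (Tτ.τD-original u) (Tτ.τD-original v))) (Tτ.τD-adj (inj₁ u) (inj₁ v))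
    isAut-σ : ∀ u v → A (Tτ.στ u) (Tτ.στ v) ≡ A u v
    isAut-σ u v = trans (A-dec _ _) (trans (cong₂ _∨_ (AD-original u v) (inE-eq' u v)) (sym (A-dec u v)))
    σA : Aut G
    σA = Perm.permutation Tτ.στ Tτ⁻¹.στ σσ' σ'σ , isAut-σ
    spec : ∀ d → Tτ.τD d ≡ act σA d
    spec (inj₁ u) = Tτ.τD-original u
    spec (inj₂ (i , j)) = trans (Tτ.OnPath.τD-path i j) (cong₂ (λ a b → inj₂ (a , flipJ b j)) (proj₁ u) (proj₂ u))
      where
      u = π-unique σA i (Tτ.OnPath.i' i) (Tτ.OnPath.b i) (Tτ.OnPath.τ-edge i)

module Orbits (G : Graph) (simp : IsSimple G) (nut : IsNut G) (vt : VertexTransitive G) (k' : ℕ) (oe : Oe G (suc k')) (oa : Oa G (suc k')) (E : EdgeOrbit G) (t' : ℕ) where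

  open Prelude
  open Subdivision G simp E t'
  open Lift G simp E t'
  open Restriction G simp nut vt E t'
  module Rev = ArcReversal G (suc k') oe oa

  VRel₁⇒act : ∀ w w' → VRel G1 w w' → Σ (Aut G) (λ σ → act σ (dec w) ≡ dec w')
  VRel₁⇒act w w' (τ , q) = σ , trans (sym (spec (dec w))) (trans (cong (λ z → dec (ap τ z)) (enc-dec w)) (cong dec q))
    where
    σ = proj₁ (restrict τ)
    spec = proj₂ (restrict τ)

  act⇒VRel₁ : ∀ w w' → Σ (Aut G) (λ σ → act σ (dec w) ≡ dec w') → VRel G1 w w'
  act⇒VRel₁ w w' (σ , q) = lift σ , trans (cong enc q) (enc-dec w')

  ARel₁⇒act : ∀ w1 w2 w3 w4 → ARelP G1 (w1 , w2) (w3 , w4) → Σ (Aut G) (λ σ → (act σ (dec w1) ≡ dec w3) × (act σ (dec w2) ≡ dec w4))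
  ARel₁⇒act w1 w2 w3 w4 (τ , q1 , q2) = σ , trans (sym (spec (dec w1))) (trans (cong (λ z → dec (ap τ z)) (enc-dec w1)) (cong dec q1))
                    , trans (sym (spec (dec w2))) (trans (cong (λ z → dec (ap τ z)) (enc-dec w2)) (cong dec q2))
    where
    σ = proj₁ (restrict τ)
    spec = proj₂ (restrict τ)

  act⇒ARel₁ : ∀ w1 w2 w3 w4 → Σ (Aut G) (λ σ → (act σ (dec w1) ≡ dec w3) × (act σ (dec w2) ≡ dec w4)) → ARelP G1 (w1 , w2) (w3 , w4)
  act⇒ARel₁ w1 w2 w3 w4 (σ , q1 , q2) = lift σ , trans (cong enc q1) (enc-dec w3) , trans (cong enc q2) (enc-dec w4)

  reverse-edge : ∀ i → Σ (Aut G) (λ ρ → (ap ρ (e1 i) ≡ e2 i) × (ap ρ (e2 i) ≡ e1 i))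
  reverse-edge i = Rev.reverse-arc (e1 i) (e2 i) (e-edge E i) (≡→T (trans (A-sym _ _) (e-adj i)))

  orient-inv : ∀ b p → orient b (orient b p) ≡ p
  orient-inv false p = refl
  orient-inv true p = refl

  not-xor : ∀ b → (b xor true) ≡ not b
  not-xor false = refl
  not-xor true = refl

  neq-not : ∀ {b0 b : Bool} → b0 ≢ b → not b0 ≡ b
  neq-not {false} {false} ne = ⊥-elim (ne refl)
  neq-not {false} {true} ne = refl
  neq-not {true} {false} ne = refl
  neq-not {true} {true} ne = ⊥-elim (ne refl)

  move-edge-from : ∀ i i' b σ0 b0 → e E i' ≡ orient b0 (map-pair (ap σ0) (ep i)) → Σ (Aut G) (λ σ → (π σ i ≡ i') × (reversed σ i ≡ b))
  move-edge-from i i' b σ0 b0 q with b0 BP.≟ b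
  ... | yes refl = σ0 , sym (proj₁ (π-unique σ0 i i' b0 q)) , sym (proj₂ (π-unique σ0 i i' b0 q))
  ... | no ne = σ , sym (proj₁ u) , trans (sym (proj₂ u)) (neq-not ne)
    where
    ρ = proj₁ (reverse-edge i')
    σ = aut-∘ σ0 ρ
    q2 : e E i' ≡ orient (not b0) (map-pair (ap σ) (ep i))
    q2 = begin
        e E i'  ≡⟨ sym (orient-inv true (ep i')) ⟩
        orient true (orient true (ep i'))  ≡⟨ cong (orient true) (sym (cong₂ _,_ (proj₁ (proj₂ (reverse-edge i'))) (proj₂ (proj₂ (reverse-edge i'))))) ⟩
        orient true (map-pair (ap ρ) (ep i'))  ≡⟨ cong (λ z → orient true (map-pair (ap ρ) z)) q ⟩
        orient true (map-pair (ap ρ) (orient b0 (map-pair (ap σ0) (ep i))))  ≡⟨ cong (orient true) (map-orient (ap ρ) b0 _) ⟩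
        orient true (orient b0 (map-pair (ap σ) (ep i)))  ≡⟨ orient-xor b0 true _ ⟩
        orient (b0 xor true) (map-pair (ap σ) (ep i))  ≡⟨ cong (λ z → orient z (map-pair (ap σ) (ep i))) (not-xor b0) ⟩
        orient (not b0) (map-pair (ap σ) (ep i)) ∎
      where open ≡-Reasoning
    u = π-unique σ i i' (not b0) q2

  move-edge : ∀ i i' b → Σ (Aut G) (λ σ → (π σ i ≡ i') × (reversed σ i ≡ b))
  move-edge i i' b with e-orbit E i i'
  ... | σ0 , inj₁ (p1 , p2) = move-edge-from i i' b σ0 false (cong₂ _,_ (sym p1) (sym p2))
  ... | σ0 , inj₂ (p1 , p2) = move-edge-from i i' b σ0 true (cong₂ _,_ (sym p2) (sym p1))

  import Data.Nat.Solver as NS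

  i0 : I
  i0 = nonempty E

  -- Reversing a path sends internal vertex j to its opposite s − 1 − j, so depth j takes
  -- 2t values; original vertices form a single orbit.
  depth : J → ℕ
  depth j = toℕ j ⊓ toℕ (F.opposite j)

  depth-flipJ : ∀ b j → depth (flipJ b j) ≡ depth j
  depth-flipJ false j = refl
  depth-flipJ true j = trans (cong (toℕ (F.opposite j) ⊓_) (cong toℕ (FP.opposite-involutive j))) (NP.⊓-comm _ _)

  opposite-injective : ∀ {j j' : J} → F.opposite j ≡ F.opposite j' → j ≡ j'
  opposite-injective {j} {j'} q = trans (sym (FP.opposite-involutive j)) (trans (cong F.opposite q) (FP.opposite-involutive j'))

  depth≡⇒ : ∀ j j' → depth j ≡ depth j' → j' ≡ j ⊎ j' ≡ F.opposite j
  depth≡⇒ j j' q with NP.⊓-sel (toℕ j) (toℕ (F.opposite j)) | NP.⊓-sel (toℕ j') (toℕ (F.opposite j'))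
  ... | inj₁ a | inj₁ b = inj₁ (FP.toℕ-injective (trans (sym b) (trans (sym q) a)))
  ... | inj₁ a | inj₂ b = inj₂ (trans (sym (FP.opposite-involutive j')) (cong F.opposite (sym (FP.toℕ-injective (trans (sym a) (trans q b))))))
  ... | inj₂ a | inj₁ b = inj₂ (FP.toℕ-injective (trans (sym b) (trans (sym q) a)))
  ... | inj₂ a | inj₂ b = inj₁ (opposite-injective (FP.toℕ-injective (trans (sym b) (trans (sym q) a))))

  L≡ : L ≡ suc (suc (suc (2 ℕ.* t' ℕ.+ 2 ℕ.* t')))
  L≡ = cong (λ z → suc (suc (suc z))) (NS.+-*-Solver.solve 1 (λ x → con 4 :* x := con 2 :* x :+ con 2 :* x) refl t')
    where open NS.+-*-Solver

  depth-bound : ∀ j → depth j ℕ.≤ suc (2 ℕ.* t')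
  depth-bound j with depth j ℕ.≤? suc (2 ℕ.* t')
  ... | yes p = p
  ... | no np = ⊥-elim (NP.<-irrefl refl (NP.≤-trans big (NP.≤-reflexive (trans (opposite-sum j) L≡))))
    where
    ge : suc (suc (2 ℕ.* t')) ℕ.≤ depth j
    ge = NP.≰⇒> np
    big : suc (suc (suc (suc (2 ℕ.* t' ℕ.+ 2 ℕ.* t')))) ℕ.≤ toℕ j ℕ.+ toℕ (F.opposite j)
    big = subst (ℕ._≤ toℕ j ℕ.+ toℕ (F.opposite j)) (cong suc (cong suc (trans (NP.+-suc (2 ℕ.* t') (suc (2 ℕ.* t'))) (cong suc (NP.+-suc (2 ℕ.* t') (2 ℕ.* t'))))))
           (NP.+-mono-≤ (NP.≤-trans ge (NP.m⊓n≤m _ _)) (NP.≤-trans ge (NP.m⊓n≤n _ _)))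

  depth-small : ∀ (j : J) → toℕ j ℕ.≤ suc (2 ℕ.* t') → depth j ≡ toℕ j
  depth-small j le = NP.m≤n⇒m⊓n≡m (NP.≤-trans le (NP.≤-trans (NP.n≤1+n _) (NP.≰⇒> λ o≤ → NP.<-irrefl (trans (opposite-sum j) L≡) (lemma o≤))))
    where
    lemma : toℕ (F.opposite j) ℕ.≤ suc (2 ℕ.* t') → suc (toℕ j ℕ.+ toℕ (F.opposite j)) ℕ.≤ suc (suc (suc (2 ℕ.* t' ℕ.+ 2 ℕ.* t')))
    lemma o≤ = s≤s (NP.≤-trans (NP.+-mono-≤ le o≤) (NP.≤-reflexive (cong suc (NP.+-suc (2 ℕ.* t') (2 ℕ.* t')))))

  vertexClass : D → ℕ
  vertexClass (inj₁ _) = 0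
  vertexClass (inj₂ (_ , j)) = suc (depth j)

  vertexClass-act : ∀ σ d → vertexClass (act σ d) ≡ vertexClass d
  vertexClass-act σ (inj₁ u) = refl
  vertexClass-act σ (inj₂ (i , j)) = cong suc (depth-flipJ (reversed σ i) j)

  Mv≡ : 2 ℕ.* suc t' ℕ.+ 1 ≡ suc (suc (suc (2 ℕ.* t')))
  Mv≡ = NS.+-*-Solver.solve 1 (λ x → con 2 :* (con 1 :+ x) :+ con 1 := con 3 :+ con 2 :* x) refl t'
    where open NS.+-*-Solver

  vertexClass≡⇒act : ∀ d d' → vertexClass d ≡ vertexClass d' → Σ (Aut G) (λ σ → act σ d ≡ d')
  vertexClass≡⇒act (inj₁ u) (inj₁ u') _ = proj₁ (vt u u') , cong inj₁ (proj₂ (vt u u'))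
  vertexClass≡⇒act (inj₁ u) (inj₂ _) ()
  vertexClass≡⇒act (inj₂ _) (inj₁ u') ()
  vertexClass≡⇒act (inj₂ (i , j)) (inj₂ (i' , j')) q with depth≡⇒ j j' (NP.suc-injective q)
  ... | inj₁ e' = let r = move-edge i i' false in proj₁ r , trans (cong₂ (λ a b → inj₂ (a , flipJ b j)) (proj₁ (proj₂ r)) (proj₂ (proj₂ r))) (cong (λ c → inj₂ (i' , c)) (sym e'))
  ... | inj₂ e' = let r = move-edge i i' true in proj₁ r , trans (cong₂ (λ a b → inj₂ (a , flipJ b j)) (proj₁ (proj₂ r)) (proj₂ (proj₂ r))) (cong (λ c → inj₂ (i' , c)) (sym e'))

  half<s : suc (suc (2 ℕ.* t')) ℕ.< s
  half<s = s≤s (s≤s (s≤s (NP.≤-trans (NP.*-monoˡ-≤ t' {2} {4} (s≤s (s≤s z≤n))) (NP.n≤1+n _))))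

  vertexClass< : ∀ d → vertexClass d ℕ.< suc (suc (suc (2 ℕ.* t')))
  vertexClass< (inj₁ _) = s≤s z≤n
  vertexClass< (inj₂ (_ , j)) = s≤s (s≤s (depth-bound j))

  vertexClass-surjective : ∀ c → c ℕ.< suc (suc (suc (2 ℕ.* t'))) → Σ (Fin N1) (λ w → vertexClass (dec w) ≡ c)
  vertexClass-surjective zero _ = enc (inj₁ (proj₁ MinDeg.two-vertices)) , cong vertexClass (dec-enc _)
  vertexClass-surjective (suc c) (s≤s (s≤s c≤)) =
    enc (inj₂ (i0 , j)) , trans (cong vertexClass (dec-enc _)) (cong suc (trans (depth-small j (subst (ℕ._≤ _) (sym toℕ-j) c≤)) toℕ-j))
    where
    c<s : c ℕ.< s
    c<s = NP.≤-<-trans c≤ (NP.<-trans (NP.n<1+n _) half<s)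
    j : J
    j = F.fromℕ< c<s
    toℕ-j : toℕ j ≡ c
    toℕ-j = FP.toℕ-fromℕ< c<s

  vertexClass≡⇒VRel₁ : ∀ w w' → vertexClass (dec w) ≡ vertexClass (dec w') → VRel G1 w w'
  vertexClass≡⇒VRel₁ w w' q = act⇒VRel₁ w w' (vertexClass≡⇒act (dec w) (dec w') q)

  VRel₁⇒vertexClass≡ : ∀ w w' → VRel G1 w w' → vertexClass (dec w) ≡ vertexClass (dec w')
  VRel₁⇒vertexClass≡ w w' r = let (σ , q) = VRel₁⇒act w w' r in trans (sym (vertexClass-act σ (dec w))) (cong vertexClass q)

  Ov₁ : Ov G1 (2 ℕ.* suc t' ℕ.+ 1)
  Ov₁ = subst (Ov G1) (sym Mv≡) (numClasses-from (Fin N1) (VRel G1) _ (λ w → vertexClass (dec w)) (λ w → vertexClass< (dec w))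
          vertexClass-surjective vertexClass≡⇒VRel₁ VRel₁⇒vertexClass≡)

  inE-sym : ∀ u v → inE G E s u v ≡ true → inE G E s v u ≡ true
  inE-sym u v q with inE-true u v q
  ... | i , inj₁ (a , b) = inE-intro v u i (inj₂ (a , b))
  ... | i , inj₂ (a , b) = inE-intro v u i (inj₁ (a , b))

  mkArc : ∀ u v → T (A u v) → Arc G
  mkArc u v p = (u , v) , p

  arc₀ : Arc G
  arc₀ = mkArc (e1 i0) (e2 i0) (e-edge E i0)

  arcClass₀ : Fin (suc k')
  arcClass₀ = Rev.fa arc₀

  edgeClass₀ : Fin (suc k')
  edgeClass₀ = Rev.fe arc₀

  original-arc-notE : ∀ u v → T (A u v ∧ not (inE G E s u v)) → inE G E s u v ≡ false
  original-arc-notE u v p = T-not (T∧₂ {A u v} p)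

  arcClass₀≢ : ∀ u v (p : T (A u v ∧ not (inE G E s u v))) → arcClass₀ ≢ Rev.fa (mkArc u v (T∧₁ p))
  arcClass₀≢ u v p q with Rev.fa-to arc₀ (mkArc u v (T∧₁ p)) q
  ... | σ , a , b = true≢false (trans (sym (subst₂ (λ x y → inE G E s x y ≡ true) a b (inE-act-true σ _ _ (inE-intro _ _ i0 (inj₁ (refl , refl)))))) (original-arc-notE u v p))

  edgeClass₀≢ : ∀ u v (p : T (A u v ∧ not (inE G E s u v))) → edgeClass₀ ≢ Rev.fe (mkArc u v (T∧₁ p))
  edgeClass₀≢ u v p q with Rev.fe-to arc₀ (mkArc u v (T∧₁ p)) q
  ... | σ , inj₁ (a , b) = true≢false (trans (sym (subst₂ (λ x y → inE G E s x y ≡ true) a b (inE-act-true σ _ _ (inE-intro _ _ i0 (inj₁ (refl , refl)))))) (original-arc-notE u v p))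
  ... | σ , inj₂ (a , b) = true≢false (trans (sym (inE-sym _ _ (subst₂ (λ x y → inE G E s x y ≡ true) a b (inE-act-true σ _ _ (inE-intro _ _ i0 (inj₁ (refl , refl))))))) (original-arc-notE u v p))

  originalArcIndex : ∀ u v → T (A u v ∧ not (inE G E s u v)) → Fin k'
  originalArcIndex u v p = F.punchOut (arcClass₀≢ u v p)

  originalEdgeIndex : ∀ u v → T (A u v ∧ not (inE G E s u v)) → Fin k'
  originalEdgeIndex u v p = F.punchOut (edgeClass₀≢ u v p)

  -- The arc p_r → p_{r+1} of a path gets r ∈ [0, s], and p_{r+1} → p_r gets s − r (its
  -- image under reversal of the path); the remaining arcs of G come after these.
  arcClass : (d d' : D) → T (AD d d') → ℕ
  arcClass (inj₁ u) (inj₁ v) p = suc s ℕ.+ toℕ (originalArcIndex u v p)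
  arcClass (inj₁ u) (inj₂ _) _ = 0
  arcClass (inj₂ _) (inj₁ u) _ = s
  arcClass (inj₂ (i , j)) (inj₂ (i' , j')) _ = if suc (toℕ j) ℕ.≡ᵇ toℕ j' then suc (toℕ j) else s ℕ.∸ toℕ j

  pos : I → ℕ → D
  pos i zero = inj₁ (e1 i)
  pos i (suc r) with r ℕ.<? s
  ... | yes p = inj₂ (i , F.fromℕ< p)
  ... | no _ = inj₁ (e2 i)

  pos-internal : ∀ i r (p : r ℕ.< s) → pos i (suc r) ≡ inj₂ (i , F.fromℕ< p)
  pos-internal i r p with r ℕ.<? s
  ... | yes p' = cong (λ z → inj₂ (i , z)) (FP.toℕ-injective (trans (FP.toℕ-fromℕ< p') (sym (FP.toℕ-fromℕ< p))))
  ... | no np = ⊥-elim (np p)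

  pos-toℕ : ∀ i (j : J) → pos i (suc (toℕ j)) ≡ inj₂ (i , j)
  pos-toℕ i j = trans (pos-internal i (toℕ j) (FP.toℕ<n j)) (cong (λ z → inj₂ (i , z)) (FP.fromℕ<-toℕ j (FP.toℕ<n j)))

  pos-end : ∀ i → pos i (suc s) ≡ inj₁ (e2 i)
  pos-end i with s ℕ.<? s
  ... | yes p = ⊥-elim (NP.<-irrefl refl p)
  ... | no _ = refl

  PathArcAt : D → D → ℕ → Set
  PathArcAt d d' c = Σ I λ i → Σ ℕ λ r → (r ℕ.≤ s) × (((d ≡ pos i r) × (d' ≡ pos i (suc r)) × (c ≡ r)) ⊎ ((d ≡ pos i (suc r)) × (d' ≡ pos i r) × (c ≡ s ℕ.∸ r)))

  IsPathArc : D → D → Set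
  IsPathArc (inj₁ _) (inj₁ _) = ⊥
  IsPathArc _ _ = Data.Unit.⊤

  pos-last : ∀ i (j : J) → toℕ j ≡ L → pos i s ≡ inj₂ (i , j)
  pos-last i j q = trans (cong (λ z → pos i (suc z)) (sym q)) (pos-toℕ i j)

  pos-1 : ∀ i (j : J) → toℕ j ≡ 0 → pos i 1 ≡ inj₂ (i , j)
  pos-1 i j q = trans (cong (λ z → pos i (suc z)) (sym q)) (pos-toℕ i j)

  internal-arc-at : ∀ i j j' (bb : Bool) → (suc (toℕ j) ℕ.≡ᵇ toℕ j') ≡ bb → ((suc (toℕ j) ℕ.≡ᵇ toℕ j') ≡ true ⊎ (suc (toℕ j') ℕ.≡ᵇ toℕ j) ≡ true) →
         PathArcAt (inj₂ (i , j)) (inj₂ (i , j')) (if bb then suc (toℕ j) else s ℕ.∸ toℕ j)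
  internal-arc-at i j j' true q _ = i , suc (toℕ j) , FP.toℕ<n j , inj₁ (sym (pos-toℕ i j) , trans (sym (pos-toℕ i j')) (cong (λ z → pos i (suc z)) (sym (≡ᵇ-true q))) , refl)
  internal-arc-at i j j' false q (inj₁ c) = ⊥-elim (true≢false (trans (sym c) q))
  internal-arc-at i j j' false q (inj₂ c) = i , suc (toℕ j') , FP.toℕ<n j' , inj₂ (trans (sym (pos-toℕ i j)) (cong (λ z → pos i (suc z)) (sym (≡ᵇ-true c))) , sym (pos-toℕ i j') , cong (s ℕ.∸_) (sym (≡ᵇ-true {suc (toℕ j')} {toℕ j} c)))

  path-arc-at : ∀ d d' (pf : T (AD d d')) → IsPathArc d d' → PathArcAt d d' (arcClass d d' pf)
  path-arc-at (inj₁ u) (inj₁ v) pf ()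
  path-arc-at (inj₁ u) (inj₂ (i , j)) pf _ with ∨-true {(toℕ j ℕ.≡ᵇ 0) ∧ (e1 i ≟ᶠ u)} (T→≡ pf)
  ... | inj₁ a = i , 0 , z≤n , inj₁ (cong inj₁ (sym (≟ᶠ-true (proj₂ (∧-true {toℕ j ℕ.≡ᵇ 0} a)))) , sym (pos-1 i j (≡ᵇ-true (proj₁ (∧-true {toℕ j ℕ.≡ᵇ 0} a)))) , refl)
  ... | inj₂ b = i , s , NP.≤-refl , inj₂ (trans (cong inj₁ (sym (≟ᶠ-true (proj₂ (∧-true {toℕ j ℕ.≡ᵇ L} b))))) (sym (pos-end i)) , sym (pos-last i j (≡ᵇ-true (proj₁ (∧-true {toℕ j ℕ.≡ᵇ L} b)))) , sym (NP.n∸n≡0 s))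
  path-arc-at (inj₂ (i , j)) (inj₁ u) pf _ with ∨-true {(toℕ j ℕ.≡ᵇ 0) ∧ (e1 i ≟ᶠ u)} (T→≡ pf)
  ... | inj₁ a = i , 0 , z≤n , inj₂ (sym (pos-1 i j (≡ᵇ-true (proj₁ (∧-true {toℕ j ℕ.≡ᵇ 0} a)))) , cong inj₁ (sym (≟ᶠ-true (proj₂ (∧-true {toℕ j ℕ.≡ᵇ 0} a)))) , refl)
  ... | inj₂ b = i , s , NP.≤-refl , inj₁ (sym (pos-last i j (≡ᵇ-true (proj₁ (∧-true {toℕ j ℕ.≡ᵇ L} b)))) , trans (cong inj₁ (sym (≟ᶠ-true (proj₂ (∧-true {toℕ j ℕ.≡ᵇ L} b))))) (sym (pos-end i)) , refl)
  path-arc-at (inj₂ (i , j)) (inj₂ (i' , j')) pf _ with ∧-true {i ≟ᶠ i'} (T→≡ pf)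
  ... | q1 , q2 with ≟ᶠ-true {a = i} {b = i'} q1
  ... | refl = internal-arc-at i j j' _ refl (∨-true {suc (toℕ j) ℕ.≡ᵇ toℕ j'} q2)

  acls-01 : ∀ d d' pf u z → d ≡ inj₁ u → d' ≡ inj₂ z → arcClass d d' pf ≡ 0
  acls-01 .(inj₁ u) .(inj₂ z) pf u z refl refl = refl
  acls-10 : ∀ d d' pf u z → d ≡ inj₂ z → d' ≡ inj₁ u → arcClass d d' pf ≡ s
  acls-10 .(inj₂ z) .(inj₁ u) pf u z refl refl = refl
  acls-22 : ∀ d d' pf i j j' → d ≡ inj₂ (i , j) → d' ≡ inj₂ (i , j') → arcClass d d' pf ≡ (if suc (toℕ j) ℕ.≡ᵇ toℕ j' then suc (toℕ j) else s ℕ.∸ toℕ j)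
  acls-22 .(inj₂ (i , j)) .(inj₂ (i , j')) pf i j j' refl refl = refl

  if-true : ∀ {b : Bool} {x y : ℕ} → b ≡ true → (if b then x else y) ≡ x
  if-true refl = refl
  if-false : ∀ {b : Bool} {x y : ℕ} → b ≡ false → (if b then x else y) ≡ y
  if-false refl = refl

  arcClass-forward : ∀ i r → r ℕ.≤ s → ∀ d d' pf → d ≡ pos i r → d' ≡ pos i (suc r) → arcClass d d' pf ≡ r
  arcClass-forward i zero _ d d' pf q q' = acls-01 d d' pf _ _ q (trans q' (pos-internal i 0 (s≤s z≤n)))
  arcClass-forward i (suc r) le d d' pf q q' = go (suc r ℕ.<? s)
    where
    e'' : ¬ (suc r ℕ.< s) → suc r ≡ s
    e'' np = NP.≤-antisym le (NP.≮⇒≥ np)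
    go : Dec (suc r ℕ.< s) → arcClass d d' pf ≡ suc r
    go (yes p) = trans (acls-22 d d' pf i _ _ (trans q (pos-internal i r le)) (trans q' (pos-internal i (suc r) p)))
                  (trans (if-true (≡ᵇ-≡ (trans (cong suc (FP.toℕ-fromℕ< le)) (sym (FP.toℕ-fromℕ< p))))) (cong suc (FP.toℕ-fromℕ< le)))
    go (no np) = trans (acls-10 d d' pf _ _ (trans q (pos-internal i r le)) (trans q' (trans (cong (λ z → pos i (suc z)) (e'' np)) (pos-end i)))) (sym (e'' np))

  ss≢ : ∀ r → suc (suc r) ≢ r
  ss≢ zero ()
  ss≢ (suc r) e = ss≢ r (NP.suc-injective e)

  arcClass-backward : ∀ i r → r ℕ.≤ s → ∀ d d' pf → d ≡ pos i (suc r) → d' ≡ pos i r → arcClass d d' pf ≡ s ℕ.∸ r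
  arcClass-backward i zero _ d d' pf q q' = acls-10 d d' pf _ _ (trans q (pos-internal i 0 (s≤s z≤n))) q'
  arcClass-backward i (suc r) le d d' pf q q' = go (suc r ℕ.<? s)
    where
    e'' : ¬ (suc r ℕ.< s) → suc r ≡ s
    e'' np = NP.≤-antisym le (NP.≮⇒≥ np)
    go : Dec (suc r ℕ.< s) → arcClass d d' pf ≡ s ℕ.∸ suc r
    go (yes p) = trans (acls-22 d d' pf i _ _ (trans q (pos-internal i (suc r) p)) (trans q' (pos-internal i r le)))
                  (trans (if-false (≡ᵇ-false (λ w → ss≢ r (trans (sym (cong suc (FP.toℕ-fromℕ< p))) (trans w (FP.toℕ-fromℕ< le))))))
                    (cong (s ℕ.∸_) (FP.toℕ-fromℕ< p)))
    go (no np) = trans (acls-01 d d' pf _ _ (trans q (trans (cong (λ z → pos i (suc z)) (e'' np)) (pos-end i))) (trans q' (pos-internal i r le))) (trans (sym (NP.n∸n≡0 s)) (cong (s ℕ.∸_) (sym (e'' np))))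

  pos-act′ : ∀ σ i r → r ℕ.≤ suc s → (b : Bool) → reversed σ i ≡ b → e E (π σ i) ≡ orient b (map-pair (ap σ) (ep i)) →
           act σ (pos i r) ≡ pos (π σ i) (if b then suc s ℕ.∸ r else r)
  pos-act′ σ i zero _ false hb q = cong inj₁ (sym (cong proj₁ q))
  pos-act′ σ i zero _ true hb q = trans (cong inj₁ (sym (cong proj₂ q))) (sym (pos-end (π σ i)))
  pos-act′ σ i (suc r) le b hb q = go (r ℕ.<? s) b hb q
    where
    go : Dec (r ℕ.< s) → (b : Bool) → reversed σ i ≡ b → e E (π σ i) ≡ orient b (map-pair (ap σ) (ep i)) → act σ (pos i (suc r)) ≡ pos (π σ i) (if b then suc s ℕ.∸ suc r else suc r)
    go (yes p) false hb q = trans (cong (act σ) (pos-internal i r p)) (trans (cong (λ z → inj₂ (π σ i , flipJ z (F.fromℕ< p))) hb) (sym (pos-internal (π σ i) r p)))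
    go (yes p) true hb q = trans (cong (act σ) (pos-internal i r p)) (trans (cong (λ z → inj₂ (π σ i , flipJ z (F.fromℕ< p))) hb)
                            (trans (sym (pos-toℕ (π σ i) (F.opposite (F.fromℕ< p)))) (cong (pos (π σ i)) (trans (cong suc tq) (sym (NP.+-∸-assoc 1 (NP.≤-pred p)))))))
      where
      tq : toℕ (F.opposite (F.fromℕ< p)) ≡ L ℕ.∸ r
      tq = trans (FP.opposite-prop (F.fromℕ< p)) (cong (L ℕ.∸_) (FP.toℕ-fromℕ< p))
    go (no np) false hb q = trans (cong (act σ) (trans (cong (λ z → pos i (suc z)) e') (pos-end i))) (trans (cong inj₁ (sym (cong proj₂ q))) (trans (sym (pos-end (π σ i))) (cong (λ z → pos (π σ i) (suc z)) (sym e'))))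
      where
      e' : r ≡ s
      e' = NP.≤-antisym (NP.≤-pred le) (NP.≮⇒≥ np)
    go (no np) true hb q = trans (cong (act σ) (trans (cong (λ z → pos i (suc z)) e') (pos-end i))) (trans (cong inj₁ (sym (cong proj₁ q))) (cong (pos (π σ i)) (sym (trans (cong (s ℕ.∸_) e') (NP.n∸n≡0 s)))))
      where
      e' : r ≡ s
      e' = NP.≤-antisym (NP.≤-pred le) (NP.≮⇒≥ np)

  pos-act : ∀ σ i r → r ℕ.≤ suc s → ∀ i' b → π σ i ≡ i' → reversed σ i ≡ b → act σ (pos i r) ≡ pos i' (if b then suc s ℕ.∸ r else r)
  pos-act σ i r le i' b pq hb = trans (pos-act′ σ i r le b hb (subst (λ z → e E (π σ i) ≡ orient z (map-pair (ap σ) (ep i))) hb (π-spec σ i))) (cong (λ z → pos z (if b then suc s ℕ.∸ r else r)) pq)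

  suc-∸ : ∀ r → r ℕ.≤ s → suc s ℕ.∸ r ≡ suc (s ℕ.∸ r)
  suc-∸ r le = NP.+-∸-assoc 1 le

  arcClass-act-path : ∀ σ d d' pf e' e'' pf' → IsPathArc d d' → act σ d ≡ e' → act σ d' ≡ e'' → arcClass e' e'' pf' ≡ arcClass d d' pf
  arcClass-act-path σ d d' pf e' e'' pf' ip q q' with path-arc-at d d' pf ip
  ... | i , r , le , inj₁ (dq , dq' , c) = trans (go (reversed σ i) refl) (sym c)
    where
    le1 : r ℕ.≤ suc s
    le1 = NP.≤-trans le (NP.n≤1+n s)
    go : ∀ b → reversed σ i ≡ b → arcClass e' e'' pf' ≡ r
    go false hb = arcClass-forward (π σ i) r le e' e'' pf' (trans (sym q) (trans (cong (act σ) dq) (pos-act σ i r le1 _ false refl hb)))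
                    (trans (sym q') (trans (cong (act σ) dq') (pos-act σ i (suc r) (s≤s le) _ false refl hb)))
    go true hb = trans (arcClass-backward (π σ i) (s ℕ.∸ r) (NP.m∸n≤m s r) e' e'' pf'
                    (trans (sym q) (trans (cong (act σ) dq) (trans (pos-act σ i r le1 _ true refl hb) (cong (pos (π σ i)) (suc-∸ r le)))))
                    (trans (sym q') (trans (cong (act σ) dq') (pos-act σ i (suc r) (s≤s le) _ true refl hb))))
                   (NP.m∸[m∸n]≡n le)
  ... | i , r , le , inj₂ (dq , dq' , c) = trans (go (reversed σ i) refl) (sym c)
    where
    le1 : r ℕ.≤ suc s
    le1 = NP.≤-trans le (NP.n≤1+n s)
    go : ∀ b → reversed σ i ≡ b → arcClass e' e'' pf' ≡ s ℕ.∸ r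
    go false hb = arcClass-backward (π σ i) r le e' e'' pf' (trans (sym q) (trans (cong (act σ) dq) (pos-act σ i (suc r) (s≤s le) _ false refl hb)))
                    (trans (sym q') (trans (cong (act σ) dq') (pos-act σ i r le1 _ false refl hb)))
    go true hb = arcClass-forward (π σ i) (s ℕ.∸ r) (NP.m∸n≤m s r) e' e'' pf'
                    (trans (sym q) (trans (cong (act σ) dq) (pos-act σ i (suc r) (s≤s le) _ true refl hb)))
                    (trans (sym q') (trans (cong (act σ) dq') (trans (pos-act σ i r le1 _ true refl hb) (cong (pos (π σ i)) (suc-∸ r le)))))

  arcClass≡⇒act-path : ∀ d d' pf e' e'' pf' → IsPathArc d d' → IsPathArc e' e'' → arcClass d d' pf ≡ arcClass e' e'' pf' → Σ (Aut G) (λ σ → (act σ d ≡ e') × (act σ d' ≡ e''))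
  arcClass≡⇒act-path d d' pf e' e'' pf' ip ip' cq with path-arc-at d d' pf ip | path-arc-at e' e'' pf' ip'
  ... | i , r , le , inj₁ (dq , dq' , c) | i' , r' , le' , inj₁ (eq , eq' , c') = σ ,
         trans (cong (act σ) dq) (trans (pos-act σ i r le1 i' false (proj₁ (proj₂ mv)) (proj₂ (proj₂ mv))) (trans (cong (pos i') rr) (sym eq))) ,
         trans (cong (act σ) dq') (trans (pos-act σ i (suc r) (s≤s le) i' false (proj₁ (proj₂ mv)) (proj₂ (proj₂ mv))) (trans (cong (λ z → pos i' (suc z)) rr) (sym eq')))
    where
    mv = move-edge i i' false
    σ = proj₁ mv
    le1 = NP.≤-trans le (NP.n≤1+n s)
    rr : r ≡ r'
    rr = trans (sym c) (trans cq c')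
  ... | i , r , le , inj₁ (dq , dq' , c) | i' , r' , le' , inj₂ (eq , eq' , c') = σ ,
         trans (cong (act σ) dq) (trans (pos-act σ i r le1 i' true (proj₁ (proj₂ mv)) (proj₂ (proj₂ mv))) (trans (cong (pos i') (trans (suc-∸ r le) (cong suc rr))) (sym eq))) ,
         trans (cong (act σ) dq') (trans (pos-act σ i (suc r) (s≤s le) i' true (proj₁ (proj₂ mv)) (proj₂ (proj₂ mv))) (trans (cong (pos i') rr) (sym eq')))
    where
    mv = move-edge i i' true
    σ = proj₁ mv
    le1 = NP.≤-trans le (NP.n≤1+n s)
    rr : s ℕ.∸ r ≡ r'
    rr = trans (cong (s ℕ.∸_) (trans (sym c) (trans cq c'))) (NP.m∸[m∸n]≡n le')
  ... | i , r , le , inj₂ (dq , dq' , c) | i' , r' , le' , inj₁ (eq , eq' , c') = σ ,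
         trans (cong (act σ) dq) (trans (pos-act σ i (suc r) (s≤s le) i' true (proj₁ (proj₂ mv)) (proj₂ (proj₂ mv))) (trans (cong (pos i') rr) (sym eq))) ,
         trans (cong (act σ) dq') (trans (pos-act σ i r le1 i' true (proj₁ (proj₂ mv)) (proj₂ (proj₂ mv))) (trans (cong (pos i') (trans (suc-∸ r le) (cong suc rr))) (sym eq')))
    where
    mv = move-edge i i' true
    σ = proj₁ mv
    le1 = NP.≤-trans le (NP.n≤1+n s)
    rr : s ℕ.∸ r ≡ r'
    rr = trans (sym c) (trans cq c')
  ... | i , r , le , inj₂ (dq , dq' , c) | i' , r' , le' , inj₂ (eq , eq' , c') = σ ,
         trans (cong (act σ) dq) (trans (pos-act σ i (suc r) (s≤s le) i' false (proj₁ (proj₂ mv)) (proj₂ (proj₂ mv))) (trans (cong (λ z → pos i' (suc z)) rr) (sym eq))) ,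
         trans (cong (act σ) dq') (trans (pos-act σ i r le1 i' false (proj₁ (proj₂ mv)) (proj₂ (proj₂ mv))) (trans (cong (pos i') rr) (sym eq')))
    where
    mv = move-edge i i' false
    σ = proj₁ mv
    le1 = NP.≤-trans le (NP.n≤1+n s)
    rr : r ≡ r'
    rr = trans (sym (NP.m∸[m∸n]≡n le)) (trans (cong (s ℕ.∸_) (trans (sym c) (trans cq c'))) (NP.m∸[m∸n]≡n le'))

  arcClass-act-original : ∀ σ u v pf u' v' pf' → ap σ u ≡ u' → ap σ v ≡ v' → arcClass (inj₁ u') (inj₁ v') pf' ≡ arcClass (inj₁ u) (inj₁ v) pf
  arcClass-act-original σ u v pf u' v' pf' q1 q2 = cong (λ z → suc s ℕ.+ toℕ z) (FP.punchOut-cong arcClass₀ (sym (Rev.fa-from (mkArc u v (T∧₁ pf)) (mkArc u' v' (T∧₁ pf')) (σ , q1 , q2))))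

  arcClass≡⇒act-original : ∀ u v pf u' v' pf' → arcClass (inj₁ u) (inj₁ v) pf ≡ arcClass (inj₁ u') (inj₁ v') pf' → Σ (Aut G) (λ σ → (ap σ u ≡ u') × (ap σ v ≡ v'))
  arcClass≡⇒act-original u v pf u' v' pf' q = Rev.fa-to (mkArc u v (T∧₁ pf)) (mkArc u' v' (T∧₁ pf')) (FP.punchOut-injective (arcClass₀≢ u v pf) (arcClass₀≢ u' v' pf') (FP.toℕ-injective (NP.+-cancelˡ-≡ (suc s) _ _ q)))

  arcClass-path-≤ : ∀ d d' pf → IsPathArc d d' → arcClass d d' pf ℕ.≤ s
  arcClass-path-≤ d d' pf ip with path-arc-at d d' pf ip
  ... | i , r , le , inj₁ (_ , _ , c) = subst (ℕ._≤ s) (sym c) le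
  ... | i , r , le , inj₂ (_ , _ , c) = subst (ℕ._≤ s) (sym c) (NP.m∸n≤m s r)

  arcClass-original-big : ∀ u v pf → suc s ℕ.≤ arcClass (inj₁ u) (inj₁ v) pf
  arcClass-original-big u v pf = NP.m≤m+n (suc s) _

  arcClass-act : ∀ σ d d' pf e' e'' pf' → act σ d ≡ e' → act σ d' ≡ e'' → arcClass e' e'' pf' ≡ arcClass d d' pf
  arcClass-act σ (inj₁ u) (inj₁ v) pf (inj₁ u') (inj₁ v') pf' q q' = arcClass-act-original σ u v pf u' v' pf' (inj₁-injective q) (inj₁-injective q')
  arcClass-act σ (inj₁ u) (inj₁ v) pf (inj₁ u') (inj₂ _) pf' q ()
  arcClass-act σ (inj₁ u) (inj₁ v) pf (inj₂ _) _ pf' () q'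
  arcClass-act σ (inj₁ u) (inj₂ z) pf e' e'' pf' q q' = arcClass-act-path σ _ _ pf e' e'' pf' _ q q'
  arcClass-act σ (inj₂ z) d' pf e' e'' pf' q q' = arcClass-act-path σ (inj₂ z) d' pf e' e'' pf' (ip d') q q'
    where
    ip : ∀ d' → IsPathArc (inj₂ z) d'
    ip (inj₁ _) = _
    ip (inj₂ _) = _

  IsPathArc-internalʳ : ∀ d z → IsPathArc d (inj₂ z)
  IsPathArc-internalʳ (inj₁ _) _ = _
  IsPathArc-internalʳ (inj₂ _) _ = _

  IsPathArc? : ∀ d d' → IsPathArc d d' ⊎ (Σ V λ u → Σ V λ v → (d ≡ inj₁ u) × (d' ≡ inj₁ v))
  IsPathArc? (inj₁ u) (inj₁ v) = inj₂ (u , v , refl , refl)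
  IsPathArc? (inj₁ u) (inj₂ _) = inj₁ _
  IsPathArc? (inj₂ _) (inj₁ _) = inj₁ _
  IsPathArc? (inj₂ _) (inj₂ _) = inj₁ _

  arcClass≡⇒act : ∀ d d' pf e' e'' pf' → arcClass d d' pf ≡ arcClass e' e'' pf' → Σ (Aut G) (λ σ → (act σ d ≡ e') × (act σ d' ≡ e''))
  arcClass≡⇒act d d' pf e' e'' pf' cq with IsPathArc? d d' | IsPathArc? e' e''
  ... | inj₁ ip | inj₁ ip' = arcClass≡⇒act-path d d' pf e' e'' pf' ip ip' cq
  arcClass≡⇒act .(inj₁ u) .(inj₁ v) pf .(inj₁ u') .(inj₁ v') pf' cq | inj₂ (u , v , refl , refl) | inj₂ (u' , v' , refl , refl)
    with arcClass≡⇒act-original u v pf u' v' pf' cq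
  ... | σ , q1 , q2 = σ , cong inj₁ q1 , cong inj₁ q2
  arcClass≡⇒act d d' pf .(inj₁ u') .(inj₁ v') pf' cq | inj₁ ip | inj₂ (u' , v' , refl , refl) =
    ⊥-elim (NP.<-irrefl refl (NP.≤-trans (arcClass-original-big u' v' pf') (NP.≤-trans (NP.≤-reflexive (sym cq)) (NP.≤-trans (arcClass-path-≤ d d' pf ip) NP.≤-refl))))
  arcClass≡⇒act .(inj₁ u) .(inj₁ v) pf e' e'' pf' cq | inj₂ (u , v , refl , refl) | inj₁ ip' =
    ⊥-elim (NP.<-irrefl refl (NP.≤-trans (arcClass-original-big u v pf) (NP.≤-trans (NP.≤-reflexive cq) (arcClass-path-≤ e' e'' pf' ip'))))

  pos-adj : ∀ i r → r ℕ.≤ s → T (AD (pos i r) (pos i (suc r)))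
  pos-adj i zero _ = subst (λ z → T (AD (inj₁ (e1 i)) z)) (sym (pos-internal i 0 (s≤s z≤n))) (≡→T (trans (endAdj-0 (e1 i) i) (≟ᶠ-refl (e1 i))))
  pos-adj i (suc r) le = go (suc r ℕ.<? s)
    where
    go : Dec (suc r ℕ.< s) → T (AD (pos i (suc r)) (pos i (suc (suc r))))
    go (yes p) = subst₂ (λ a b → T (AD a b)) (sym (pos-internal i r le)) (sym (pos-internal i (suc r) p))
                   (≡→T (cong₂ _∧_ (≟ᶠ-refl i) (cong (_∨ (suc (toℕ (F.fromℕ< p)) ℕ.≡ᵇ toℕ (F.fromℕ< le))) (≡ᵇ-≡ (trans (cong suc (FP.toℕ-fromℕ< le)) (sym (FP.toℕ-fromℕ< p)))))))
    go (no np) = subst₂ (λ a b → T (AD a b)) (trans (cong (λ z → inj₂ (i , z)) jl) (sym (pos-internal i r le))) (trans (sym (pos-end i)) (cong (λ z → pos i (suc z)) (sym e')))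
                   (≡→T (trans (endAdj-last (e2 i) i) (≟ᶠ-refl (e2 i))))
      where
      e' : suc r ≡ s
      e' = NP.≤-antisym le (NP.≮⇒≥ np)
      jl : lastJ ≡ F.fromℕ< le
      jl = FP.toℕ-injective (trans toℕ-lastJ (trans (NP.suc-injective (sym e')) (sym (FP.toℕ-fromℕ< le))))

  arcClass-cong : ∀ d1 d2 d1' d2' p p' → d1 ≡ d2 → d1' ≡ d2' → arcClass d1 d1' p ≡ arcClass d2 d2' p'
  arcClass-cong d1 .d1 d1' .d1' p p' refl refl = cong (arcClass d1 d1') (BP.T-irrelevant p p')

  original-arc : ∀ u v → T (A u v) → inE G E s u v ≡ false → T (A u v ∧ not (inE G E s u v))
  original-arc u v p q rewrite q | T→≡ p = tt

  inE⇒arcClass₀ : ∀ u v pu → inE G E s u v ≡ true → Rev.fa (mkArc u v pu) ≡ arcClass₀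
  inE⇒arcClass₀ u v pu q with inE-true u v q
  ... | i , inj₁ (a , b) = Rev.fa-from (mkArc u v pu) arc₀ (proj₁ mv , trans (cong (ap (proj₁ mv)) (sym a)) (sym (cong proj₁ c)) , trans (cong (ap (proj₁ mv)) (sym b)) (sym (cong proj₂ c)))
    where
    mv = move-edge i i0 false
    c : e E i0 ≡ orient false (map-pair (ap (proj₁ mv)) (ep i))
    c = subst₂ (λ z w → e E z ≡ orient w (map-pair (ap (proj₁ mv)) (ep i))) (proj₁ (proj₂ mv)) (proj₂ (proj₂ mv)) (π-spec (proj₁ mv) i)
  ... | i , inj₂ (a , b) = Rev.fa-from (mkArc u v pu) arc₀ (proj₁ mv , trans (cong (ap (proj₁ mv)) (sym b)) (sym (cong proj₁ c)) , trans (cong (ap (proj₁ mv)) (sym a)) (sym (cong proj₂ c)))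
    where
    mv = move-edge i i0 true
    c : e E i0 ≡ orient true (map-pair (ap (proj₁ mv)) (ep i))
    c = subst₂ (λ z w → e E z ≡ orient w (map-pair (ap (proj₁ mv)) (ep i))) (proj₁ (proj₂ mv)) (proj₂ (proj₂ mv)) (π-spec (proj₁ mv) i)

  arcClass< : ∀ d d' pf → arcClass d d' pf ℕ.< suc s ℕ.+ k'
  arcClass< (inj₁ u) (inj₁ v) pf = NP.+-monoʳ-< (suc s) (FP.toℕ<n _)
  arcClass< (inj₁ u) (inj₂ z) pf = NP.≤-trans (s≤s (arcClass-path-≤ (inj₁ u) (inj₂ z) pf _)) (NP.m≤m+n (suc s) k')
  arcClass< (inj₂ z) (inj₁ u) pf = NP.≤-trans (s≤s (arcClass-path-≤ (inj₂ z) (inj₁ u) pf _)) (NP.m≤m+n (suc s) k')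
  arcClass< (inj₂ z) (inj₂ z') pf = NP.≤-trans (s≤s (arcClass-path-≤ (inj₂ z) (inj₂ z') pf _)) (NP.m≤m+n (suc s) k')

  Ma≡ : 4 ℕ.* suc t' ℕ.+ suc k' ≡ suc s ℕ.+ k'
  Ma≡ = NS.+-*-Solver.solve 2 (λ x y → con 4 :* (con 1 :+ x) :+ (con 1 :+ y) := (con 5 :+ con 4 :* x) :+ y) refl t' k'
    where open NS.+-*-Solver

  encArc : ∀ d d' → T (AD d d') → Arc G1
  encArc d d' p = (enc d , enc d') , subst₂ (λ a b → T (AD a b)) (sym (dec-enc d)) (sym (dec-enc d')) p

  original-arc-of-index : (f : Arc G → Fin (suc k')) (rep : Fin (suc k') → Arc G) → (∀ c → f (rep c) ≡ c) →
    (∀ u v p → inE G E s u v ≡ true → f (mkArc u v p) ≡ f arc₀) →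
    (f₀≢ : ∀ u v (p : T (A u v ∧ not (inE G E s u v))) → f arc₀ ≢ f (mkArc u v (T∧₁ p))) →
    ∀ x → Σ V λ u → Σ V λ v → Σ (T (A u v ∧ not (inE G E s u v))) λ p → F.punchOut (f₀≢ u v p) ≡ x
  original-arc-of-index f rep rep-class inE⇒f₀ f₀≢ x =
    u , v , p , trans (FP.punchOut-cong (f arc₀) (trans (cong (λ q → f (mkArc u v q)) (BP.T-irrelevant _ _)) (rep-class c))) (FP.punchOut-punchIn (f arc₀))
    where
    c = F.punchIn (f arc₀) x
    u = proj₁ (proj₁ (rep c))
    v = proj₂ (proj₁ (rep c))
    p = original-arc u v (proj₂ (rep c)) (not-true→false (λ q → FP.punchInᵢ≢i (f arc₀) x (trans (sym (rep-class c)) (inE⇒f₀ u v (proj₂ (rep c)) q))))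

  original-arc-above : ∀ b c → b ℕ.≤ c → c ℕ.< b ℕ.+ k' → (f : Arc G → Fin (suc k')) (rep : Fin (suc k') → Arc G) → (∀ c → f (rep c) ≡ c) →
    (∀ u v p → inE G E s u v ≡ true → f (mkArc u v p) ≡ f arc₀) →
    (f₀≢ : ∀ u v (p : T (A u v ∧ not (inE G E s u v))) → f arc₀ ≢ f (mkArc u v (T∧₁ p))) →
    Σ V λ u → Σ V λ v → Σ (T (A u v ∧ not (inE G E s u v))) λ p → b ℕ.+ toℕ (F.punchOut (f₀≢ u v p)) ≡ c
  original-arc-above b c b≤c c<b+k' f rep rep-class inE⇒f₀ f₀≢ =
    let (u , v , p , idx) = original-arc-of-index f rep rep-class inE⇒f₀ f₀≢ (F.fromℕ< c∸b<k')
    in u , v , p , trans (cong (λ z → b ℕ.+ toℕ z) idx) (trans (cong (b ℕ.+_) (FP.toℕ-fromℕ< c∸b<k')) (NP.m+[n∸m]≡n b≤c))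
    where
    c∸b<k' : c ℕ.∸ b ℕ.< k'
    c∸b<k' = NP.+-cancelˡ-< b _ _ (subst (ℕ._< b ℕ.+ k') (sym (NP.m+[n∸m]≡n b≤c)) c<b+k')

  arcClass₁ : Arc G1 → ℕ
  arcClass₁ ((w1 , w2) , pf) = arcClass (dec w1) (dec w2) pf

  arcClass₁-surjective : ∀ c → c ℕ.< suc s ℕ.+ k' → Σ (Arc G1) (λ a → arcClass₁ a ≡ c)
  arcClass₁-surjective c lt with c ℕ.≤? s
  ... | yes c≤s = encArc (pos i0 c) (pos i0 (suc c)) (pos-adj i0 c c≤s) , arcClass-forward i0 c c≤s _ _ _ (dec-enc _) (dec-enc _)
  ... | no c≰s =
    let (u , v , p , q) = original-arc-above (suc s) c (NP.≰⇒> c≰s) lt Rev.fa Rev.arcRep Rev.arcRep-class inE⇒arcClass₀ arcClass₀≢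
    in encArc (inj₁ u) (inj₁ v) p , trans (arcClass-cong _ (inj₁ u) _ (inj₁ v) _ p (dec-enc (inj₁ u)) (dec-enc (inj₁ v))) q

  arcClass₁≡⇒ARel₁ : ∀ a b → arcClass₁ a ≡ arcClass₁ b → ARel G1 a b
  arcClass₁≡⇒ARel₁ ((w1 , w2) , pf) ((w3 , w4) , pf') q = act⇒ARel₁ w1 w2 w3 w4 (arcClass≡⇒act (dec w1) (dec w2) pf (dec w3) (dec w4) pf' q)

  ARel₁⇒arcClass₁≡ : ∀ a b → ARel G1 a b → arcClass₁ a ≡ arcClass₁ b
  ARel₁⇒arcClass₁≡ ((w1 , w2) , pf) ((w3 , w4) , pf') r =
    let (σ , q1 , q2) = ARel₁⇒act w1 w2 w3 w4 r in sym (arcClass-act σ (dec w1) (dec w2) pf (dec w3) (dec w4) pf' q1 q2)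

  Oa₁ : Oa G1 (4 ℕ.* suc t' ℕ.+ suc k')
  Oa₁ = subst (Oa G1) (sym Ma≡) (numClasses-from (Arc G1) (ARel G1) _ arcClass₁ (λ ((w1 , w2) , pf) → arcClass< (dec w1) (dec w2) pf)
          arcClass₁-surjective arcClass₁≡⇒ARel₁ ARel₁⇒arcClass₁≡)

  E0 : ℕ
  E0 = suc (suc (suc (2 ℕ.* t')))

  -- Identifies the classes r and s − r of the two orientations of a path edge.
  fold : ℕ → ℕ
  fold c = c ⊓ (s ℕ.∸ c)

  edgeClass : (d d' : D) → T (AD d d') → ℕ
  edgeClass (inj₁ u) (inj₁ v) pf = E0 ℕ.+ toℕ (originalEdgeIndex u v pf)
  edgeClass (inj₁ u) (inj₂ z) pf = fold (arcClass (inj₁ u) (inj₂ z) pf)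
  edgeClass (inj₂ z) (inj₁ u) pf = fold (arcClass (inj₂ z) (inj₁ u) pf)
  edgeClass (inj₂ z) (inj₂ z') pf = fold (arcClass (inj₂ z) (inj₂ z') pf)

  edgeClass-path : ∀ d d' pf → IsPathArc d d' → edgeClass d d' pf ≡ fold (arcClass d d' pf)
  edgeClass-path (inj₁ u) (inj₁ v) pf ()
  edgeClass-path (inj₁ u) (inj₂ z) pf _ = refl
  edgeClass-path (inj₂ z) (inj₁ u) pf _ = refl
  edgeClass-path (inj₂ z) (inj₂ z') pf _ = refl

  fold-reflect : ∀ c → c ℕ.≤ s → fold (s ℕ.∸ c) ≡ fold c
  fold-reflect c le = trans (cong ((s ℕ.∸ c) ⊓_) (NP.m∸[m∸n]≡n le)) (NP.⊓-comm (s ℕ.∸ c) c)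

  arcClass-reverse : ∀ d d' pf pf' → IsPathArc d d' → arcClass d' d pf' ≡ s ℕ.∸ arcClass d d' pf
  arcClass-reverse d d' pf pf' ip with path-arc-at d d' pf ip
  ... | i , r , le , inj₁ (dq , dq' , c) = trans (arcClass-backward i r le d' d pf' dq' dq) (cong (s ℕ.∸_) (sym c))
  ... | i , r , le , inj₂ (dq , dq' , c) = trans (arcClass-forward i r le d' d pf' dq' dq) (trans (sym (NP.m∸[m∸n]≡n le)) (cong (s ℕ.∸_) (sym c)))

  AD-sym : ∀ d d' → AD d d' ≡ AD d' d
  AD-sym (inj₁ u) (inj₁ v) = cong₂ (λ a b → a ∧ not b) (A-sym u v) (bool-iff (inE-sym u v) (inE-sym v u))
  AD-sym (inj₁ u) (inj₂ z) = refl
  AD-sym (inj₂ z) (inj₁ u) = refl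
  AD-sym (inj₂ (i , j)) (inj₂ (i' , j')) = cong₂ _∧_ (≡ᵇ-sym (toℕ i) (toℕ i')) (BP.∨-comm (suc (toℕ j) ℕ.≡ᵇ toℕ j') (suc (toℕ j') ℕ.≡ᵇ toℕ j))

  edgeClass-sym : ∀ d d' pf pf' → edgeClass d' d pf' ≡ edgeClass d d' pf
  edgeClass-sym (inj₁ u) (inj₁ v) pf pf' = cong (λ z → E0 ℕ.+ toℕ z) (FP.punchOut-cong edgeClass₀ (sym (Rev.fe-from (mkArc u v (T∧₁ pf)) (mkArc v u (T∧₁ pf')) (Rev.id-aut , inj₂ (refl , refl)))))
  edgeClass-sym (inj₁ u) (inj₂ z) pf pf' = trans (cong fold (arcClass-reverse (inj₁ u) (inj₂ z) pf pf' _)) (fold-reflect _ (arcClass-path-≤ (inj₁ u) (inj₂ z) pf _))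
  edgeClass-sym (inj₂ z) (inj₁ u) pf pf' = trans (cong fold (arcClass-reverse (inj₂ z) (inj₁ u) pf pf' _)) (fold-reflect _ (arcClass-path-≤ (inj₂ z) (inj₁ u) pf _))
  edgeClass-sym (inj₂ z) (inj₂ z') pf pf' = trans (cong fold (arcClass-reverse (inj₂ z) (inj₂ z') pf pf' _)) (fold-reflect _ (arcClass-path-≤ (inj₂ z) (inj₂ z') pf _))

  edgeClass-act : ∀ σ d d' pf e' e'' pf' → act σ d ≡ e' → act σ d' ≡ e'' → edgeClass e' e'' pf' ≡ edgeClass d d' pf
  edgeClass-act σ (inj₁ u) (inj₁ v) pf (inj₁ u') (inj₁ v') pf' q q' =
    cong (λ z → E0 ℕ.+ toℕ z) (FP.punchOut-cong edgeClass₀ (sym (Rev.fe-from (mkArc u v (T∧₁ pf)) (mkArc u' v' (T∧₁ pf')) (σ , inj₁ (inj₁-injective q , inj₁-injective q')))))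
  edgeClass-act σ (inj₁ u) (inj₁ v) pf (inj₁ u') (inj₂ _) pf' q ()
  edgeClass-act σ (inj₁ u) (inj₁ v) pf (inj₂ _) _ pf' () q'
  edgeClass-act σ (inj₁ u) (inj₂ z) pf (inj₁ u') (inj₂ z') pf' q q' = cong fold (arcClass-act σ _ _ pf _ _ pf' q q')
  edgeClass-act σ (inj₁ u) (inj₂ z) pf (inj₁ u') (inj₁ _) pf' q ()
  edgeClass-act σ (inj₁ u) (inj₂ z) pf (inj₂ _) _ pf' () q'
  edgeClass-act σ (inj₂ z) (inj₁ u) pf (inj₂ z') (inj₁ u') pf' q q' = cong fold (arcClass-act σ _ _ pf _ _ pf' q q')
  edgeClass-act σ (inj₂ z) (inj₁ u) pf (inj₂ z') (inj₂ _) pf' q ()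
  edgeClass-act σ (inj₂ z) (inj₁ u) pf (inj₁ _) _ pf' () q'
  edgeClass-act σ (inj₂ z) (inj₂ z'') pf (inj₂ z') (inj₂ z3) pf' q q' = cong fold (arcClass-act σ _ _ pf _ _ pf' q q')
  edgeClass-act σ (inj₂ z) (inj₂ z'') pf (inj₂ z') (inj₁ _) pf' q ()
  edgeClass-act σ (inj₂ z) (inj₂ z'') pf (inj₁ _) _ pf' () q'

  s≡ : s ≡ suc (suc (suc (suc (2 ℕ.* t' ℕ.+ 2 ℕ.* t'))))
  s≡ = cong (λ z → suc (suc (suc (suc z)))) (NS.+-*-Solver.solve 1 (λ x → con 4 :* x := con 2 :* x :+ con 2 :* x) refl t')
    where open NS.+-*-Solver

  fold-bound : ∀ c → c ℕ.≤ s → fold c ℕ.≤ suc (suc (2 ℕ.* t'))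
  fold-bound c le with fold c ℕ.≤? suc (suc (2 ℕ.* t'))
  ... | yes p = p
  ... | no np = ⊥-elim (NP.<-irrefl refl (NP.≤-trans big (NP.≤-reflexive (trans (NP.m+[n∸m]≡n le) s≡))))
    where
    ge : suc (suc (suc (2 ℕ.* t'))) ℕ.≤ fold c
    ge = NP.≰⇒> np
    big : suc (suc (suc (suc (suc (2 ℕ.* t' ℕ.+ 2 ℕ.* t'))))) ℕ.≤ c ℕ.+ (s ℕ.∸ c)
    eqE : E0 ℕ.+ E0 ≡ suc (suc (suc (suc (suc (suc (2 ℕ.* t' ℕ.+ 2 ℕ.* t'))))))
    eqE = NS.+-*-Solver.solve 1 (λ x → (con 3 :+ con 2 :* x) :+ (con 3 :+ con 2 :* x) := con 6 :+ (con 2 :* x :+ con 2 :* x)) refl t'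
      where open NS.+-*-Solver
    big = NP.≤-trans (NP.n≤1+n _) (NP.≤-trans (NP.≤-reflexive (sym eqE)) (NP.+-mono-≤ (NP.≤-trans ge (NP.m⊓n≤m _ _)) (NP.≤-trans ge (NP.m⊓n≤n _ _))))

  fold-small : ∀ c → c ℕ.≤ suc (suc (2 ℕ.* t')) → fold c ≡ c
  fold-small c le = NP.m≤n⇒m⊓n≡m (NP.≮⇒≥ λ lt → NP.<-irrefl refl (NP.≤-trans (s≤s (NP.≤-reflexive (sym (NP.m+[n∸m]≡n cs)))) (NP.≤-trans (NP.+-monoʳ-< c lt) (NP.≤-trans (NP.+-mono-≤ le le) (NP.≤-reflexive eq2)))))
    where
    cs : c ℕ.≤ s
    cs = NP.≤-trans le (NP.≤-trans (s≤s (s≤s (NP.*-monoˡ-≤ t' {2} {4} (s≤s (s≤s z≤n))))) (NP.≤-trans (NP.n≤1+n _) (NP.n≤1+n _)))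
    eq2 : suc (suc (2 ℕ.* t')) ℕ.+ suc (suc (2 ℕ.* t')) ≡ s
    eq2 = NS.+-*-Solver.solve 1 (λ x → (con 2 :+ con 2 :* x) :+ (con 2 :+ con 2 :* x) := con 4 :+ con 4 :* x) refl t'
      where open NS.+-*-Solver

  fold≡⇒ : ∀ c c' → c ℕ.≤ s → c' ℕ.≤ s → fold c ≡ fold c' → c' ≡ c ⊎ c' ≡ s ℕ.∸ c
  fold≡⇒ c c' le le' q with NP.⊓-sel c (s ℕ.∸ c) | NP.⊓-sel c' (s ℕ.∸ c')
  ... | inj₁ a | inj₁ b = inj₁ (trans (sym b) (trans (sym q) a))
  ... | inj₁ a | inj₂ b = inj₂ (trans (sym (NP.m∸[m∸n]≡n le')) (cong (s ℕ.∸_) (trans (sym b) (trans (sym q) a))))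
  ... | inj₂ a | inj₁ b = inj₂ (trans (sym b) (trans (sym q) a))
  ... | inj₂ a | inj₂ b = inj₁ (trans (sym (NP.m∸[m∸n]≡n le')) (trans (cong (s ℕ.∸_) (trans (sym b) (trans (sym q) a))) (NP.m∸[m∸n]≡n le)))

  SameEdgeUnder : D → D → D → D → Set
  SameEdgeUnder d1 d2 d3 d4 = Σ (Aut G) (λ σ → ((act σ d1 ≡ d3) × (act σ d2 ≡ d4)) ⊎ ((act σ d1 ≡ d4) × (act σ d2 ≡ d3)))

  edgeClass≡⇒act : ∀ d1 d2 pf d3 d4 pf' → edgeClass d1 d2 pf ≡ edgeClass d3 d4 pf' → SameEdgeUnder d1 d2 d3 d4
  edgeClass≡⇒act d1 d2 pf d3 d4 pf' q with IsPathArc? d1 d2 | IsPathArc? d3 d4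
  ... | inj₁ ip | inj₁ ip' with fold≡⇒ (arcClass d1 d2 pf) (arcClass d3 d4 pf') (arcClass-path-≤ d1 d2 pf ip) (arcClass-path-≤ d3 d4 pf' ip')
                                (trans (sym (edgeClass-path d1 d2 pf ip)) (trans q (edgeClass-path d3 d4 pf' ip')))
  ...   | inj₁ c' = let r = arcClass≡⇒act d1 d2 pf d3 d4 pf' (sym c') in proj₁ r , inj₁ (proj₂ r)
  ...   | inj₂ c' = let r = arcClass≡⇒act d2 d1 pf'' d3 d4 pf' (trans (arcClass-reverse d1 d2 pf pf'' ip) (sym c')) in proj₁ r , inj₂ (proj₂ (proj₂ r) , proj₁ (proj₂ r))
    where
    pf'' : T (AD d2 d1)
    pf'' = subst T (AD-sym d1 d2) pf
  edgeClass≡⇒act .(inj₁ u) .(inj₁ v) pf .(inj₁ u') .(inj₁ v') pf' q | inj₂ (u , v , refl , refl) | inj₂ (u' , v' , refl , refl)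
    with Rev.fe-to (mkArc u v (T∧₁ pf)) (mkArc u' v' (T∧₁ pf')) (FP.punchOut-injective (edgeClass₀≢ u v pf) (edgeClass₀≢ u' v' pf') (FP.toℕ-injective (NP.+-cancelˡ-≡ E0 _ _ q)))
  ... | σ , inj₁ (a , b) = σ , inj₁ (cong inj₁ a , cong inj₁ b)
  ... | σ , inj₂ (a , b) = σ , inj₂ (cong inj₁ a , cong inj₁ b)
  edgeClass≡⇒act d1 d2 pf .(inj₁ u') .(inj₁ v') pf' q | inj₁ ip | inj₂ (u' , v' , refl , refl) =
    ⊥-elim (NP.<-irrefl refl (NP.≤-trans (NP.m≤m+n E0 _) (NP.≤-trans (NP.≤-reflexive (sym q)) (NP.≤-trans (NP.≤-reflexive (edgeClass-path d1 d2 pf ip)) (fold-bound _ (arcClass-path-≤ d1 d2 pf ip))))))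
  edgeClass≡⇒act .(inj₁ u) .(inj₁ v) pf d3 d4 pf' q | inj₂ (u , v , refl , refl) | inj₁ ip' =
    ⊥-elim (NP.<-irrefl refl (NP.≤-trans (NP.m≤m+n E0 _) (NP.≤-trans (NP.≤-reflexive q) (NP.≤-trans (NP.≤-reflexive (edgeClass-path d3 d4 pf' ip')) (fold-bound _ (arcClass-path-≤ d3 d4 pf' ip'))))))

  edgeClass< : ∀ d d' pf → edgeClass d d' pf ℕ.< E0 ℕ.+ k'
  edgeClass< (inj₁ u) (inj₁ v) pf = NP.+-monoʳ-< E0 (FP.toℕ<n _)
  edgeClass< (inj₁ u) (inj₂ z) pf = NP.≤-trans (s≤s (fold-bound _ (arcClass-path-≤ (inj₁ u) (inj₂ z) pf _))) (NP.m≤m+n E0 k')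
  edgeClass< (inj₂ z) (inj₁ u) pf = NP.≤-trans (s≤s (fold-bound _ (arcClass-path-≤ (inj₂ z) (inj₁ u) pf _))) (NP.m≤m+n E0 k')
  edgeClass< (inj₂ z) (inj₂ z') pf = NP.≤-trans (s≤s (fold-bound _ (arcClass-path-≤ (inj₂ z) (inj₂ z') pf _))) (NP.m≤m+n E0 k')

  Me≡ : 2 ℕ.* suc t' ℕ.+ suc k' ≡ E0 ℕ.+ k'
  Me≡ = NS.+-*-Solver.solve 2 (λ x y → con 2 :* (con 1 :+ x) :+ (con 1 :+ y) := (con 3 :+ con 2 :* x) :+ y) refl t' k'
    where open NS.+-*-Solver

  inE⇒edgeClass₀ : ∀ u v pu → inE G E s u v ≡ true → Rev.fe (mkArc u v pu) ≡ edgeClass₀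
  inE⇒edgeClass₀ u v pu q = Rev.fe-from (mkArc u v pu) arc₀ (Rev.ARel⇒ERel (mkArc u v pu) arc₀ (Rev.fa-to (mkArc u v pu) arc₀ (inE⇒arcClass₀ u v pu q)))

  edgeClass-cong : ∀ d1 d2 d1' d2' p p' → d1 ≡ d2 → d1' ≡ d2' → edgeClass d1 d1' p ≡ edgeClass d2 d2' p'
  edgeClass-cong d1 .d1 d1' .d1' p p' refl refl = cong (edgeClass d1 d1') (BP.T-irrelevant p p')

  edgeClass₁ : Arc G1 → ℕ
  edgeClass₁ ((w1 , w2) , pf) = edgeClass (dec w1) (dec w2) pf

  edgeClass₁-surjective : ∀ c → c ℕ.< E0 ℕ.+ k' → Σ (Arc G1) (λ a → edgeClass₁ a ≡ c)
  edgeClass₁-surjective c lt with c ℕ.≤? suc (suc (2 ℕ.* t'))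
  ... | yes c≤ = encArc (pos i0 c) (pos i0 (suc c)) (pos-adj i0 c c≤s) ,
                 trans (edgeClass-path _ _ _ path) (trans (cong fold (arcClass-forward i0 c c≤s _ _ _ (dec-enc _) (dec-enc _))) (fold-small c c≤))
    where
    c<s : c ℕ.< s
    c<s = NP.≤-<-trans c≤ half<s
    c≤s : c ℕ.≤ s
    c≤s = NP.<⇒≤ c<s
    path : IsPathArc (dec (enc (pos i0 c))) (dec (enc (pos i0 (suc c))))
    path = subst (IsPathArc _) (sym (trans (dec-enc _) (pos-internal i0 c c<s))) (IsPathArc-internalʳ _ _)
  ... | no c≰ =
    let (u , v , p , q) = original-arc-above E0 c (NP.≰⇒> c≰) lt Rev.fe Rev.edgeRep Rev.edgeRep-class inE⇒edgeClass₀ edgeClass₀≢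
    in encArc (inj₁ u) (inj₁ v) p , trans (edgeClass-cong _ (inj₁ u) _ (inj₁ v) _ p (dec-enc (inj₁ u)) (dec-enc (inj₁ v))) q

  edgeClass₁≡⇒ERel₁ : ∀ a b → edgeClass₁ a ≡ edgeClass₁ b → ERel G1 a b
  edgeClass₁≡⇒ERel₁ ((w1 , w2) , pf) ((w3 , w4) , pf') q with edgeClass≡⇒act (dec w1) (dec w2) pf (dec w3) (dec w4) pf' q
  ... | σ , inj₁ (q1 , q2) = lift σ , inj₁ (trans (cong enc q1) (enc-dec w3) , trans (cong enc q2) (enc-dec w4))
  ... | σ , inj₂ (q1 , q2) = lift σ , inj₂ (trans (cong enc q1) (enc-dec w4) , trans (cong enc q2) (enc-dec w3))

  ERel₁⇒edgeClass₁≡ : ∀ a b → ERel G1 a b → edgeClass₁ a ≡ edgeClass₁ b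
  ERel₁⇒edgeClass₁≡ ((w1 , w2) , pf) ((w3 , w4) , pf') (τ , inj₁ (q1 , q2)) =
    let (σ , r1 , r2) = ARel₁⇒act w1 w2 w3 w4 (τ , q1 , q2) in sym (edgeClass-act σ (dec w1) (dec w2) pf (dec w3) (dec w4) pf' r1 r2)
  ERel₁⇒edgeClass₁≡ ((w1 , w2) , pf) ((w3 , w4) , pf') (τ , inj₂ (q1 , q2)) =
    let (σ , r1 , r2) = ARel₁⇒act w1 w2 w4 w3 (τ , q1 , q2)
    in trans (sym (edgeClass-act σ (dec w1) (dec w2) pf (dec w4) (dec w3) pf'' r1 r2)) (edgeClass-sym (dec w3) (dec w4) pf' pf'')
    where
    pf'' : T (AD (dec w4) (dec w3))
    pf'' = subst T (AD-sym (dec w3) (dec w4)) pf'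

  Oe₁ : Oe G1 (2 ℕ.* suc t' ℕ.+ suc k')
  Oe₁ = subst (Oe G1) (sym Me≡) (numClasses-from (Arc G1) (ERel G1) _ edgeClass₁ (λ ((w1 , w2) , pf) → edgeClass< (dec w1) (dec w2) pf)
          edgeClass₁-surjective edgeClass₁≡⇒ERel₁ ERel₁⇒edgeClass₁≡)

open import Data.Nat using (_+_; _*_; _≤_)

lemma7 : (G : Graph) → IsSimple G → IsNut G → VertexTransitive G →
    (k : ℕ) → Oe G k → Oa G k →
    (E : EdgeOrbit G) → (t : ℕ) → 1 ≤ t →
    IsNut (subdivide G E (4 * t)) ×
    Ov (subdivide G E (4 * t)) (2 * t + 1) ×
    Oe (subdivide G E (4 * t)) (2 * t + k) ×
    Oa (subdivide G E (4 * t)) (4 * t + k)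
lemma7 G simp nut vt zero oe oa E t _ = ⊥-elim (FP.¬Fin0 (proj₁ oe (e E (nonempty E) , e-edge E (nonempty E))))
lemma7 G simp nut vt (suc k') oe oa E (suc t') _ =
  subst Claim (sym (NP.*-suc 4 t')) (Kernel.isNut₁ nut , Ov₁ , Oe₁ , Oa₁)
  where
  open Subdivision G simp E t' using (module Kernel)
  open Orbits G simp nut vt k' oe oa E t' using (Ov₁; Oe₁; Oa₁)
  Claim : ℕ → Set
  Claim s = IsNut (subdivide G E s) × Ov (subdivide G E s) (2 * suc t' + 1) ×
            Oe (subdivide G E s) (2 * suc t' + suc k') × Oa (subdivide G E s) (4 * suc t' + suc k')
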